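{- Let $n\ge 1$ and let $A\in\mathcal{A}_{n,1}^{+}\cup\mathcal{A}_{n,1}^{0}$. Let $k$ be the index of the opening row of $A$, let $j$ be the index of the opening column of $A$, and let $P=(p_{uv})=\delta(A)$. Then: (1) $P$ is a permutation matrix; (2) rows $1$ to $k$ (inclusive) of $A$ and of $P$ coincide; in particular $r(A)=r(P)$; (3) if $p_{kj'}=1$ and $p_{k+1,m}=1$, then $m<j'$; (4) $\ell(A)=\ell(P)$, where $\ell(P)$ denotes the sum of the entries of $P$ lying strictly below row $k$ and strictly between columns $m$ and $j'$ (with $m,j'$ as in (3)); (5) $c(A)+E(A)<x(A)=x(P)$, where $x(A)$ (resp. $x(P)$) denotes the sum of the entries of $A$ (resp. of $P$) lying strictly below row $k$ and strictly to the right of column $j$; (6) $i(A)=i(P)+c(A)+1+E(A)$.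
   Context: An alternating sign matrix (ASM) of order $n$ is an $n\times n$ matrix $A=(a_{uv})$ with entries in $\{1,0,-1\}$ such that in every row and every column the nonzero entries alternate in sign, beginning and ending with $1$. Rows are numbered $1,\dots,n$ from top to bottom and columns $1,\dots,n$ from left to right; "below" means larger row index. $\mathcal{A}_{n,s}$ denotes the set of order-$n$ ASMs with exactly $s$ entries equal to $-1$ (so $\mathcal{A}_{n,0}$ is the set of $n\times n$ permutation matrices). For an ASM $A$: $r(A)$ is the number of entries of the first row lying to the left of its unique $1$; $i(A)=\sum_{u,v}a_{uv}\sum_{u'>u,\,v'<v}a_{u'v'}$; and $\overline{A}=(a_{u,n+1-v})$ is its vertical reflection. For $A\in\mathcal{A}_{n,1}$: the opening column is the column containing the $-1$; the opening row is the row of the highest $1$ in the opening column; the closing row is the row of the $-1$. The left side (resp. right side) consists of the columns strictly to the left (resp. right) of the opening column. The closing row contains exactly two $1$'s, one in each side; the one in the right side is the closing $1$, and its column is the closing column. The enclosed rows are the rows strictly between the opening row and the closing row. $A$ is neutral if there are no enclosed rows; otherwise $A$ is positive (resp. negative) if the $1$ of the lowest enclosed row lies in the right (resp. left) side. $\mathcal{A}_{n,1}^{+},\mathcal{A}_{n,1}^{0},\mathcal{A}_{n,1}^{ - }$ denote the sets of positive, neutral, negative elements. For $A\in\mathcal{A}_{n,1}^{+}\cup\mathcal{A}_{n,1}^{0}$: the charged cell is the submatrix formed by the enclosed rows and the right-side columns; the extended neutral cell is the submatrix formed by the rows from the opening row to the closing row (inclusive) and the left-side columns. The leading $1$ is the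 highest $1$ in the left side strictly below the opening row, and its column is the leading column; the leading cell consists of the entries strictly below the opening row and strictly between the leading column and the opening column, and $\ell(A)$ is their sum. The closing cell consists of the entries strictly below the closing row and strictly between the opening column and the closing column, and $c(A)$ is their sum; the extended closing cell consists of the entries strictly below the closing row in the columns from the opening column to the closing column inclusive. $E(A)$ is the sum of the entries of the charged cell if $A$ is positive, and $E(A)=0$ if $A$ is neutral. Horizontal displacement $H$: for an $m\times p$ $(0,1)$-matrix $Q$ whose nonzero columns are $j_1<\dots<j_t$ with $j_1=1$ and $j_t<p$, $H(Q)$ is obtained by moving the entries of column $j_i$ into column $j_{i+1}$ for $1\le i\le t$ (where $j_{t+1}=p$) and replacing column $1$ by zeros. Vertical displacement $V$: for an $m\times p$ $(0,1)$-matrix $Q$ whose first row is zero and whose last row is nonzero, with nonzero rows $i_1<\dots<i_t$ (so $i_t=m$), $V(Q)$ is obtained by moving row $i_s$ into row $i_{s-1}$ for $1\le s\le t$ (where $i_0=1$) and replacing row $m$ by zeros. Partial discharging procedure: for $A\in\mathcal{A}_{n,1}^{+}\cup\mathcal{A}_{n,1}^{0}$, $\delta(A)$ is obtained from $A$ by successively: (1) replacing the $-1$ and the closing $1$ by $0$; (2) replacing the extended closing cell by its image under $H$; (3) replacing the extended neutral cell by its image under $V$; (4) moving every $1$ lying in the extended neutral cell or in the charged cell down by one row within its column (vacated positions becoming $0$). Here all cells refer to the positions they occupy in $A$. -}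

module Defs where

open import Data.Nat as ℕ using (ℕ; zero; suc; _+_; _∸_; _<ᵇ_; _≤ᵇ_; _≡ᵇ_; _<?_)
open import Data.Integer as ℤ using (ℤ; 0ℤ; 1ℤ; -1ℤ)
open import Data.Fin as Fin using (Fin; toℕ; fromℕ<)
open import Data.Fin.Permutation using (Permutation′; _⟨$⟩ʳ_)
open import Data.List using (List; []; _∷_; map; filter; length; takeWhile; upTo; allFin)
open import Data.Nat.ListAction using (sum)
open import Data.Bool using (Bool; true; false; if_then_else_; _∧_; _∨_; not)
open import Data.Product using (Σ; ∃; _×_; _,_)
open import Data.Sum using (_⊎_)
open import Relation.Nullary using (does; ¬?; yes; no)
open import Relation.Binary.PropositionalEquality using (_≡_)

-- Matrices.  An n×n matrix is a function Fin n → Fin n → ℤ.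
-- Indices are 0-based internally: row/column "u" of the paper is u-1 here.
-- For index arithmetic we use the extension by zero to ℕ × ℕ.

Matrix : ℕ → Set
Matrix n = Fin n → Fin n → ℤ

ℕMat : Set
ℕMat = ℕ → ℕ → ℤ

private
  liftCol : ∀ {n} → (Fin n → ℤ) → ℕ → ℤ
  liftCol {n} f v with v <? n
  ... | yes p = f (fromℕ< p)
  ... | no _  = 0ℤ

lift : ∀ {n} → Matrix n → ℕMat
lift {n} A u v with u <? n
... | yes p = liftCol (A (fromℕ< p)) v
... | no _  = 0ℤ

_==_ : ℤ → ℤ → Bool
x == y = does (x ℤ.≟ y)

sumFrom : ℕ → ℕ → (ℕ → ℤ) → ℤ
sumFrom lo zero    f = 0ℤ
sumFrom lo (suc d) f = f lo ℤ.+ sumFrom (suc lo) d f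

sumR : ℕ → ℕ → (ℕ → ℤ) → ℤ
sumR lo hi f = sumFrom lo (hi ∸ lo) f

rectSum : ℕMat → ℕ → ℕ → ℕ → ℕ → ℤ
rectSum M r0 r1 c0 c1 = sumR r0 r1 (λ u → sumR c0 c1 (λ v → M u v))

data Alternating : List ℤ → Set where
  alt-one  : Alternating (1ℤ ∷ [])
  alt-cons : ∀ {l} → Alternating l → Alternating (1ℤ ∷ -1ℤ ∷ l)

nonzeros : List ℤ → List ℤ
nonzeros = filter (λ x → ¬? (x ℤ.≟ 0ℤ))

rowList : ∀ {n} → Matrix n → Fin n → List ℤ
rowList {n} A u = map (A u) (allFin n)

colList : ∀ {n} → Matrix n → Fin n → List ℤ
colList {n} A v = map (λ u → A u v) (allFin n)

record IsASM {n : ℕ} (A : Matrix n) : Set where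
  field
    entries : ∀ u v → A u v ≡ 1ℤ ⊎ A u v ≡ 0ℤ ⊎ A u v ≡ -1ℤ
    rows    : ∀ u → Alternating (nonzeros (rowList A u))
    cols    : ∀ v → Alternating (nonzeros (colList A v))

negCount : ∀ {n} → Matrix n → ℕ
negCount {n} A = sum (map (λ u → length (filter (λ x → x ℤ.≟ -1ℤ) (rowList A u))) (allFin n))

InASM : (n s : ℕ) → Matrix n → Set
InASM n s A = IsASM A × negCount A ≡ s

IsPermutationMatrix : ∀ {n} → Matrix n → Set
IsPermutationMatrix {n} P =
  Σ (Permutation′ n) λ σ → ∀ u v → P u v ≡ (if does ((σ ⟨$⟩ʳ u) Fin.≟ v) then 1ℤ else 0ℤ)

r : (n : ℕ) → ℕMat → ℕ
r n M = length (takeWhile (λ x → ¬? (x ℤ.≟ 1ℤ)) (map (M 0) (upTo n)))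

inv : (n : ℕ) → ℕMat → ℤ
inv n M = sumR 0 n (λ u → sumR 0 n (λ v → M u v ℤ.* rectSum M (suc u) n 0 v))

-- Data of an element of 𝒜_{n,1} (0-based indices, lifted matrix Â = lift A):
--   j : opening column, c : closing row   (Â c j = -1)
--   k : opening row (highest 1 in column j)
--   q : closing column (right-side 1 of the closing row)

IsOpeningRow : ℕMat → (k j : ℕ) → Set
IsOpeningRow M k j = M k j ≡ 1ℤ × (∀ u → u ℕ.< k → M u j ≡ 1ℤ → Data.Empty.⊥)
  where import Data.Empty

IsNeutral : ℕMat → (k c j : ℕ) → Set
IsNeutral M k c j = ∀ u → k ℕ.< u → u ℕ.< c → Data.Empty.⊥
  where import Data.Empty

IsPositive : ℕMat → (k c j : ℕ) → Set
IsPositive M k c j = suc k ℕ.< c × ∃ λ v → j ℕ.< v × M (c ∸ 1) v ≡ 1ℤ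

IsLeadingColumn : ℕMat → (k j L : ℕ) → Set
IsLeadingColumn M k j L =
  L ℕ.< j × ∃ λ w → k ℕ.< w × M w L ≡ 1ℤ ×
    (∀ w' v' → k ℕ.< w' → w' ℕ.< w → v' ℕ.< j → M w' v' ≡ 1ℤ → Data.Empty.⊥)
  where import Data.Empty

ellStat : (n : ℕ) → ℕMat → (k L j : ℕ) → ℤ
ellStat n M k L j = rectSum M (suc k) n (suc L) j

closingStat : (n : ℕ) → ℕMat → (c j q : ℕ) → ℤ
closingStat n M c j q = rectSum M (suc c) n (suc j) q

chargeStat : (n : ℕ) → ℕMat → (k c j : ℕ) → ℤ
chargeStat n M k c j = if suc k ≡ᵇ c then 0ℤ else rectSum M (suc k) c (suc j) n

xStat : (n : ℕ) → ℕMat → (k j : ℕ) → ℤ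
xStat n M k j = rectSum M (suc k) n (suc j) n

anyFrom : (ℕ → Bool) → ℕ → ℕ → Bool
anyFrom P lo zero    = false
anyFrom P lo (suc d) = P lo ∨ anyFrom P (suc lo) d

anyR : (ℕ → Bool) → ℕ → ℕ → Bool
anyR P lo hi = anyFrom P lo (hi ∸ lo)

-- largest x ∈ [lo, lo+d) with P x ; default lo
searchDown : (ℕ → Bool) → ℕ → ℕ → ℕ
searchDown P lo zero    = lo
searchDown P lo (suc d) = if P (lo + d) then lo + d else searchDown P lo d

-- smallest x ∈ [lo, lo+d) with P x ; default lo+d
searchUp : (ℕ → Bool) → ℕ → ℕ → ℕ
searchUp P lo zero    = lo
searchUp P lo (suc d) = if P lo then lo else searchUp P (suc lo) d

module Discharge (n k c j q : ℕ) where

  step1 : ℕMat → ℕMat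
  step1 M u v = if (u ≡ᵇ c) ∧ ((v ≡ᵇ j) ∨ (v ≡ᵇ q)) then 0ℤ else M u v

  -- (2) horizontal displacement H on the extended closing cell:
  --     rows c < u < n, columns j ≤ v ≤ q.
  inECC : ℕ → ℕ → Bool
  inECC u v = (c <ᵇ u) ∧ (u <ᵇ n) ∧ (j ≤ᵇ v) ∧ (v ≤ᵇ q)

  nzCol : ℕMat → ℕ → Bool
  nzCol M v = anyR (λ u → not (M u v == 0ℤ)) (suc c) n

  prevNZ : ℕMat → ℕ → ℕ
  prevNZ M v = searchDown (nzCol M) j (v ∸ j)

  step2 : ℕMat → ℕMat
  step2 M u v =
    if inECC u v
    then (if (j <ᵇ v) ∧ ((v ≡ᵇ q) ∨ nzCol M v) then M u (prevNZ M v) else 0ℤ)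
    else M u v

  -- (3) vertical displacement V on the extended neutral cell:
  --     rows k ≤ u ≤ c, columns 0 ≤ v < j.
  inENC : ℕ → ℕ → Bool
  inENC u v = (k ≤ᵇ u) ∧ (u ≤ᵇ c) ∧ (v <ᵇ j)

  nzRow : ℕMat → ℕ → Bool
  nzRow M u = anyR (λ v → not (M u v == 0ℤ)) 0 j

  nextNZ : ℕMat → ℕ → ℕ
  nextNZ M u = searchUp (nzRow M) (suc u) (c ∸ suc u)

  step3 : ℕMat → ℕMat
  step3 M u v =
    if inENC u v
    then (if (u <ᵇ c) ∧ ((u ≡ᵇ k) ∨ nzRow M u) then M (nextNZ M u) v else 0ℤ)
    else M u v

  -- (4) move every 1 in the extended neutral cell or in the charged cell
  --     (rows k < u < c, columns j < v < n) down by one row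
  inCharged : ℕ → ℕ → Bool
  inCharged u v = (k <ᵇ u) ∧ (u <ᵇ c) ∧ (j <ᵇ v) ∧ (v <ᵇ n)

  inCell : ℕ → ℕ → Bool
  inCell u v = inENC u v ∨ inCharged u v

  vacate : ℕMat → ℕMat
  vacate M u v = if inCell u v ∧ (M u v == 1ℤ) then 0ℤ else M u v

  step4 : ℕMat → ℕMat
  step4 M zero    v = vacate M zero v
  step4 M (suc u) v = if inCell u v ∧ (M u v == 1ℤ) then 1ℤ else vacate M (suc u) v

  δℕ : ℕMat → ℕMat
  δℕ M = step4 (step3 (step2 (step1 M)))

δ : ∀ {n} → Matrix n → (k c j q : ℕ) → Matrix n
δ {n} A k c j q u v = Discharge.δℕ n k c j q (lift A) (toℕ u) (toℕ v)

-- Let ρ u be the column of the leftmost 1 of row u of A.  Every row other than the closing row c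
-- is the indicator row of ρ u, and row c is e_{ρ c} + e_q - e_j.  The four steps of δ can be
-- computed explicitly: δ(A) is the permutation matrix of a map ρδ that agrees with ρ on the rows
-- up to k, equals τ ∘ ρ below row c, where τ moves a column of the extended closing cell to the
-- next column receiving a displaced column, and in between rotates ρ cyclically on the segments
-- ending at the rows whose 1 lies in the left side.
--
-- All statistics are sums of entries over rectangles.  A rectangle sum of δ(A) that reaches from a
-- row ≤ k + 1 to the bottom equals the one of A, since both count the same values of ρ up to the
-- correction e_q - e_j of the closing row.  Inversions change in two places only: each rotation
-- removes one inversion per enclosed row whose 1 lies right of j, giving E(A), and the correction of
-- the closing row contributes c(A) + 1.

module Submission where

open import Defs
open import Data.Bool using (Bool; true; false; if_then_else_; _∧_; _∨_; not; T)
open import Data.Bool.Properties using (∧-zeroʳ; ∨-zeroʳ; ∧-identityʳ)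
open import Data.Empty using (⊥; ⊥-elim)
open import Data.Fin as Fin using (Fin; toℕ; fromℕ<)
import Data.Fin.Properties as Finₚ
open import Data.Fin.Permutation using (permutation)
open import Data.Integer as ℤ using (ℤ; 0ℤ; 1ℤ; -1ℤ; -_; _+_; _-_; _*_) renaming (_≤_ to _≤ℤ_; _<_ to _<ℤ_)
import Data.Integer.Properties as ℤₚ
open import Data.Integer.Tactic.RingSolver using (solve-∀)
open import Data.List as List using (List; []; _∷_; filter; length; take; tabulate)
import Data.List.Properties as Listₚ
open import Data.Nat as ℕ using (ℕ; zero; suc; _∸_; _≤_; _<_; z≤n; s≤s; _<ᵇ_; _≤ᵇ_; _≡ᵇ_)
open import Data.Nat.Induction using (<-wellFounded)
open import Data.Nat.ListAction using (sum)
import Data.Nat.Properties as ℕₚ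
open import Data.Product using (∃; _×_; _,_; proj₁; proj₂)
open import Data.Product.Properties using () renaming (≡-dec to ×-≡-dec)
open import Data.Sum using (_⊎_; inj₁; inj₂; [_,_]′)
open import Function using (_∘_; id)
open import Induction.WellFounded using (Acc; acc)
open import Level using (0ℓ)
open import Relation.Binary.Definitions using (tri<; tri≈; tri>)
open import Relation.Binary.PropositionalEquality
open import Relation.Nullary using (Dec; yes; no; does; proof; ¬?)
open import Relation.Nullary.Reflects using (Reflects; ofʸ; ofⁿ)
open import Relation.Unary using (Pred; Decidable)

true≢false : true ≢ false
true≢false ()

true⊎false : ∀ b → b ≡ true ⊎ b ≡ false
true⊎false true  = inj₁ refl
true⊎false false = inj₂ refl

-- ℕ._≟_ decides via _≡ᵇ_, so its proof component reflects _≡ᵇ_.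
≡ᵇ-reflects-≡ : ∀ m n → Reflects (m ≡ n) (m ≡ᵇ n)
≡ᵇ-reflects-≡ m n = proof (m ℕ.≟ n)

≡ᵇ-refl : ∀ m → (m ≡ᵇ m) ≡ true
≡ᵇ-refl zero    = refl
≡ᵇ-refl (suc m) = ≡ᵇ-refl m

≢⇒≡ᵇ≡false : ∀ {m n} → m ≢ n → (m ≡ᵇ n) ≡ false
≢⇒≡ᵇ≡false {m} {n} m≢n with m ≡ᵇ n | ≡ᵇ-reflects-≡ m n
... | true  | ofʸ m≡n = ⊥-elim (m≢n m≡n)
... | false | _       = refl

<⇒<ᵇ≡true : ∀ {m n} → m < n → (m <ᵇ n) ≡ true
<⇒<ᵇ≡true {m} {n} m<n with m <ᵇ n | ℕₚ.<ᵇ-reflects-< m n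
... | true  | _       = refl
... | false | ofⁿ m≮n = ⊥-elim (m≮n m<n)

≤⇒<ᵇ≡false : ∀ {m n} → n ≤ m → (m <ᵇ n) ≡ false
≤⇒<ᵇ≡false {m} {n} n≤m with m <ᵇ n | ℕₚ.<ᵇ-reflects-< m n
... | true  | ofʸ m<n = ⊥-elim (ℕₚ.<⇒≱ m<n n≤m)
... | false | _       = refl

≤⇒≤ᵇ≡true : ∀ {m n} → m ≤ n → (m ≤ᵇ n) ≡ true
≤⇒≤ᵇ≡true {m} {n} m≤n with m ≤ᵇ n | ℕₚ.≤ᵇ-reflects-≤ m n
... | true  | _       = refl
... | false | ofⁿ m≰n = ⊥-elim (m≰n m≤n)

<⇒≤ᵇ≡false : ∀ {m n} → n < m → (m ≤ᵇ n) ≡ false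
<⇒≤ᵇ≡false {m} {n} n<m with m ≤ᵇ n | ℕₚ.≤ᵇ-reflects-≤ m n
... | true  | ofʸ m≤n = ⊥-elim (ℕₚ.<⇒≱ n<m m≤n)
... | false | _       = refl

<ᵇ≡true⇒< : ∀ {m n} → (m <ᵇ n) ≡ true → m < n
<ᵇ≡true⇒< {m} {n} m<ᵇn = ℕₚ.<ᵇ⇒< m n (subst T (sym m<ᵇn) _)

<ᵇ≡false⇒≥ : ∀ {m n} → (m <ᵇ n) ≡ false → n ≤ m
<ᵇ≡false⇒≥ {m} {n} m≮ᵇn = ℕₚ.≮⇒≥ (λ m<n → true≢false (trans (sym (<⇒<ᵇ≡true m<n)) m≮ᵇn))

χ : Bool → ℤ
χ true  = 1ℤ
χ false = 0ℤ

χ-≡ᵇ : ∀ {m n} → m ≡ n → χ (m ≡ᵇ n) ≡ 1ℤ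
χ-≡ᵇ {m} refl rewrite ≡ᵇ-refl m = refl

χ-≢ᵇ : ∀ {m n} → m ≢ n → χ (m ≡ᵇ n) ≡ 0ℤ
χ-≢ᵇ m≢n rewrite ≢⇒≡ᵇ≡false m≢n = refl

χ-≡ᵇ⁻¹ : ∀ {m n} → χ (m ≡ᵇ n) ≡ 1ℤ → m ≡ n
χ-≡ᵇ⁻¹ {m} {n} eq with m ≡ᵇ n | ≡ᵇ-reflects-≡ m n
... | true  | ofʸ m≡n = m≡n
χ-≡ᵇ⁻¹ () | false | _

χ-nonneg : ∀ b → 0ℤ ≤ℤ χ b
χ-nonneg true  = ℤ.+≤+ z≤n
χ-nonneg false = ℤₚ.≤-refl

==⇒≡ : ∀ {x y} → (x == y) ≡ true → x ≡ y
==⇒≡ {x} {y} x==y with x ℤ.≟ y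
... | yes x≡y = x≡y
==⇒≡ () | no _

==-refl : ∀ x → (x == x) ≡ true
==-refl x with x ℤ.≟ x
... | yes _  = refl
... | no x≢x = ⊥-elim (x≢x refl)

1≢0 : 1ℤ ≢ 0ℤ
1≢0 ()

inRange : ℕ → ℕ → ℕ → Bool
inRange lo hi t = (lo ≤ᵇ t) ∧ (t <ᵇ hi)

lo<lo+suc : ∀ lo d → lo < lo ℕ.+ suc d
lo<lo+suc lo d = ℕₚ.m<m+n lo (s≤s z≤n)

private
  shrink : ∀ {lo d x} → suc lo ≤ x → x < suc lo ℕ.+ d → lo ≤ x × x < lo ℕ.+ suc d
  shrink {lo} {d} {x} p q = ℕₚ.≤-trans (ℕₚ.n≤1+n lo) p , subst (x <_) (sym (ℕₚ.+-suc lo d)) q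

sumFrom-cong : ∀ lo d {f g : ℕ → ℤ} → (∀ x → lo ≤ x → x < lo ℕ.+ d → f x ≡ g x) →
  sumFrom lo d f ≡ sumFrom lo d g
sumFrom-cong lo zero    f≗g = refl
sumFrom-cong lo (suc d) f≗g =
  cong₂ _+_ (f≗g lo ℕₚ.≤-refl (lo<lo+suc lo d))
            (sumFrom-cong (suc lo) d (λ x p q → let p′ , q′ = shrink p q in f≗g x p′ q′))

sumFrom-+ : ∀ lo d (f g : ℕ → ℤ) → sumFrom lo d (λ x → f x + g x) ≡ sumFrom lo d f + sumFrom lo d g
sumFrom-+ lo zero    f g = refl
sumFrom-+ lo (suc d) f g rewrite sumFrom-+ (suc lo) d f g =
  swap (f lo) (g lo) (sumFrom (suc lo) d f) (sumFrom (suc lo) d g)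
  where
  swap : ∀ a b s t → a + b + (s + t) ≡ a + s + (b + t)
  swap = solve-∀

sumFrom-neg : ∀ lo d (f : ℕ → ℤ) → sumFrom lo d (λ x → - f x) ≡ - sumFrom lo d f
sumFrom-neg lo zero    f = refl
sumFrom-neg lo (suc d) f rewrite sumFrom-neg (suc lo) d f = sym (ℤₚ.neg-distrib-+ (f lo) _)

sumFrom-++ : ∀ lo d₁ d₂ (f : ℕ → ℤ) →
  sumFrom lo (d₁ ℕ.+ d₂) f ≡ sumFrom lo d₁ f + sumFrom (lo ℕ.+ d₁) d₂ f
sumFrom-++ lo zero     d₂ f rewrite ℕₚ.+-identityʳ lo = sym (ℤₚ.+-identityˡ _)
sumFrom-++ lo (suc d₁) d₂ f rewrite sumFrom-++ (suc lo) d₁ d₂ f | ℕₚ.+-suc lo d₁ =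
  sym (ℤₚ.+-assoc (f lo) _ _)

sumFrom-shift : ∀ lo d (f : ℕ → ℤ) → sumFrom (suc lo) d f ≡ sumFrom lo d (f ∘ suc)
sumFrom-shift lo zero    f = refl
sumFrom-shift lo (suc d) f = cong (f (suc lo) +_) (sumFrom-shift (suc lo) d f)

sumFrom-const-0 : ∀ lo d → sumFrom lo d (λ _ → 0ℤ) ≡ 0ℤ
sumFrom-const-0 lo zero    = refl
sumFrom-const-0 lo (suc d) = trans (ℤₚ.+-identityˡ _) (sumFrom-const-0 (suc lo) d)

sumFrom-swap : ∀ a d b e (f : ℕ → ℕ → ℤ) →
  sumFrom a d (λ u → sumFrom b e (f u)) ≡ sumFrom b e (λ v → sumFrom a d (λ u → f u v))
sumFrom-swap a zero    b e f = sym (sumFrom-const-0 b e)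
sumFrom-swap a (suc d) b e f rewrite sumFrom-swap (suc a) d b e f =
  sym (sumFrom-+ b e (f a) (λ v → sumFrom (suc a) d (λ u → f u v)))

sumFrom-mono : ∀ lo d (f g : ℕ → ℤ) → (∀ x → lo ≤ x → x < lo ℕ.+ d → f x ≤ℤ g x) →
  sumFrom lo d f ≤ℤ sumFrom lo d g
sumFrom-mono lo zero    f g f≤g = ℤₚ.≤-refl
sumFrom-mono lo (suc d) f g f≤g =
  ℤₚ.+-mono-≤ (f≤g lo ℕₚ.≤-refl (lo<lo+suc lo d))
              (sumFrom-mono (suc lo) d f g (λ x p q → let p′ , q′ = shrink p q in f≤g x p′ q′))

sumFrom-nonzero : ∀ lo d (f : ℕ → ℤ) → sumFrom lo d f ≢ 0ℤ →
  ∃ λ x → lo ≤ x × x < lo ℕ.+ d × f x ≢ 0ℤ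
sumFrom-nonzero lo zero    f s≢0 = ⊥-elim (s≢0 refl)
sumFrom-nonzero lo (suc d) f s≢0 with f lo ℤ.≟ 0ℤ
... | no  flo≢0 = lo , ℕₚ.≤-refl , lo<lo+suc lo d , flo≢0
... | yes flo≡0 with sumFrom-nonzero (suc lo) d f (λ s≡0 → s≢0 (cong₂ _+_ flo≡0 s≡0))
...   | x , p , q , fx≢0 = let p′ , q′ = shrink p q in x , p′ , q′ , fx≢0

x<lo+[hi∸lo]⇒x<hi : ∀ lo hi x → lo ≤ x → x < lo ℕ.+ (hi ∸ lo) → x < hi
x<lo+[hi∸lo]⇒x<hi lo hi x lo≤x x<lo+d with lo ℕ.≤? hi
... | yes lo≤hi = subst (x <_) (ℕₚ.m+[n∸m]≡n lo≤hi) x<lo+d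
... | no  lo≰hi = ⊥-elim (ℕₚ.<⇒≱ x<lo+d (subst (_≤ x) lo≡lo+d lo≤x))
  where
  lo≡lo+d : lo ≡ lo ℕ.+ (hi ∸ lo)
  lo≡lo+d = sym (trans (cong (lo ℕ.+_) (ℕₚ.m≤n⇒m∸n≡0 (ℕₚ.<⇒≤ (ℕₚ.≰⇒> lo≰hi)))) (ℕₚ.+-identityʳ lo))

x<hi⇒x<lo+[hi∸lo] : ∀ lo hi x → lo ≤ x → x < hi → x < lo ℕ.+ (hi ∸ lo)
x<hi⇒x<lo+[hi∸lo] lo hi x lo≤x x<hi = subst (x <_) (sym (ℕₚ.m+[n∸m]≡n (ℕₚ.≤-trans lo≤x (ℕₚ.<⇒≤ x<hi)))) x<hi

sumR-cong : ∀ lo hi {f g : ℕ → ℤ} → (∀ x → lo ≤ x → x < hi → f x ≡ g x) → sumR lo hi f ≡ sumR lo hi g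
sumR-cong lo hi f≗g = sumFrom-cong lo (hi ∸ lo) (λ x p q → f≗g x p (x<lo+[hi∸lo]⇒x<hi lo hi x p q))

sumR-zero : ∀ lo hi (f : ℕ → ℤ) → (∀ x → lo ≤ x → x < hi → f x ≡ 0ℤ) → sumR lo hi f ≡ 0ℤ
sumR-zero lo hi f f≗0 = trans (sumR-cong lo hi f≗0) (sumFrom-const-0 lo (hi ∸ lo))

sumR-empty : ∀ lo hi (f : ℕ → ℤ) → hi ≤ lo → sumR lo hi f ≡ 0ℤ
sumR-empty lo hi f hi≤lo rewrite ℕₚ.m≤n⇒m∸n≡0 hi≤lo = refl

sumR-+ : ∀ lo hi (f g : ℕ → ℤ) → sumR lo hi (λ x → f x + g x) ≡ sumR lo hi f + sumR lo hi g
sumR-+ lo hi = sumFrom-+ lo (hi ∸ lo)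

sumR-- : ∀ lo hi (f g : ℕ → ℤ) → sumR lo hi (λ x → f x - g x) ≡ sumR lo hi f - sumR lo hi g
sumR-- lo hi f g = trans (sumR-+ lo hi f (λ x → - g x)) (cong (sumR lo hi f +_) (sumFrom-neg lo (hi ∸ lo) g))

sumR-split : ∀ lo mid hi (f : ℕ → ℤ) → lo ≤ mid → mid ≤ hi → sumR lo hi f ≡ sumR lo mid f + sumR mid hi f
sumR-split lo mid hi f lo≤mid mid≤hi = begin
  sumFrom lo (hi ∸ lo) f                                    ≡⟨ cong (λ d → sumFrom lo d f) lengths ⟩
  sumFrom lo ((mid ∸ lo) ℕ.+ (hi ∸ mid)) f                   ≡⟨ sumFrom-++ lo (mid ∸ lo) (hi ∸ mid) f ⟩
  sumR lo mid f + sumFrom (lo ℕ.+ (mid ∸ lo)) (hi ∸ mid) f   ≡⟨ cong (λ m → sumR lo mid f + sumFrom m (hi ∸ mid) f)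
                                                                      (ℕₚ.m+[n∸m]≡n lo≤mid) ⟩
  sumR lo mid f + sumR mid hi f                             ∎
  where
  open ≡-Reasoning
  lengths : hi ∸ lo ≡ (mid ∸ lo) ℕ.+ (hi ∸ mid)
  lengths = trans (cong (_∸ lo) (sym (ℕₚ.m+[n∸m]≡n mid≤hi))) (ℕₚ.+-∸-comm (hi ∸ mid) lo≤mid)

sumR-shift : ∀ lo hi (f : ℕ → ℤ) → sumR (suc lo) (suc hi) f ≡ sumR lo hi (f ∘ suc)
sumR-shift lo hi = sumFrom-shift lo (hi ∸ lo)

sumR-cons : ∀ lo hi (f : ℕ → ℤ) → lo < hi → sumR lo hi f ≡ f lo + sumR (suc lo) hi f
sumR-cons lo (suc hi) f (s≤s lo≤hi) rewrite ℕₚ.+-∸-assoc 1 lo≤hi = refl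

sumR-single : ∀ x (f : ℕ → ℤ) → sumR x (suc x) f ≡ f x
sumR-single x f =
  trans (sumR-cons x (suc x) f ℕₚ.≤-refl)
        (trans (cong (f x +_) (sumR-empty (suc x) (suc x) f ℕₚ.≤-refl)) (ℤₚ.+-identityʳ (f x)))

sumR-snoc : ∀ lo hi (f : ℕ → ℤ) → lo ≤ hi → sumR lo (suc hi) f ≡ sumR lo hi f + f hi
sumR-snoc lo hi f lo≤hi =
  trans (sumR-split lo hi (suc hi) f lo≤hi (ℕₚ.n≤1+n hi)) (cong (sumR lo hi f +_) (sumR-single hi f))

sumR-swap : ∀ a a′ b b′ (f : ℕ → ℕ → ℤ) →
  sumR a a′ (λ u → sumR b b′ (f u)) ≡ sumR b b′ (λ v → sumR a a′ (λ u → f u v))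
sumR-swap a a′ b b′ = sumFrom-swap a (a′ ∸ a) b (b′ ∸ b)

sumR-mono : ∀ lo hi (f g : ℕ → ℤ) → (∀ x → lo ≤ x → x < hi → f x ≤ℤ g x) → sumR lo hi f ≤ℤ sumR lo hi g
sumR-mono lo hi f g f≤g = sumFrom-mono lo (hi ∸ lo) f g (λ x p q → f≤g x p (x<lo+[hi∸lo]⇒x<hi lo hi x p q))

sumR-nonneg : ∀ lo hi (f : ℕ → ℤ) → (∀ x → lo ≤ x → x < hi → 0ℤ ≤ℤ f x) → 0ℤ ≤ℤ sumR lo hi f
sumR-nonneg lo hi f 0≤f =
  subst (_≤ℤ sumR lo hi f) (sumR-zero lo hi (λ _ → 0ℤ) (λ _ _ _ → refl)) (sumR-mono lo hi _ f 0≤f)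

sumR-nonzero : ∀ lo hi (f : ℕ → ℤ) → sumR lo hi f ≢ 0ℤ → ∃ λ x → lo ≤ x × x < hi × f x ≢ 0ℤ
sumR-nonzero lo hi f s≢0 with sumFrom-nonzero lo (hi ∸ lo) f s≢0
... | x , p , q , fx≢0 = x , p , x<lo+[hi∸lo]⇒x<hi lo hi x p q , fx≢0

sumR-point : ∀ lo hi t (f : ℕ → ℤ) → lo ≤ t → t < hi → (∀ v → v ≢ t → f v ≡ 0ℤ) → sumR lo hi f ≡ f t
sumR-point lo hi t f lo≤t t<hi f≗0 = begin
  sumR lo hi f                             ≡⟨ sumR-split lo t hi f lo≤t (ℕₚ.<⇒≤ t<hi) ⟩
  sumR lo t f + sumR t hi f                ≡⟨ cong₂ _+_ left (sumR-cons t hi f t<hi) ⟩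
  0ℤ + (f t + sumR (suc t) hi f)           ≡⟨ cong (λ s → 0ℤ + (f t + s)) right ⟩
  0ℤ + (f t + 0ℤ)                          ≡⟨ trans (ℤₚ.+-identityˡ _) (ℤₚ.+-identityʳ _) ⟩
  f t                                      ∎
  where
  open ≡-Reasoning
  left : sumR lo t f ≡ 0ℤ
  left = sumR-zero lo t f (λ v _ v<t → f≗0 v (ℕₚ.<⇒≢ v<t))
  right : sumR (suc t) hi f ≡ 0ℤ
  right = sumR-zero (suc t) hi f (λ v t<v _ → f≗0 v (ℕₚ.>⇒≢ t<v))

χ≡ᵇ*-≢ : ∀ {v t} (F : ℕ → ℤ) → v ≢ t → χ (v ≡ᵇ t) * F v ≡ 0ℤ
χ≡ᵇ*-≢ {v} F v≢t rewrite χ-≢ᵇ v≢t = ℤₚ.*-zeroˡ (F v)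

sumR-χ≡ᵇ* : ∀ lo hi t (F : ℕ → ℤ) → lo ≤ t → t < hi → sumR lo hi (λ v → χ (v ≡ᵇ t) * F v) ≡ F t
sumR-χ≡ᵇ* lo hi t F lo≤t t<hi =
  trans (sumR-point lo hi t _ lo≤t t<hi (λ v → χ≡ᵇ*-≢ F))
        (trans (cong (_* F t) (χ-≡ᵇ {t} refl)) (ℤₚ.*-identityˡ (F t)))

sumR-χ≡ᵇ : ∀ lo hi t → sumR lo hi (λ v → χ (v ≡ᵇ t)) ≡ χ (inRange lo hi t)
sumR-χ≡ᵇ lo hi t with lo ≤ᵇ t | ℕₚ.≤ᵇ-reflects-≤ lo t | t <ᵇ hi | ℕₚ.<ᵇ-reflects-< t hi
... | true  | ofʸ lo≤t | true  | ofʸ t<hi =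
  trans (sumR-point lo hi t _ lo≤t t<hi (λ v → χ-≢ᵇ)) (χ-≡ᵇ {t} refl)
... | true  | _        | false | ofⁿ t≮hi =
  sumR-zero lo hi _ (λ v _ v<hi → χ-≢ᵇ (λ v≡t → t≮hi (subst (_< hi) v≡t v<hi)))
... | false | ofⁿ lo≰t | _     | _        =
  sumR-zero lo hi _ (λ v lo≤v _ → χ-≢ᵇ (λ v≡t → lo≰t (subst (lo ≤_) v≡t lo≤v)))

sumR-≥-pair : ∀ lo hi (f : ℕ → ℤ) → (∀ x → lo ≤ x → x < hi → 0ℤ ≤ℤ f x) →
  ∀ x y → lo ≤ x → x < hi → lo ≤ y → y < hi → x ≢ y → f x + f y ≤ℤ sumR lo hi f
sumR-≥-pair lo hi f 0≤f x y lo≤x x<hi lo≤y y<hi x≢y =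
  subst (_≤ℤ sumR lo hi f) pair-sum (sumR-mono lo hi pair f pair≤f)
  where
  pair : ℕ → ℤ
  pair v = χ (v ≡ᵇ x) * f v + χ (v ≡ᵇ y) * f v
  pair-sum : sumR lo hi pair ≡ f x + f y
  pair-sum = trans (sumR-+ lo hi _ _) (cong₂ _+_ (sumR-χ≡ᵇ* lo hi x f lo≤x x<hi) (sumR-χ≡ᵇ* lo hi y f lo≤y y<hi))
  pair≤f : ∀ v → lo ≤ v → v < hi → pair v ≤ℤ f v
  pair≤f v p q with v ≡ᵇ x | ≡ᵇ-reflects-≡ v x | v ≡ᵇ y | ≡ᵇ-reflects-≡ v y
  ... | true  | ofʸ refl | true  | ofʸ refl = ⊥-elim (x≢y refl)
  ... | true  | _        | false | _ = ℤₚ.≤-reflexive (first (f v))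
    where
    first : ∀ a → 1ℤ * a + 0ℤ * a ≡ a
    first = solve-∀
  ... | false | _        | true  | _ = ℤₚ.≤-reflexive (second (f v))
    where
    second : ∀ a → 0ℤ * a + 1ℤ * a ≡ a
    second = solve-∀
  ... | false | _        | false | _ = subst (_≤ℤ f v) (sym (neither (f v))) (0≤f v p q)
    where
    neither : ∀ a → 0ℤ * a + 0ℤ * a ≡ 0ℤ
    neither = solve-∀

sumR-unique-one : ∀ lo hi (f : ℕ → ℤ) → (∀ x → lo ≤ x → x < hi → 0ℤ ≤ℤ f x) → sumR lo hi f ≡ 1ℤ →
  ∀ x → lo ≤ x → x < hi → f x ≡ 1ℤ → ∀ y → lo ≤ y → y < hi → y ≢ x → f y ≡ 0ℤ
sumR-unique-one lo hi f 0≤f s≡1 x lo≤x x<hi fx≡1 y lo≤y y<hi y≢x =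
  ℤₚ.≤-antisym fy≤0 (0≤f y lo≤y y<hi)
  where
  1+fy≤1 : 1ℤ + f y ≤ℤ 1ℤ
  1+fy≤1 = subst₂ (λ a b → a + f y ≤ℤ b) fx≡1 s≡1
             (sumR-≥-pair lo hi f 0≤f x y lo≤x x<hi lo≤y y<hi (λ x≡y → y≢x (sym x≡y)))
  fy≤0 : f y ≤ℤ 0ℤ
  fy≤0 = subst₂ _≤ℤ_ (cancel (f y)) (cancel 0ℤ)
           (ℤₚ.+-monoʳ-≤ (- 1ℤ) (subst (1ℤ + f y ≤ℤ_) (sym (ℤₚ.+-identityʳ 1ℤ)) 1+fy≤1))
    where
    cancel : ∀ x → - 1ℤ + (1ℤ + x) ≡ x
    cancel = solve-∀

sumR-ones-coincide : ∀ lo hi (f : ℕ → ℤ) → (∀ x → lo ≤ x → x < hi → 0ℤ ≤ℤ f x) → sumR lo hi f ≡ 1ℤ →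
  ∀ x y → lo ≤ x → x < hi → lo ≤ y → y < hi → f x ≡ 1ℤ → f y ≡ 1ℤ → x ≡ y
sumR-ones-coincide lo hi f 0≤f s≡1 x y lo≤x x<hi lo≤y y<hi fx≡1 fy≡1 with x ℕ.≟ y
... | yes x≡y = x≡y
... | no  x≢y = ⊥-elim (1≢0 (trans (sym fy≡1) (sumR-unique-one lo hi f 0≤f s≡1 x lo≤x x<hi fx≡1 y lo≤y y<hi (x≢y ∘ sym))))

sumR-≥-term : ∀ lo hi (f : ℕ → ℤ) → (∀ x → lo ≤ x → x < hi → 0ℤ ≤ℤ f x) →
  ∀ t → lo ≤ t → t < hi → f t ≤ℤ sumR lo hi f
sumR-≥-term lo hi f 0≤f t lo≤t t<hi =
  subst (_≤ℤ sumR lo hi f) (sumR-χ≡ᵇ* lo hi t f lo≤t t<hi) (sumR-mono lo hi _ f term≤f)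
  where
  term≤f : ∀ v → lo ≤ v → v < hi → χ (v ≡ᵇ t) * f v ≤ℤ f v
  term≤f v p q with v ≡ᵇ t
  ... | true  = ℤₚ.≤-reflexive (ℤₚ.*-identityˡ (f v))
  ... | false = subst (_≤ℤ f v) (sym (ℤₚ.*-zeroˡ (f v))) (0≤f v p q)

lift-inside : ∀ {n} (A : Matrix n) u v (u<n : u < n) (v<n : v < n) → lift A u v ≡ A (fromℕ< u<n) (fromℕ< v<n)
lift-inside {n} A u v u<n v<n with u ℕ.<? n
... | no  u≮n = ⊥-elim (u≮n u<n)
... | yes _ with v ℕ.<? n
...   | no  v≮n = ⊥-elim (v≮n v<n)
...   | yes _   = refl

lift-row-outside : ∀ {n} (A : Matrix n) u v → n ≤ u → lift A u v ≡ 0ℤ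
lift-row-outside {n} A u v n≤u with u ℕ.<? n
... | no  _   = refl
... | yes u<n = ⊥-elim (ℕₚ.<⇒≱ u<n n≤u)

lift-col-outside : ∀ {n} (A : Matrix n) u v → n ≤ v → lift A u v ≡ 0ℤ
lift-col-outside {n} A u v n≤v with u ℕ.<? n
... | no  _ = refl
... | yes _ with v ℕ.<? n
...   | no  _   = refl
...   | yes v<n = ⊥-elim (ℕₚ.<⇒≱ v<n n≤v)

lift-nonzero : ∀ {n} (A : Matrix n) u v → lift A u v ≢ 0ℤ → u < n × v < n
lift-nonzero {n} A u v Auv≢0 with ℕₚ.<-≤-connex u n | ℕₚ.<-≤-connex v n
... | inj₁ u<n | inj₁ v<n = u<n , v<n
... | inj₂ n≤u | _        = ⊥-elim (Auv≢0 (lift-row-outside A u v n≤u))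
... | inj₁ _   | inj₂ n≤v = ⊥-elim (Auv≢0 (lift-col-outside A u v n≤v))

lift-δ : ∀ {n} (A : Matrix n) k c j q u v (u<n : u < n) (v<n : v < n) →
  lift (δ A k c j q) u v ≡ Discharge.δℕ n k c j q (lift A) u v
lift-δ A k c j q u v u<n v<n =
  trans (lift-inside (δ A k c j q) u v u<n v<n)
        (cong₂ (Discharge.δℕ _ k c j q (lift A)) (Finₚ.toℕ-fromℕ< u<n) (Finₚ.toℕ-fromℕ< v<n))

sumℤ : List ℤ → ℤ
sumℤ = List.foldr _+_ 0ℤ

Between01 : ℤ → Set
Between01 x = 0ℤ ≤ℤ x × x ≤ℤ 1ℤ

alternating-sum : ∀ {l} → Alternating l → sumℤ l ≡ 1ℤ
alternating-sum alt-one = refl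
alternating-sum (alt-cons a) rewrite alternating-sum a = refl

alternating-prefix : ∀ {l} → Alternating l → ∀ m → Between01 (sumℤ (take m l))
alternating-prefix _                  zero          = ℤₚ.≤-refl , ℤ.+≤+ z≤n
alternating-prefix alt-one            (suc zero)    = ℤ.+≤+ z≤n , ℤₚ.≤-refl
alternating-prefix alt-one            (suc (suc m)) = ℤ.+≤+ z≤n , ℤₚ.≤-refl
alternating-prefix (alt-cons a)       (suc zero)    = ℤ.+≤+ z≤n , ℤₚ.≤-refl
alternating-prefix (alt-cons {l} a)   (suc (suc m)) =
  subst Between01 (sym (1+[-1+x]≡x (sumℤ (take m l)))) (alternating-prefix a m)
  where
  1+[-1+x]≡x : ∀ x → 1ℤ + (-1ℤ + x) ≡ x
  1+[-1+x]≡x x = trans (sym (ℤₚ.+-assoc 1ℤ -1ℤ x)) (ℤₚ.+-identityˡ x)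

sumℤ-nonzeros : ∀ l → sumℤ (nonzeros l) ≡ sumℤ l
sumℤ-nonzeros []      = refl
sumℤ-nonzeros (x ∷ l) with x ℤ.≟ 0ℤ
... | yes refl = trans (sumℤ-nonzeros l) (sym (ℤₚ.+-identityˡ _))
... | no  _    = cong (x +_) (sumℤ-nonzeros l)

prefix-nonzeros : ∀ l m → ∃ λ m′ → sumℤ (take m l) ≡ sumℤ (take m′ (nonzeros l))
prefix-nonzeros l       zero    = zero , refl
prefix-nonzeros []      (suc m) = zero , refl
prefix-nonzeros (x ∷ l) (suc m) with x ℤ.≟ 0ℤ | prefix-nonzeros l m
... | yes refl | m′ , eq = m′ , trans (ℤₚ.+-identityˡ _) eq
... | no  _    | m′ , eq = suc m′ , cong (x +_) eq

sumℤ-tabulate-prefix : ∀ n (G : ℕ → ℤ) m → m ≤ n → sumℤ (take m (tabulate {n = n} (G ∘ toℕ))) ≡ sumFrom 0 m G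
sumℤ-tabulate-prefix n       G zero    _         = refl
sumℤ-tabulate-prefix (suc n) G (suc m) (s≤s m≤n) =
  cong (G 0 +_) (trans (sumℤ-tabulate-prefix n (G ∘ suc) m m≤n) (sym (sumFrom-shift 0 m G)))

AlternatingLine : ℕ → (ℕ → ℤ) → Set
AlternatingLine n G = sumR 0 n G ≡ 1ℤ × (∀ m → m ≤ n → Between01 (sumR 0 m G))

alternating-line : ∀ n (G : ℕ → ℤ) → Alternating (nonzeros (tabulate {n = n} (G ∘ toℕ))) → AlternatingLine n G
alternating-line n G alt = total , prefix
  where
  l : List ℤ
  l = tabulate {n = n} (G ∘ toℕ)
  l≡take-n : l ≡ take n l
  l≡take-n = sym (Listₚ.take-all n l (ℕₚ.≤-reflexive (Listₚ.length-tabulate _)))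
  total : sumR 0 n G ≡ 1ℤ
  total = begin
    sumFrom 0 n G        ≡⟨ sym (sumℤ-tabulate-prefix n G n ℕₚ.≤-refl) ⟩
    sumℤ (take n l)      ≡⟨ cong sumℤ (sym l≡take-n) ⟩
    sumℤ l               ≡⟨ sym (sumℤ-nonzeros l) ⟩
    sumℤ (nonzeros l)    ≡⟨ alternating-sum alt ⟩
    1ℤ                   ∎
    where open ≡-Reasoning
  prefix : ∀ m → m ≤ n → Between01 (sumR 0 m G)
  prefix m m≤n with prefix-nonzeros l m
  ... | m′ , eq = subst Between01 (trans eq′ (sumℤ-tabulate-prefix n G m m≤n)) (alternating-prefix alt m′)
    where
    eq′ : sumℤ (take m′ (nonzeros l)) ≡ sumℤ (take m l)
    eq′ = sym eq

asm-row : ∀ {n} (A : Matrix n) → IsASM A → ∀ u → u < n → AlternatingLine n (lift A u)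
asm-row {n} A asm u u<n = alternating-line n (lift A u) (subst (Alternating ∘ nonzeros) row≡ (IsASM.rows asm (fromℕ< u<n)))
  where
  row≡ : rowList A (fromℕ< u<n) ≡ tabulate (lift A u ∘ toℕ)
  row≡ = trans (Listₚ.map-tabulate id (A (fromℕ< u<n)))
               (Listₚ.tabulate-cong (λ v → sym (trans (lift-inside A u (toℕ v) u<n (Finₚ.toℕ<n v)) (cong (A _) (Finₚ.fromℕ<-toℕ v _)))))

asm-col : ∀ {n} (A : Matrix n) → IsASM A → ∀ v → v < n → AlternatingLine n (λ u → lift A u v)
asm-col {n} A asm v v<n = alternating-line n (λ u → lift A u v) (subst (Alternating ∘ nonzeros) col≡ (IsASM.cols asm (fromℕ< v<n)))
  where
  col≡ : colList A (fromℕ< v<n) ≡ tabulate ((λ u → lift A u v) ∘ toℕ)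
  col≡ = trans (Listₚ.map-tabulate id (λ u → A u (fromℕ< v<n)))
               (Listₚ.tabulate-cong (λ u → sym (trans (lift-inside A (toℕ u) v (Finₚ.toℕ<n u) v<n) (cong (λ w → A w _) (Finₚ.fromℕ<-toℕ u _)))))

sum-tabulate-≥ : ∀ {n} (f : Fin n → ℕ) x → f x ≤ sum (tabulate f)
sum-tabulate-≥ f Fin.zero    = ℕₚ.m≤m+n _ _
sum-tabulate-≥ f (Fin.suc x) = ℕₚ.≤-trans (sum-tabulate-≥ (f ∘ Fin.suc) x) (ℕₚ.m≤n+m _ (f Fin.zero))

sum-tabulate-≥-pair : ∀ {n} (f : Fin n → ℕ) x y → x ≢ y → f x ℕ.+ f y ≤ sum (tabulate f)
sum-tabulate-≥-pair f Fin.zero    Fin.zero    x≢y = ⊥-elim (x≢y refl)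
sum-tabulate-≥-pair f Fin.zero    (Fin.suc y) _   = ℕₚ.+-monoʳ-≤ (f Fin.zero) (sum-tabulate-≥ (f ∘ Fin.suc) y)
sum-tabulate-≥-pair f (Fin.suc x) Fin.zero    _   =
  subst (_≤ sum (tabulate f)) (ℕₚ.+-comm (f Fin.zero) _) (ℕₚ.+-monoʳ-≤ (f Fin.zero) (sum-tabulate-≥ (f ∘ Fin.suc) x))
sum-tabulate-≥-pair f (Fin.suc x) (Fin.suc y) x≢y =
  ℕₚ.≤-trans (sum-tabulate-≥-pair (f ∘ Fin.suc) x y (x≢y ∘ cong Fin.suc)) (ℕₚ.m≤n+m _ (f Fin.zero))

count-≥1 : ∀ {n} {P : Pred ℤ 0ℓ} (P? : Decidable P) (F : Fin n → ℤ) x → P (F x) → 1 ≤ length (filter P? (tabulate F))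
count-≥1 P? F Fin.zero px with P? (F Fin.zero)
... | yes _  = s≤s z≤n
... | no  ¬p = ⊥-elim (¬p px)
count-≥1 P? F (Fin.suc x) px with P? (F Fin.zero)
... | yes _ = s≤s z≤n
... | no  _ = count-≥1 P? (F ∘ Fin.suc) x px

count-≥2 : ∀ {n} {P : Pred ℤ 0ℓ} (P? : Decidable P) (F : Fin n → ℤ) x y → x ≢ y → P (F x) → P (F y) →
  2 ≤ length (filter P? (tabulate F))
count-≥2 P? F Fin.zero    Fin.zero    x≢y _  _  = ⊥-elim (x≢y refl)
count-≥2 P? F Fin.zero    (Fin.suc y) _   px py with P? (F Fin.zero)
... | yes _  = s≤s (count-≥1 P? (F ∘ Fin.suc) y py)
... | no  ¬p = ⊥-elim (¬p px)
count-≥2 P? F (Fin.suc x) Fin.zero    _   px py with P? (F Fin.zero)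
... | yes _  = s≤s (count-≥1 P? (F ∘ Fin.suc) x px)
... | no  ¬p = ⊥-elim (¬p py)
count-≥2 P? F (Fin.suc x) (Fin.suc y) x≢y px py with P? (F Fin.zero)
... | yes _ = ℕₚ.≤-trans (count-≥2 P? (F ∘ Fin.suc) x y (x≢y ∘ cong Fin.suc) px py) (ℕₚ.n≤1+n _)
... | no  _ = count-≥2 P? (F ∘ Fin.suc) x y (x≢y ∘ cong Fin.suc) px py

negCount-≥2 : ∀ {n} (A : Matrix n) u v u′ v′ → A u v ≡ -1ℤ → A u′ v′ ≡ -1ℤ → (u , v) ≢ (u′ , v′) → 2 ≤ negCount A
negCount-≥2 {n} A u v u′ v′ Auv Au′v′ distinct = subst (2 ≤_) (sym negCount≡) bound
  where
  rowCount : Fin n → ℕ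
  rowCount w = length (filter (ℤ._≟ -1ℤ) (tabulate (A w)))
  negCount≡ : negCount A ≡ sum (tabulate rowCount)
  negCount≡ = trans (cong sum (Listₚ.map-tabulate {n = n} id (λ w → length (filter (ℤ._≟ -1ℤ) (rowList A w)))))
                    (cong sum (Listₚ.tabulate-cong (λ w → cong (length ∘ filter (ℤ._≟ -1ℤ)) (Listₚ.map-tabulate id (A w)))))
  bound : 2 ≤ sum (tabulate rowCount)
  bound with u Finₚ.≟ u′
  ... | no u≢u′ = ℕₚ.≤-trans (ℕₚ.+-mono-≤ (count-≥1 (ℤ._≟ -1ℤ) (A u) v Auv) (count-≥1 (ℤ._≟ -1ℤ) (A u′) v′ Au′v′))
                             (sum-tabulate-≥-pair rowCount u u′ u≢u′)
  ... | yes refl = ℕₚ.≤-trans (count-≥2 (ℤ._≟ -1ℤ) (A u) v v′ (λ v≡v′ → distinct (cong (u ,_) v≡v′)) Auv Au′v′)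
                              (sum-tabulate-≥ rowCount u)

private
  +suc : ∀ {lo d x} → x < suc lo ℕ.+ d → x < lo ℕ.+ suc d
  +suc {lo} {d} {x} = subst (x <_) (sym (ℕₚ.+-suc lo d))

  suc+ : ∀ {lo d x} → x < lo ℕ.+ suc d → x < suc lo ℕ.+ d
  suc+ {lo} {d} {x} = subst (x <_) (ℕₚ.+-suc lo d)

anyFrom-true : ∀ (P : ℕ → Bool) lo d x → lo ≤ x → x < lo ℕ.+ d → P x ≡ true → anyFrom P lo d ≡ true
anyFrom-true P lo zero    x lo≤x x<lo+0 _ = ⊥-elim (ℕₚ.<⇒≱ x<lo+0 (subst (_≤ x) (sym (ℕₚ.+-identityʳ lo)) lo≤x))
anyFrom-true P lo (suc d) x lo≤x x<hi Px with P lo in Plo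
... | true  = refl
... | false with ℕₚ.m≤n⇒m<n∨m≡n lo≤x
...   | inj₁ lo<x = anyFrom-true P (suc lo) d x lo<x (suc+ x<hi) Px
...   | inj₂ refl = ⊥-elim (true≢false (trans (sym Px) Plo))

anyFrom-false : ∀ (P : ℕ → Bool) lo d → (∀ x → lo ≤ x → x < lo ℕ.+ d → P x ≡ false) → anyFrom P lo d ≡ false
anyFrom-false P lo zero    _   = refl
anyFrom-false P lo (suc d) ¬P rewrite ¬P lo ℕₚ.≤-refl (lo<lo+suc lo d) =
  anyFrom-false P (suc lo) d (λ x p q → ¬P x (ℕₚ.≤-trans (ℕₚ.n≤1+n lo) p) (+suc q))

anyFrom-witness : ∀ (P : ℕ → Bool) lo d → anyFrom P lo d ≡ true → ∃ λ x → lo ≤ x × x < lo ℕ.+ d × P x ≡ true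
anyFrom-witness P lo zero    ()
anyFrom-witness P lo (suc d) any with P lo in Plo
... | true  = lo , ℕₚ.≤-refl , lo<lo+suc lo d , Plo
... | false with anyFrom-witness P (suc lo) d any
...   | x , p , q , Px = x , ℕₚ.≤-trans (ℕₚ.n≤1+n lo) p , +suc q , Px

anyR-true : ∀ (P : ℕ → Bool) lo hi x → lo ≤ x → x < hi → P x ≡ true → anyR P lo hi ≡ true
anyR-true P lo hi x lo≤x x<hi = anyFrom-true P lo (hi ∸ lo) x lo≤x (x<hi⇒x<lo+[hi∸lo] lo hi x lo≤x x<hi)

anyR-false : ∀ (P : ℕ → Bool) lo hi → (∀ x → lo ≤ x → x < hi → P x ≡ false) → anyR P lo hi ≡ false
anyR-false P lo hi ¬P = anyFrom-false P lo (hi ∸ lo) (λ x p q → ¬P x p (x<lo+[hi∸lo]⇒x<hi lo hi x p q))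

anyR-witness : ∀ (P : ℕ → Bool) lo hi → anyR P lo hi ≡ true → ∃ λ x → lo ≤ x × x < hi × P x ≡ true
anyR-witness P lo hi any with anyFrom-witness P lo (hi ∸ lo) any
... | x , p , q , Px = x , p , x<lo+[hi∸lo]⇒x<hi lo hi x p q , Px

searchUp-≥ : ∀ (P : ℕ → Bool) lo d → lo ≤ searchUp P lo d
searchUp-≥ P lo zero    = ℕₚ.≤-refl
searchUp-≥ P lo (suc d) with P lo
... | true  = ℕₚ.≤-refl
... | false = ℕₚ.≤-trans (ℕₚ.n≤1+n lo) (searchUp-≥ P (suc lo) d)

searchUp-≤ : ∀ (P : ℕ → Bool) lo d → searchUp P lo d ≤ lo ℕ.+ d
searchUp-≤ P lo zero    = ℕₚ.≤-reflexive (sym (ℕₚ.+-identityʳ lo))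
searchUp-≤ P lo (suc d) with P lo
... | true  = ℕₚ.m≤m+n lo _
... | false = subst (searchUp P (suc lo) d ≤_) (sym (ℕₚ.+-suc lo d)) (searchUp-≤ P (suc lo) d)

searchUp-found : ∀ (P : ℕ → Bool) lo d → searchUp P lo d < lo ℕ.+ d → P (searchUp P lo d) ≡ true
searchUp-found P lo zero    s<lo+0 = ⊥-elim (ℕₚ.<-irrefl (sym (ℕₚ.+-identityʳ lo)) s<lo+0)
searchUp-found P lo (suc d) s<hi with P lo in Plo
... | true  = Plo
... | false = searchUp-found P (suc lo) d (suc+ s<hi)

searchUp-minimal : ∀ (P : ℕ → Bool) lo d y → lo ≤ y → y < searchUp P lo d → P y ≡ false
searchUp-minimal P lo zero    y lo≤y y<s = ⊥-elim (ℕₚ.<⇒≱ y<s lo≤y)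
searchUp-minimal P lo (suc d) y lo≤y y<s with P lo in Plo
... | true  = ⊥-elim (ℕₚ.<⇒≱ y<s lo≤y)
... | false with ℕₚ.m≤n⇒m<n∨m≡n lo≤y
...   | inj₁ lo<y = searchUp-minimal P (suc lo) d y lo<y y<s
...   | inj₂ refl = Plo

searchUp-≤-witness : ∀ (P : ℕ → Bool) lo d y → lo ≤ y → y < lo ℕ.+ d → P y ≡ true → searchUp P lo d ≤ y
searchUp-≤-witness P lo d y lo≤y y<hi Py with ℕₚ.<-cmp (searchUp P lo d) y
... | tri< s<y _ _ = ℕₚ.<⇒≤ s<y
... | tri≈ _ s≡y _ = ℕₚ.≤-reflexive s≡y
... | tri> _ _ y<s = ⊥-elim (true≢false (trans (sym Py) (searchUp-minimal P lo d y lo≤y y<s)))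

searchDown-spec : ∀ (P : ℕ → Bool) lo d y → lo ≤ y → y < lo ℕ.+ d → P y ≡ true →
  let s = searchDown P lo d in
  lo ≤ s × s < lo ℕ.+ d × P s ≡ true × (∀ z → s < z → z < lo ℕ.+ d → P z ≡ false)
searchDown-spec P lo zero    y lo≤y y<lo+0 _ = ⊥-elim (ℕₚ.<⇒≱ y<lo+0 (subst (_≤ y) (sym (ℕₚ.+-identityʳ lo)) lo≤y))
searchDown-spec P lo (suc d) y lo≤y y<hi Py with P (lo ℕ.+ d) in Plast
... | true  = ℕₚ.m≤m+n lo d , +suc (ℕₚ.n<1+n _) , Plast ,
              λ z last<z z<hi → ⊥-elim (ℕₚ.<⇒≱ last<z (ℕₚ.≤-pred (suc+ z<hi)))
... | false with ℕₚ.m≤n⇒m<n∨m≡n (ℕₚ.≤-pred (suc+ y<hi))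
...   | inj₂ refl = ⊥-elim (true≢false (trans (sym Py) Plast))
...   | inj₁ y<last with searchDown-spec P lo d y lo≤y y<last Py
...     | lo≤s , s<last , Ps , above = lo≤s , ℕₚ.<-trans s<last (+suc (ℕₚ.n<1+n _)) , Ps , above′
  where
  above′ : ∀ z → searchDown P lo d < z → z < lo ℕ.+ suc d → P z ≡ false
  above′ z s<z z<hi with ℕₚ.m≤n⇒m<n∨m≡n (ℕₚ.≤-pred (suc+ z<hi))
  ... | inj₁ z<last = above z s<z z<last
  ... | inj₂ refl   = Plast

record OneNegative (n : ℕ) (M : ℕMat) (k c j q : ℕ) : Set where
  field
    row-outside   : ∀ u v → n ≤ u → M u v ≡ 0ℤ
    col-outside   : ∀ u v → n ≤ v → M u v ≡ 0ℤ
    entries       : ∀ u v → M u v ≡ 1ℤ ⊎ M u v ≡ 0ℤ ⊎ M u v ≡ -1ℤ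
    only-negative : ∀ u v → M u v ≡ -1ℤ → u ≡ c × v ≡ j
    rows          : ∀ u → u < n → AlternatingLine n (M u)
    cols          : ∀ v → v < n → AlternatingLine n (λ u → M u v)
    Mcj≡-1        : M c j ≡ -1ℤ
    Mkj≡1         : M k j ≡ 1ℤ
    k-highest     : ∀ u → u < k → M u j ≡ 1ℤ → ⊥
    j<q           : j < q
    Mcq≡1         : M c q ≡ 1ℤ

-1≢0 : -1ℤ ≢ 0ℤ
-1≢0 ()

oneNegative : ∀ n (A : Matrix n) → InASM n 1 A → ∀ k c j q →
  lift A c j ≡ -1ℤ → IsOpeningRow (lift A) k j → j < q → lift A c q ≡ 1ℤ → OneNegative n (lift A) k c j q
oneNegative n A (asm , negCount≡1) k c j q Acj≡-1 (Akj≡1 , k-highest) j<q Acq≡1 = record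
  { row-outside   = lift-row-outside A
  ; col-outside   = lift-col-outside A
  ; entries       = entries
  ; only-negative = only-negative
  ; rows          = asm-row A asm
  ; cols          = asm-col A asm
  ; Mcj≡-1        = Acj≡-1
  ; Mkj≡1         = Akj≡1
  ; k-highest     = k-highest
  ; j<q           = j<q
  ; Mcq≡1         = Acq≡1
  }
  where
  entries : ∀ u v → lift A u v ≡ 1ℤ ⊎ lift A u v ≡ 0ℤ ⊎ lift A u v ≡ -1ℤ
  entries u v with ℕₚ.<-≤-connex u n | ℕₚ.<-≤-connex v n
  ... | inj₁ u<n | inj₁ v<n = subst (λ x → x ≡ 1ℤ ⊎ x ≡ 0ℤ ⊎ x ≡ -1ℤ) (sym (lift-inside A u v u<n v<n)) (IsASM.entries asm _ _)
  ... | inj₂ n≤u | _        = inj₂ (inj₁ (lift-row-outside A u v n≤u))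
  ... | inj₁ _   | inj₂ n≤v = inj₂ (inj₁ (lift-col-outside A u v n≤v))
  two≰negCount : 2 ≤ negCount A → ⊥
  two≰negCount 2≤ with subst (2 ≤_) negCount≡1 2≤
  ... | s≤s ()
  only-negative : ∀ u v → lift A u v ≡ -1ℤ → u ≡ c × v ≡ j
  only-negative u v Auv≡-1
    with lift-nonzero A u v (-1≢0 ∘ trans (sym Auv≡-1)) | lift-nonzero A c j (-1≢0 ∘ trans (sym Acj≡-1))
  ... | u<n , v<n | c<n , j<n
    with ×-≡-dec Finₚ._≟_ Finₚ._≟_ (fromℕ< u<n , fromℕ< v<n) (fromℕ< c<n , fromℕ< j<n)
  ...   | yes same = Finₚ.fromℕ<-injective u c u<n c<n (cong proj₁ same) ,
                     Finₚ.fromℕ<-injective v j v<n j<n (cong proj₂ same)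
  ...   | no distinct = ⊥-elim (two≰negCount (negCount-≥2 A _ _ _ _ (trans (sym (lift-inside A u v u<n v<n)) Auv≡-1)
                                                                  (trans (sym (lift-inside A c j c<n j<n)) Acj≡-1) distinct))

module Structure {n : ℕ} {M : ℕMat} {k c j q : ℕ} (S : OneNegative n M k c j q) where
  open OneNegative S

  nonzero⇒inside : ∀ u v → M u v ≢ 0ℤ → u < n × v < n
  nonzero⇒inside u v Muv≢0 with ℕₚ.<-≤-connex u n | ℕₚ.<-≤-connex v n
  ... | inj₁ u<n | inj₁ v<n = u<n , v<n
  ... | inj₂ n≤u | _        = ⊥-elim (Muv≢0 (row-outside u v n≤u))
  ... | inj₁ _   | inj₂ n≤v = ⊥-elim (Muv≢0 (col-outside u v n≤v))

  c<n : c < n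
  c<n = proj₁ (nonzero⇒inside c q (1≢0 ∘ trans (sym Mcq≡1)))

  q<n : q < n
  q<n = proj₂ (nonzero⇒inside c q (1≢0 ∘ trans (sym Mcq≡1)))

  j<n : j < n
  j<n = ℕₚ.<-trans j<q q<n

  nonneg-unless-−1 : ∀ u v → M u v ≢ -1ℤ → 0ℤ ≤ℤ M u v
  nonneg-unless-−1 u v Muv≢-1 with entries u v
  ... | inj₁ Muv≡1         = subst (0ℤ ≤ℤ_) (sym Muv≡1) (ℤ.+≤+ z≤n)
  ... | inj₂ (inj₁ Muv≡0)  = subst (0ℤ ≤ℤ_) (sym Muv≡0) ℤₚ.≤-refl
  ... | inj₂ (inj₂ Muv≡-1) = ⊥-elim (Muv≢-1 Muv≡-1)

  nonneg-off-row-c : ∀ u v → u ≢ c → 0ℤ ≤ℤ M u v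
  nonneg-off-row-c u v u≢c = nonneg-unless-−1 u v (u≢c ∘ proj₁ ∘ only-negative u v)

  nonneg-off-col-j : ∀ u v → v ≢ j → 0ℤ ≤ℤ M u v
  nonneg-off-col-j u v v≢j = nonneg-unless-−1 u v (v≢j ∘ proj₂ ∘ only-negative u v)

  one-unless-0-or-−1 : ∀ u v → M u v ≢ 0ℤ → M u v ≢ -1ℤ → M u v ≡ 1ℤ
  one-unless-0-or-−1 u v Muv≢0 Muv≢-1 with entries u v
  ... | inj₁ Muv≡1         = Muv≡1
  ... | inj₂ (inj₁ Muv≡0)  = ⊥-elim (Muv≢0 Muv≡0)
  ... | inj₂ (inj₂ Muv≡-1) = ⊥-elim (Muv≢-1 Muv≡-1)

  1≤sum⇒one : ∀ u lo hi → (∀ v → lo ≤ v → v < hi → M u v ≢ -1ℤ) → 1ℤ ≤ℤ sumR lo hi (M u) →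
    ∃ λ v → lo ≤ v × v < hi × M u v ≡ 1ℤ
  1≤sum⇒one u lo hi no-−1 1≤s with sumR-nonzero lo hi (M u) (λ s≡0 → 1≰0 (subst (1ℤ ≤ℤ_) s≡0 1≤s))
    where
    1≰0 : 1ℤ ≤ℤ 0ℤ → ⊥
    1≰0 (ℤ.+≤+ ())
  ... | v , lo≤v , v<hi , Muv≢0 = v , lo≤v , v<hi , one-unless-0-or-−1 u v Muv≢0 (no-−1 v lo≤v v<hi)

  -- In the closing row this is the 1 of the left side.
  opaque
    ρ : ℕ → ℕ
    ρ u = searchUp (λ v → M u v == 1ℤ) 0 n

  opaque
    unfolding ρ
    ρ-leftmost : ∀ u x → x < n → M u x ≡ 1ℤ → ρ u ≤ x × M u (ρ u) ≡ 1ℤ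
    ρ-leftmost u x x<n Mux≡1 = ρu≤x , ==⇒≡ (searchUp-found _ 0 n (ℕₚ.≤-<-trans ρu≤x x<n))
      where
      ρu≤x : ρ u ≤ x
      ρu≤x = searchUp-≤-witness (λ v → M u v == 1ℤ) 0 n x z≤n x<n (subst (λ z → (z == 1ℤ) ≡ true) (sym Mux≡1) (==-refl 1ℤ))

  row-indicator : ∀ u → u < n → u ≢ c → ρ u < n × (∀ v → M u v ≡ χ (v ≡ᵇ ρ u))
  row-indicator u u<n u≢c = ρu<n , indicator
    where
    rowsum : sumR 0 n (M u) ≡ 1ℤ
    rowsum = proj₁ (rows u u<n)
    one : ∃ λ x → 0 ≤ x × x < n × M u x ≡ 1ℤ
    one = 1≤sum⇒one u 0 n (λ v _ _ → u≢c ∘ proj₁ ∘ only-negative u v) (ℤₚ.≤-reflexive (sym rowsum))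
    x : ℕ
    x = proj₁ one
    x<n : x < n
    x<n = proj₁ (proj₂ (proj₂ one))
    leftmost : ρ u ≤ x × M u (ρ u) ≡ 1ℤ
    leftmost = ρ-leftmost u x x<n (proj₂ (proj₂ (proj₂ one)))
    ρu<n : ρ u < n
    ρu<n = ℕₚ.≤-<-trans (proj₁ leftmost) x<n
    indicator : ∀ v → M u v ≡ χ (v ≡ᵇ ρ u)
    indicator v with v ≡ᵇ ρ u | ≡ᵇ-reflects-≡ v (ρ u)
    ... | true  | ofʸ refl = proj₂ leftmost
    ... | false | ofⁿ v≢ρu with ℕₚ.<-≤-connex v n
    ...   | inj₂ n≤v = col-outside u v n≤v
    ...   | inj₁ v<n = sumR-unique-one 0 n (M u) (λ z _ _ → nonneg-off-row-c u z u≢c) rowsum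
                         (ρ u) z≤n ρu<n (proj₂ leftmost) v z≤n v<n v≢ρu

  row : ∀ u → u < n → u ≢ c → ∀ v → M u v ≡ χ (v ≡ᵇ ρ u)
  row u u<n u≢c = proj₂ (row-indicator u u<n u≢c)

  closing-row-left-one : ∃ λ x → 0 ≤ x × x < j × M c x ≡ 1ℤ
  closing-row-left-one = 1≤sum⇒one c 0 j (λ v _ v<j → ℕₚ.<⇒≢ v<j ∘ proj₂ ∘ only-negative c v) 1≤s
    where
    s : ℤ
    s = sumR 0 j (M c)
    0≤s-1 : 0ℤ ≤ℤ s + -1ℤ
    0≤s-1 = subst (0ℤ ≤ℤ_) (trans (sumR-snoc 0 j (M c) z≤n) (cong (s +_) Mcj≡-1)) (proj₁ (proj₂ (rows c c<n) (suc j) j<n))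
    1≤s : 1ℤ ≤ℤ s
    1≤s = subst (1ℤ ≤ℤ_) (shift s) (ℤₚ.+-monoˡ-≤ 1ℤ 0≤s-1)
      where
      shift : ∀ s → s + -1ℤ + 1ℤ ≡ s
      shift = solve-∀

  ρc<j : ρ c < j
  ρc<j = let x , _ , x<j , Mcx≡1 = closing-row-left-one in
         ℕₚ.≤-<-trans (proj₁ (ρ-leftmost c x (ℕₚ.<-trans x<j j<n) Mcx≡1)) x<j

  Mcρc≡1 : M c (ρ c) ≡ 1ℤ
  Mcρc≡1 = let x , _ , x<j , Mcx≡1 = closing-row-left-one in
           proj₂ (ρ-leftmost c x (ℕₚ.<-trans x<j j<n) Mcx≡1)

  ρc<n : ρ c < n
  ρc<n = ℕₚ.<-trans ρc<j j<n

  ρc≢j : ρ c ≢ j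
  ρc≢j = ℕₚ.<⇒≢ ρc<j

  ρc≢q : ρ c ≢ q
  ρc≢q = ℕₚ.<⇒≢ (ℕₚ.<-trans ρc<j j<q)

  q≢j : q ≢ j
  q≢j = ℕₚ.>⇒≢ j<q

  -- Adding the indicator of column j to the closing row leaves a nonnegative row of sum 2 with
  -- ones at ρ c and q; removing the one at ρ c leaves a row to which sumR-unique-one applies.
  closing-row+j : ∀ v → M c v + χ (v ≡ᵇ j) ≡ χ (v ≡ᵇ ρ c) + χ (v ≡ᵇ q)
  closing-row+j v with v ≡ᵇ ρ c | ≡ᵇ-reflects-≡ v (ρ c) | v ≡ᵇ q | ≡ᵇ-reflects-≡ v q
  ... | true  | ofʸ refl  | true  | ofʸ ρc≡q = ⊥-elim (ρc≢q ρc≡q)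
  ... | true  | ofʸ refl  | false | _        = cong₂ _+_ Mcρc≡1 (χ-≢ᵇ ρc≢j)
  ... | false | _         | true  | ofʸ refl = cong₂ _+_ Mcq≡1 (χ-≢ᵇ q≢j)
  ... | false | ofⁿ v≢ρc  | false | ofⁿ v≢q  = f-zero
    where
    f : ℕ → ℤ
    f z = M c z + χ (z ≡ᵇ j)
    f≥0 : ∀ z → 0ℤ ≤ℤ f z
    f≥0 z with z ≡ᵇ j | ≡ᵇ-reflects-≡ z j
    ... | true  | ofʸ refl = subst (λ x → 0ℤ ≤ℤ x + 1ℤ) (sym Mcj≡-1) ℤₚ.≤-refl
    ... | false | ofⁿ z≢j = subst (0ℤ ≤ℤ_) (sym (ℤₚ.+-identityʳ _)) (nonneg-off-col-j c z z≢j)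
    f-ρc : f (ρ c) ≡ 1ℤ
    f-ρc = cong₂ _+_ Mcρc≡1 (χ-≢ᵇ ρc≢j)
    f′ : ℕ → ℤ
    f′ z = f z - χ (z ≡ᵇ ρ c) * f z
    f′≥0 : ∀ z → 0ℤ ≤ℤ f′ z
    f′≥0 z with z ≡ᵇ ρ c
    ... | true  = subst (0ℤ ≤ℤ_) (sym (x-1*x≡0 (f z))) ℤₚ.≤-refl
      where
      x-1*x≡0 : ∀ x → x - 1ℤ * x ≡ 0ℤ
      x-1*x≡0 = solve-∀
    ... | false = subst (0ℤ ≤ℤ_) (sym (x-0*x≡x (f z))) (f≥0 z)
      where
      x-0*x≡x : ∀ x → x - 0ℤ * x ≡ x
      x-0*x≡x = solve-∀
    f′-sum : sumR 0 n f′ ≡ 1ℤ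
    f′-sum = begin
      sumR 0 n f′                                             ≡⟨ sumR-- 0 n f _ ⟩
      sumR 0 n f - sumR 0 n (λ z → χ (z ≡ᵇ ρ c) * f z)        ≡⟨ cong₂ _-_ (sumR-+ 0 n (M c) _)
                                                                        (sumR-χ≡ᵇ* 0 n (ρ c) f z≤n ρc<n) ⟩
      sumR 0 n (M c) + sumR 0 n (λ z → χ (z ≡ᵇ j)) - f (ρ c)  ≡⟨ cong₂ (λ a b → a + b - f (ρ c)) (proj₁ (rows c c<n))
                                                                        (trans (sumR-χ≡ᵇ 0 n j) j-in-range) ⟩
      1ℤ + 1ℤ - f (ρ c)                                       ≡⟨ cong (λ x → 1ℤ + 1ℤ - x) f-ρc ⟩
      1ℤ                                                      ∎
      where
      open ≡-Reasoning
      j-in-range : χ (inRange 0 n j) ≡ 1ℤ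
      j-in-range rewrite <⇒<ᵇ≡true j<n = refl
    f′-q : f′ q ≡ 1ℤ
    f′-q = trans (cong (λ x → f q - x * f q) (χ-≢ᵇ (ρc≢q ∘ sym)))
                 (cong (λ a → a - 0ℤ * a) f-q)
      where
      f-q : f q ≡ 1ℤ
      f-q = cong₂ _+_ Mcq≡1 (χ-≢ᵇ q≢j)
    f-zero : f v ≡ 0ℤ + 0ℤ
    f-zero with ℕₚ.<-≤-connex v n
    ... | inj₂ n≤v = cong₂ _+_ (col-outside c v n≤v) (χ-≢ᵇ (λ v≡j → ℕₚ.<⇒≱ j<n (subst (n ≤_) v≡j n≤v)))
    ... | inj₁ v<n = trans (sym (trans (cong (λ x → f v - x * f v) (χ-≢ᵇ v≢ρc)) (x-0*x≡x (f v))))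
                           (sumR-unique-one 0 n f′ (λ z _ _ → f′≥0 z) f′-sum q z≤n q<n f′-q v z≤n v<n v≢q)
      where
      x-0*x≡x : ∀ x → x - 0ℤ * x ≡ x
      x-0*x≡x = solve-∀

  closing-row : ∀ v → M c v ≡ χ (v ≡ᵇ ρ c) + χ (v ≡ᵇ q) - χ (v ≡ᵇ j)
  closing-row v = trans (sym (x+y-y≡x (M c v) (χ (v ≡ᵇ j)))) (cong (_- χ (v ≡ᵇ j)) (closing-row+j v))
    where
    x+y-y≡x : ∀ x y → x + y - y ≡ x
    x+y-y≡x = solve-∀

  private
    shift-by-−1 : ∀ s → 0ℤ ≤ℤ s + -1ℤ → 1ℤ ≤ℤ s
    shift-by-−1 s 0≤s-1 = subst (1ℤ ≤ℤ_) (cancel s) (ℤₚ.+-monoˡ-≤ 1ℤ 0≤s-1)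
      where
      cancel : ∀ s → s + -1ℤ + 1ℤ ≡ s
      cancel = solve-∀

  col-j-above-c : sumR 0 c (λ u → M u j) ≡ 1ℤ
  col-j-above-c = ℤₚ.≤-antisym (proj₂ (prefix c (ℕₚ.<⇒≤ c<n))) (shift-by-−1 _ 0≤s-1)
    where
    prefix : ∀ m → m ≤ n → Between01 (sumR 0 m (λ u → M u j))
    prefix = proj₂ (cols j j<n)
    0≤s-1 : 0ℤ ≤ℤ sumR 0 c (λ u → M u j) + -1ℤ
    0≤s-1 = subst (0ℤ ≤ℤ_) (trans (sumR-snoc 0 c (λ u → M u j) z≤n) (cong (sumR 0 c (λ u → M u j) +_) Mcj≡-1))
                  (proj₁ (prefix (suc c) c<n))

  k<c : k < c
  k<c with sumR-nonzero 0 c (λ u → M u j) (1≢0 ∘ trans (sym col-j-above-c))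
  ... | x , _ , x<c , Mxj≢0 with one-unless-0-or-−1 x j Mxj≢0 (ℕₚ.<⇒≢ x<c ∘ proj₁ ∘ only-negative x j)
  ...   | Mxj≡1 with ℕₚ.<-cmp x k
  ...     | tri< x<k _ _ = ⊥-elim (k-highest x x<k Mxj≡1)
  ...     | tri≈ _ refl _ = x<c
  ...     | tri> _ _ k<x = ℕₚ.<-trans k<x x<c

  k<n : k < n
  k<n = ℕₚ.<-trans k<c c<n

  col-j-above-c-only-k : ∀ u → u < c → u ≢ k → M u j ≡ 0ℤ
  col-j-above-c-only-k u u<c u≢k =
    sumR-unique-one 0 c (λ u → M u j) (λ z _ z<c → nonneg-off-row-c z j (ℕₚ.<⇒≢ z<c)) col-j-above-c
                    k z≤n k<c Mkj≡1 u z≤n u<c u≢k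

  col-j-below-c : sumR (suc c) n (λ u → M u j) ≡ 1ℤ
  col-j-below-c = 1+[-1+s]≡1⇒s≡1 (begin
    1ℤ                                                          ≡⟨ sym (proj₁ (cols j j<n)) ⟩
    sumR 0 n (λ u → M u j)                                      ≡⟨ sumR-split 0 c n _ z≤n (ℕₚ.<⇒≤ c<n) ⟩
    sumR 0 c (λ u → M u j) + sumR c n (λ u → M u j)             ≡⟨ cong₂ _+_ col-j-above-c (sumR-cons c n _ c<n) ⟩
    1ℤ + (M c j + sumR (suc c) n (λ u → M u j))                 ≡⟨ cong (λ x → 1ℤ + (x + sumR (suc c) n (λ u → M u j))) Mcj≡-1 ⟩
    1ℤ + (-1ℤ + sumR (suc c) n (λ u → M u j))                   ∎)
    where
    open ≡-Reasoning
    1+[-1+s]≡1⇒s≡1 : ∀ {s} → 1ℤ ≡ 1ℤ + (-1ℤ + s) → s ≡ 1ℤ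
    1+[-1+s]≡1⇒s≡1 {s} eq = sym (trans eq (trans (sym (ℤₚ.+-assoc 1ℤ -1ℤ s)) (ℤₚ.+-identityˡ s)))

  ρk≡j : ρ k ≡ j
  ρk≡j = sym (χ-≡ᵇ⁻¹ (trans (sym (row k k<n (ℕₚ.<⇒≢ k<c) j)) Mkj≡1))

  col-q-only-c : ∀ u → u ≢ c → M u q ≡ 0ℤ
  col-q-only-c u u≢c with ℕₚ.<-≤-connex u n
  ... | inj₂ n≤u = row-outside u q n≤u
  ... | inj₁ u<n = sumR-unique-one 0 n (λ u → M u q) (λ z _ _ → nonneg-off-col-j z q q≢j) (proj₁ (cols q q<n))
                                   c z≤n c<n Mcq≡1 u z≤n u<n u≢c

  ρ≢q : ∀ u → u < n → u ≢ c → ρ u ≢ q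
  ρ≢q u u<n u≢c ρu≡q = 1≢0 (trans (sym (trans (row u u<n u≢c q) (χ-≡ᵇ (sym ρu≡q)))) (col-q-only-c u u≢c))

  ρ<n : ∀ u → u < n → ρ u < n
  ρ<n u u<n with u ℕ.≟ c
  ... | yes refl = ρc<n
  ... | no  u≢c  = proj₁ (row-indicator u u<n u≢c)

  M-ρ≡1 : ∀ u → u < n → M u (ρ u) ≡ 1ℤ
  M-ρ≡1 u u<n with u ℕ.≟ c
  ... | yes refl = Mcρc≡1
  ... | no  u≢c  = trans (row u u<n u≢c (ρ u)) (χ-≡ᵇ {ρ u} refl)

  left-one-is-ρ : ∀ u v → u < n → v < j → M u v ≡ 1ℤ → v ≡ ρ u
  left-one-is-ρ u v u<n v<j Muv≡1 with u ℕ.≟ c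
  ... | no  u≢c  = χ-≡ᵇ⁻¹ (trans (sym (row u u<n u≢c v)) Muv≡1)
  ... | yes refl = χ-≡ᵇ⁻¹ (begin
    χ (v ≡ᵇ ρ c)                               ≡⟨ sym (trans (ℤₚ.+-identityʳ _) (ℤₚ.+-identityʳ _)) ⟩
    χ (v ≡ᵇ ρ c) + 0ℤ - 0ℤ                     ≡⟨ sym (cong₂ (λ x y → χ (v ≡ᵇ ρ c) + x - y)
                                                            (χ-≢ᵇ (ℕₚ.<⇒≢ (ℕₚ.<-trans v<j j<q))) (χ-≢ᵇ (ℕₚ.<⇒≢ v<j))) ⟩
    χ (v ≡ᵇ ρ c) + χ (v ≡ᵇ q) - χ (v ≡ᵇ j)     ≡⟨ sym (closing-row v) ⟩
    M c v                                      ≡⟨ Muv≡1 ⟩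
    1ℤ                                         ∎)
    where open ≡-Reasoning

  ρ≢j-enclosed : ∀ u → k < u → u < c → ρ u ≢ j
  ρ≢j-enclosed u k<u u<c ρu≡j =
    1≢0 (trans (sym (trans (row u (ℕₚ.<-trans u<c c<n) (ℕₚ.<⇒≢ u<c) j) (χ-≡ᵇ (sym ρu≡j))))
               (col-j-above-c-only-k u u<c (ℕₚ.>⇒≢ k<u)))

  ρ-injective-below-c : ∀ u w → c < u → u < n → c < w → w < n → ρ u ≡ ρ w → u ≡ w
  ρ-injective-below-c u w c<u u<n c<w w<n ρu≡ρw = by-column (ρ u ℕ.≟ j)
    where
    Mwρu≡1 : M w (ρ u) ≡ 1ℤ
    Mwρu≡1 = subst (λ y → M w y ≡ 1ℤ) (sym ρu≡ρw) (M-ρ≡1 w w<n)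
    by-column : Dec (ρ u ≡ j) → u ≡ w
    by-column (yes ρu≡j) =
      sumR-ones-coincide (suc c) n (λ z → M z (ρ u)) (λ z c<z _ → nonneg-off-row-c z (ρ u) (ℕₚ.>⇒≢ c<z))
                        (subst (λ y → sumR (suc c) n (λ z → M z y) ≡ 1ℤ) (sym ρu≡j) col-j-below-c)
                        u w c<u u<n c<w w<n (M-ρ≡1 u u<n) Mwρu≡1
    by-column (no ρu≢j) =
      sumR-ones-coincide 0 n (λ z → M z (ρ u)) (λ z _ _ → nonneg-off-col-j z (ρ u) ρu≢j) (proj₁ (cols (ρ u) (ρ<n u u<n)))
                        u w z≤n u<n z≤n w<n (M-ρ≡1 u u<n) Mwρu≡1

Is01 : ℤ → Set
Is01 z = z ≡ 0ℤ ⊎ z ≡ 1ℤ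

χ-01 : ∀ b → Is01 (χ b)
χ-01 true  = inj₂ refl
χ-01 false = inj₁ refl

χ-==-1 : ∀ b → (χ b == 1ℤ) ≡ b
χ-==-1 true  = refl
χ-==-1 false = refl

-- The entry that `vacate` leaves at a position with cell flag b and value z.
vacated-inside : ∀ b z → Is01 z → b ≡ true → (if b ∧ (z == 1ℤ) then 0ℤ else z) ≡ 0ℤ
vacated-inside .true .0ℤ (inj₁ refl) refl = refl
vacated-inside .true .1ℤ (inj₂ refl) refl = refl

vacated-zero : ∀ b z → z ≡ 0ℤ → (if b ∧ (z == 1ℤ) then 0ℤ else z) ≡ 0ℤ
vacated-zero false z    z≡0  = z≡0
vacated-zero true  .0ℤ refl = refl

vacated-outside : ∀ b z → b ≡ false → (if b ∧ (z == 1ℤ) then 0ℤ else z) ≡ z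
vacated-outside .false z refl = refl

module Discharged {n : ℕ} {M : ℕMat} {k c j q : ℕ} (S : OneNegative n M k c j q) where
  open OneNegative S
  open Structure S
  open Discharge n k c j q

  M1 : ℕMat
  M1 = step1 M

  M1-off-c : ∀ u v → u ≢ c → M1 u v ≡ M u v
  M1-off-c u v u≢c rewrite ≢⇒≡ᵇ≡false u≢c = refl

  M1-below-c : ∀ u v → c < u → M1 u v ≡ M u v
  M1-below-c u v c<u = M1-off-c u v (ℕₚ.>⇒≢ c<u)

  M1-matrix : ∀ u v → u < n → M1 u v ≡ χ (v ≡ᵇ ρ u)
  M1-matrix u v u<n with u ℕ.≟ c
  ... | no  u≢c  = trans (M1-off-c u v u≢c) (row u u<n u≢c v)
  ... | yes refl rewrite ≡ᵇ-refl c with v ≡ᵇ j | ≡ᵇ-reflects-≡ v j | v ≡ᵇ q | ≡ᵇ-reflects-≡ v q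
  ...   | true  | ofʸ refl | _     | _        = sym (χ-≢ᵇ (ρc≢j ∘ sym))
  ...   | false | _        | true  | ofʸ refl = sym (χ-≢ᵇ (ρc≢q ∘ sym))
  ...   | false | ofⁿ v≢j  | false | ofⁿ v≢q  = begin
    M c v                                               ≡⟨ closing-row v ⟩
    χ (v ≡ᵇ ρ c) + χ (v ≡ᵇ q) - χ (v ≡ᵇ j)              ≡⟨ cong₂ (λ x y → χ (v ≡ᵇ ρ c) + x - y) (χ-≢ᵇ v≢q) (χ-≢ᵇ v≢j) ⟩
    χ (v ≡ᵇ ρ c) + 0ℤ - 0ℤ                              ≡⟨ trans (ℤₚ.+-identityʳ _) (ℤₚ.+-identityʳ _) ⟩
    χ (v ≡ᵇ ρ c)                                        ∎
    where open ≡-Reasoning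

  M1-01 : ∀ u v → Is01 (M1 u v)
  M1-01 u v with ℕₚ.<-≤-connex u n
  ... | inj₁ u<n = subst Is01 (sym (M1-matrix u v u<n)) (χ-01 _)
  ... | inj₂ n≤u with u ℕ.≟ c
  ...   | yes refl = ⊥-elim (ℕₚ.<⇒≱ c<n n≤u)
  ...   | no  u≢c  = inj₁ (trans (M1-off-c u v u≢c) (row-outside u v n≤u))

  colBelow : ℕ → ℤ
  colBelow x = sumR (suc c) n (λ w → M w x)

  occupied : ℕ → Bool
  occupied = nzCol M1

  occupied-ρ : ∀ w → c < w → w < n → occupied (ρ w) ≡ true
  occupied-ρ w c<w w<n = anyR-true _ (suc c) n w c<w w<n nonzero
    where
    nonzero : not (M1 w (ρ w) == 0ℤ) ≡ true
    nonzero rewrite M1-matrix w (ρ w) w<n | ≡ᵇ-refl (ρ w) = refl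

  occupied-witness : ∀ x → occupied x ≡ true → ∃ λ w → c < w × w < n × ρ w ≡ x
  occupied-witness x occ with anyR-witness _ (suc c) n occ
  ... | w , c<w , w<n , nonzero = w , c<w , w<n , sym (χ-≡ᵇ⁻¹ (χ-≢0 (M1-matrix w x w<n) nonzero))
    where
    χ-≢0 : ∀ {z b} → z ≡ χ b → not (z == 0ℤ) ≡ true → χ b ≡ 1ℤ
    χ-≢0 {b = true}  _    _ = refl
    χ-≢0 {b = false} refl ()

  unoccupied : ∀ x → occupied x ≡ false → ∀ w → c < w → w < n → M w x ≡ 0ℤ
  unoccupied x unocc w c<w w<n with ρ w ℕ.≟ x
  ... | yes refl = ⊥-elim (true≢false (trans (sym (occupied-ρ w c<w w<n)) unocc))
  ... | no  ρw≢x = trans (sym (M1-below-c w x c<w)) (trans (M1-matrix w x w<n) (χ-≢ᵇ (ρw≢x ∘ sym)))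

  occupied-j : occupied j ≡ true
  occupied-j with sumR-nonzero (suc c) n (λ u → M u j) (1≢0 ∘ trans (sym col-j-below-c))
  ... | w , c<w , w<n , Mwj≢0 = anyR-true _ (suc c) n w c<w w<n nonzero
    where
    nonzero : not (M1 w j == 0ℤ) ≡ true
    nonzero rewrite M1-below-c w j c<w with M w j ℤ.≟ 0ℤ
    ... | yes Mwj≡0 = ⊥-elim (Mwj≢0 Mwj≡0)
    ... | no  _     = refl

  colBelow-j : colBelow j ≡ 1ℤ
  colBelow-j = col-j-below-c

  colBelow-≤1 : ∀ x → x ≢ j → x < n → colBelow x ≤ℤ 1ℤ
  colBelow-≤1 x x≢j x<n = subst (colBelow x ≤ℤ_) (proj₁ (cols x x<n)) (begin
    colBelow x                                            ≡⟨ sym (ℤₚ.+-identityˡ _) ⟩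
    0ℤ + colBelow x                                       ≤⟨ ℤₚ.+-monoˡ-≤ (colBelow x) (sumR-nonneg 0 (suc c) _ (λ z _ _ → nonneg-off-col-j z x x≢j)) ⟩
    sumR 0 (suc c) (λ w → M w x) + colBelow x             ≡⟨ sym (sumR-split 0 (suc c) n _ z≤n c<n) ⟩
    sumR 0 n (λ w → M w x)                                ∎)
    where open ℤₚ.≤-Reasoning

  colBelow-occupied : ∀ x → x ≢ j → x < n → occupied x ≡ true → colBelow x ≡ 1ℤ
  colBelow-occupied x x≢j x<n occ with occupied-witness x occ
  ... | w , c<w , w<n , refl = ℤₚ.≤-antisym (colBelow-≤1 x x≢j x<n)
    (subst (_≤ℤ colBelow x) (M-ρ≡1 w w<n) (sumR-≥-term (suc c) n (λ w → M w x) (λ z _ _ → nonneg-off-col-j z x x≢j) w c<w w<n))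

  colBelow-unoccupied : ∀ x → occupied x ≡ false → colBelow x ≡ 0ℤ
  colBelow-unoccupied x unocc = sumR-zero (suc c) n _ (unoccupied x unocc)

  M2 : ℕMat
  M2 = step2 M1

  M2-upper : ∀ u v → u ≤ c → M2 u v ≡ M1 u v
  M2-upper u v u≤c rewrite ≤⇒<ᵇ≡false {c} {u} u≤c = refl

  prevOcc : ℕ → ℕ
  prevOcc = prevNZ M1

  private
    j+[v∸j]≡v : ∀ {v} → j < v → j ℕ.+ (v ∸ j) ≡ v
    j+[v∸j]≡v j<v = ℕₚ.m+[n∸m]≡n (ℕₚ.<⇒≤ j<v)

  prevOcc-spec : ∀ v → j < v →
    j ≤ prevOcc v × prevOcc v < v × occupied (prevOcc v) ≡ true × (∀ z → prevOcc v < z → z < v → occupied z ≡ false)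
  prevOcc-spec v j<v with searchDown-spec occupied j (v ∸ j) j ℕₚ.≤-refl (subst (j <_) (sym (j+[v∸j]≡v j<v)) j<v) occupied-j
  ... | j≤p , p<v , occ , above = j≤p , subst (prevOcc v <_) (j+[v∸j]≡v j<v) p<v , occ ,
                                  λ z p<z z<v → above z p<z (subst (z <_) (sym (j+[v∸j]≡v j<v)) z<v)

  -- The columns receiving a displaced column of the extended closing cell.
  isTarget : ℕ → Bool
  isTarget v = (v ≡ᵇ q) ∨ occupied v

  isTarget-q : isTarget q ≡ true
  isTarget-q rewrite ≡ᵇ-refl q = refl

  isTarget-occupied : ∀ z → occupied z ≡ true → isTarget z ≡ true
  isTarget-occupied z occ rewrite occ = ∨-zeroʳ (z ≡ᵇ q)

  nextTarget : ℕ → ℕ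
  nextTarget x = searchUp isTarget (suc x) (q ∸ x)

  private
    suc-x+[q∸x]≡suc-q : ∀ {x} → x < q → suc x ℕ.+ (q ∸ x) ≡ suc q
    suc-x+[q∸x]≡suc-q x<q = cong suc (ℕₚ.m+[n∸m]≡n (ℕₚ.<⇒≤ x<q))

  nextTarget-≤ : ∀ x v → x < v → v ≤ q → isTarget v ≡ true → nextTarget x ≤ v
  nextTarget-≤ x v x<v v≤q target = searchUp-≤-witness isTarget (suc x) (q ∸ x) v x<v
    (subst (v <_) (sym (suc-x+[q∸x]≡suc-q (ℕₚ.<-≤-trans x<v v≤q))) (s≤s v≤q)) target

  nextTarget-spec : ∀ x → x < q →
    x < nextTarget x × nextTarget x ≤ q × isTarget (nextTarget x) ≡ true × (∀ y → x < y → y < nextTarget x → isTarget y ≡ false)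
  nextTarget-spec x x<q = x<t , t≤q , target , searchUp-minimal isTarget (suc x) (q ∸ x)
    where
    x<t : x < nextTarget x
    x<t = searchUp-≥ isTarget (suc x) (q ∸ x)
    t≤q : nextTarget x ≤ q
    t≤q = nextTarget-≤ x q x<q ℕₚ.≤-refl isTarget-q
    target : isTarget (nextTarget x) ≡ true
    target = searchUp-found isTarget (suc x) (q ∸ x) (subst (nextTarget x <_) (sym (suc-x+[q∸x]≡suc-q x<q)) (s≤s t≤q))

  -- Consecutive occupied columns and target columns correspond: this is the horizontal displacement H.
  prevOcc≡ᵇ≡nextTarget : ∀ x v → j ≤ x → x < q → occupied x ≡ true → j < v → v ≤ q → isTarget v ≡ true →
    (prevOcc v ≡ᵇ x) ≡ (v ≡ᵇ nextTarget x)
  prevOcc≡ᵇ≡nextTarget x v j≤x x<q occ-x j<v v≤q target-v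
    with prevOcc-spec v j<v | nextTarget-spec x x<q
  ... | _ , p<v , occ-p , no-occupied-between | x<t , _ , target-t , no-target-between
    with prevOcc v ≡ᵇ x | ≡ᵇ-reflects-≡ (prevOcc v) x
  ...   | true  | ofʸ refl = sym (subst (λ z → (v ≡ᵇ z) ≡ true) v≡t (≡ᵇ-refl v))
    where
    v≡t : v ≡ nextTarget x
    v≡t with ℕₚ.m≤n⇒m<n∨m≡n (nextTarget-≤ x v p<v v≤q target-v)
    ... | inj₂ t≡v = sym t≡v
    ... | inj₁ t<v = ⊥-elim (true≢false (trans (sym target-t)
                       (cong₂ _∨_ (≢⇒≡ᵇ≡false (ℕₚ.<⇒≢ (ℕₚ.<-≤-trans t<v v≤q))) (no-occupied-between (nextTarget x) x<t t<v))))
  ...   | false | ofⁿ p≢x = sym (≢⇒≡ᵇ≡false v≢t)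
    where
    v≢t : v ≢ nextTarget x
    v≢t refl with ℕₚ.<-cmp (prevOcc v) x
    ... | tri≈ _ p≡x _ = p≢x p≡x
    ... | tri< p<x _ _ = true≢false (trans (sym occ-x) (no-occupied-between x p<x x<t))
    ... | tri> _ _ x<p = true≢false (trans (sym (isTarget-occupied (prevOcc v) occ-p)) (no-target-between (prevOcc v) x<p p<v))

  τ : ℕ → ℕ
  τ x = if (j ≤ᵇ x) ∧ (x <ᵇ q) then nextTarget x else x

  τ-inside : ∀ x → j ≤ x → x < q → τ x ≡ nextTarget x
  τ-inside x j≤x x<q rewrite ≤⇒≤ᵇ≡true j≤x | <⇒<ᵇ≡true x<q = refl

  τ-left : ∀ x → x < j → τ x ≡ x
  τ-left x x<j rewrite <⇒≤ᵇ≡false x<j = refl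

  τ-right : ∀ x → q ≤ x → τ x ≡ x
  τ-right x q≤x rewrite ≤⇒<ᵇ≡false {x} {q} q≤x | ∧-zeroʳ (j ≤ᵇ x) = refl

  module RowBelowClosing (u : ℕ) (c<u : c < u) (u<n : u < n) where
    private
      inECC≡ : ∀ v → inECC u v ≡ (j ≤ᵇ v) ∧ (v ≤ᵇ q)
      inECC≡ v rewrite <⇒<ᵇ≡true c<u | <⇒<ᵇ≡true u<n = refl

    M2-left : ∀ v → v < j → M2 u v ≡ M1 u v
    M2-left v v<j rewrite inECC≡ v | <⇒≤ᵇ≡false v<j = refl

    M2-j : M2 u j ≡ 0ℤ
    M2-j rewrite inECC≡ j | ≤⇒≤ᵇ≡true (ℕₚ.≤-refl {j}) | ≤⇒≤ᵇ≡true (ℕₚ.<⇒≤ j<q) | ≤⇒<ᵇ≡false {j} {j} ℕₚ.≤-refl = refl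

    M2-target : ∀ v → j < v → v ≤ q → isTarget v ≡ true → M2 u v ≡ M1 u (prevOcc v)
    M2-target v j<v v≤q target rewrite inECC≡ v | ≤⇒≤ᵇ≡true (ℕₚ.<⇒≤ j<v) | ≤⇒≤ᵇ≡true v≤q | <⇒<ᵇ≡true j<v | target = refl

    M2-nontarget : ∀ v → j < v → v ≤ q → isTarget v ≡ false → M2 u v ≡ 0ℤ
    M2-nontarget v j<v v≤q ¬target rewrite inECC≡ v | ≤⇒≤ᵇ≡true (ℕₚ.<⇒≤ j<v) | ≤⇒≤ᵇ≡true v≤q | <⇒<ᵇ≡true j<v | ¬target = refl

    M2-right : ∀ v → q < v → M2 u v ≡ M1 u v
    M2-right v q<v rewrite inECC≡ v | <⇒≤ᵇ≡false q<v | ∧-zeroʳ (j ≤ᵇ v) = refl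

    private
      x : ℕ
      x = ρ u

      x≢q : x ≢ q
      x≢q = ρ≢q u u<n (ℕₚ.>⇒≢ c<u)

      middle-zero-outside : (x < j ⊎ q < x) → ∀ v → j ≤ v → v ≤ q → M2 u v ≡ 0ℤ
      middle-zero-outside x-outside v j≤v v≤q with ℕₚ.m≤n⇒m<n∨m≡n j≤v
      ... | inj₂ refl = M2-j
      ... | inj₁ j<v with true⊎false (isTarget v)
      ...   | inj₂ target = M2-nontarget v j<v v≤q target
      ...   | inj₁ target = trans (M2-target v j<v v≤q target) (trans (M1-matrix u (prevOcc v) u<n) (χ-≢ᵇ p≢x))
        where
        p≢x : prevOcc v ≢ x
        p≢x p≡x with prevOcc-spec v j<v
        ... | j≤p , p<v , _ = [ (λ x<j → ℕₚ.<⇒≱ x<j (subst (j ≤_) p≡x j≤p))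
                              , (λ q<x → ℕₚ.<⇒≱ q<x (subst (_≤ q) p≡x (ℕₚ.<⇒≤ (ℕₚ.<-≤-trans p<v v≤q)))) ]′ x-outside

      x-outside-fixed : (x < j ⊎ q < x) → ∀ v → M2 u v ≡ χ (v ≡ᵇ x)
      x-outside-fixed x-out v with ℕₚ.<-≤-connex v j | ℕₚ.<-≤-connex q v
      ... | inj₁ v<j | _        = trans (M2-left v v<j) (M1-matrix u v u<n)
      ... | inj₂ _   | inj₁ q<v = trans (M2-right v q<v) (M1-matrix u v u<n)
      ... | inj₂ j≤v | inj₂ v≤q = trans (middle-zero-outside x-out v j≤v v≤q) (sym (χ-≢ᵇ v≢x))
        where
        v≢x : v ≢ x
        v≢x refl = [ (λ x<j → ℕₚ.<⇒≱ x<j j≤v) , (λ q<x → ℕₚ.<⇒≱ q<x v≤q) ]′ x-out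

      t : ℕ
      t = nextTarget x

    M2-below-c : ∀ v → M2 u v ≡ χ (v ≡ᵇ τ x)
    M2-below-c v with ℕₚ.<-≤-connex x j | ℕₚ.<-≤-connex x q
    ... | inj₁ x<j | _        rewrite τ-left x x<j  = x-outside-fixed (inj₁ x<j) v
    ... | inj₂ _   | inj₂ q≤x rewrite τ-right x q≤x = x-outside-fixed (inj₂ (ℕₚ.≤∧≢⇒< q≤x (x≢q ∘ sym))) v
    ... | inj₂ j≤x | inj₁ x<q rewrite τ-inside x j≤x x<q = inside
      where
      x<t : x < t
      x<t = proj₁ (nextTarget-spec x x<q)
      t≤q : t ≤ q
      t≤q = proj₁ (proj₂ (nextTarget-spec x x<q))
      inside : M2 u v ≡ χ (v ≡ᵇ t)
      inside with ℕₚ.<-≤-connex v j | ℕₚ.<-≤-connex q v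
      ... | inj₁ v<j | _ = trans (M2-left v v<j) (trans (M1-matrix u v u<n)
                             (trans (χ-≢ᵇ (λ v≡x → ℕₚ.<⇒≱ v<j (subst (j ≤_) (sym v≡x) j≤x)))
                                    (sym (χ-≢ᵇ (λ v≡t → ℕₚ.<⇒≱ v<j (subst (j ≤_) (sym v≡t) (ℕₚ.<⇒≤ (ℕₚ.≤-<-trans j≤x x<t))))))))
      ... | inj₂ _ | inj₁ q<v = trans (M2-right v q<v) (trans (M1-matrix u v u<n)
                             (trans (χ-≢ᵇ (λ v≡x → ℕₚ.<-asym q<v (subst (_< q) (sym v≡x) x<q)))
                                    (sym (χ-≢ᵇ (λ v≡t → ℕₚ.<⇒≱ q<v (subst (_≤ q) (sym v≡t) t≤q))))))
      ... | inj₂ j≤v | inj₂ v≤q with ℕₚ.m≤n⇒m<n∨m≡n j≤v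
      ...   | inj₂ refl = trans M2-j (sym (χ-≢ᵇ (λ j≡t → ℕₚ.<-irrefl j≡t (ℕₚ.≤-<-trans j≤x x<t))))
      ...   | inj₁ j<v with true⊎false (isTarget v)
      ...     | inj₂ target = trans (M2-nontarget v j<v v≤q target) (sym (χ-≢ᵇ v≢t))
        where
        v≢t : v ≢ t
        v≢t refl = true≢false (trans (sym (proj₁ (proj₂ (proj₂ (nextTarget-spec x x<q))))) target)
      ...     | inj₁ target = trans (M2-target v j<v v≤q target) (trans (M1-matrix u (prevOcc v) u<n)
                          (cong χ (prevOcc≡ᵇ≡nextTarget x v j≤x x<q (occupied-ρ u c<u u<n) j<v v≤q target)))

  M2-01 : ∀ u v → Is01 (M2 u v)
  M2-01 u v with inECC u v
  ... | false = M1-01 u v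
  ... | true with (j <ᵇ v) ∧ ((v ≡ᵇ q) ∨ occupied v)
  ...   | true  = M1-01 u (prevOcc v)
  ...   | false = inj₁ refl

  M3 : ℕMat
  M3 = step3 M2

  isLeft : ℕ → Bool
  isLeft = nzRow M2

  isLeft≡ρ<ᵇj : ∀ u → u ≤ c → u < n → isLeft u ≡ (ρ u <ᵇ j)
  isLeft≡ρ<ᵇj u u≤c u<n with ρ u <ᵇ j | ℕₚ.<ᵇ-reflects-< (ρ u) j
  ... | true  | ofʸ ρu<j = anyR-true _ 0 j (ρ u) z≤n ρu<j nonzero
    where
    nonzero : not (M2 u (ρ u) == 0ℤ) ≡ true
    nonzero rewrite M2-upper u (ρ u) u≤c | M1-matrix u (ρ u) u<n | ≡ᵇ-refl (ρ u) = refl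
  ... | false | ofⁿ ρu≮j = anyR-false _ 0 j zero-left
    where
    zero-left : ∀ x → 0 ≤ x → x < j → not (M2 u x == 0ℤ) ≡ false
    zero-left x _ x<j rewrite M2-upper u x u≤c | M1-matrix u x u<n
                            | ≢⇒≡ᵇ≡false {x} {ρ u} (λ x≡ρu → ρu≮j (subst (_< j) x≡ρu x<j)) = refl

  isLeft-c : isLeft c ≡ true
  isLeft-c = trans (isLeft≡ρ<ᵇj c ℕₚ.≤-refl c<n) (<⇒<ᵇ≡true ρc<j)

  nextLeft : ℕ → ℕ
  nextLeft = nextNZ M2

  <nextLeft : ∀ p → p < nextLeft p
  <nextLeft p = searchUp-≥ isLeft (suc p) (c ∸ suc p)

  nextLeft≤c : ∀ p → p < c → nextLeft p ≤ c
  nextLeft≤c p p<c = subst (nextLeft p ≤_) (ℕₚ.m+[n∸m]≡n p<c) (searchUp-≤ isLeft (suc p) (c ∸ suc p))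

  nextLeft<n : ∀ p → p < c → nextLeft p < n
  nextLeft<n p p<c = ℕₚ.≤-<-trans (nextLeft≤c p p<c) c<n

  isLeft-nextLeft : ∀ p → p < c → isLeft (nextLeft p) ≡ true
  isLeft-nextLeft p p<c with ℕₚ.m≤n⇒m<n∨m≡n (nextLeft≤c p p<c)
  ... | inj₁ nl<c  = searchUp-found isLeft (suc p) (c ∸ suc p) (subst (nextLeft p <_) (sym (ℕₚ.m+[n∸m]≡n p<c)) nl<c)
  ... | inj₂ nl≡c = subst (λ z → isLeft z ≡ true) (sym nl≡c) isLeft-c

  nextLeft-minimal : ∀ p y → p < y → y < nextLeft p → isLeft y ≡ false
  nextLeft-minimal p = searchUp-minimal isLeft (suc p) (c ∸ suc p)

  isLeft⇒ρ<j : ∀ u → u ≤ c → isLeft u ≡ true → ρ u < j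
  isLeft⇒ρ<j u u≤c left = <ᵇ≡true⇒< (trans (sym (isLeft≡ρ<ᵇj u u≤c (ℕₚ.≤-<-trans u≤c c<n))) left)

  ¬isLeft⇒j<ρ : ∀ p → k < p → p < c → isLeft p ≡ false → j < ρ p
  ¬isLeft⇒j<ρ p k<p p<c right = ℕₚ.≤∧≢⇒< j≤ρp (ρ≢j-enclosed p k<p p<c ∘ sym)
    where
    j≤ρp : j ≤ ρ p
    j≤ρp = <ᵇ≡false⇒≥ (trans (sym (isLeft≡ρ<ᵇj p (ℕₚ.<⇒≤ p<c) (ℕₚ.<-trans p<c c<n))) right)

  ρ-nextLeft<j : ∀ p → p < c → ρ (nextLeft p) < j
  ρ-nextLeft<j p p<c = isLeft⇒ρ<j (nextLeft p) (nextLeft≤c p p<c) (isLeft-nextLeft p p<c)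

  M3-01 : ∀ u v → Is01 (M3 u v)
  M3-01 u v with inENC u v
  ... | false = M2-01 u v
  ... | true with (u <ᵇ c) ∧ ((u ≡ᵇ k) ∨ isLeft u)
  ...   | true  = M2-01 (nextLeft u) v
  ...   | false = inj₁ refl

  M3-outside-ENC : ∀ u v → inENC u v ≡ false → M3 u v ≡ M2 u v
  M3-outside-ENC u v outside rewrite outside = refl

  M3-pulled : ∀ p v → k ≤ p → p < c → v < j → ((p ≡ᵇ k) ∨ isLeft p) ≡ true → M3 p v ≡ χ (v ≡ᵇ ρ (nextLeft p))
  M3-pulled p v k≤p p<c v<j pulled rewrite ≤⇒≤ᵇ≡true k≤p | ≤⇒≤ᵇ≡true (ℕₚ.<⇒≤ p<c) | <⇒<ᵇ≡true v<j | <⇒<ᵇ≡true p<c | pulled =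
    trans (M2-upper (nextLeft p) v (nextLeft≤c p p<c)) (M1-matrix (nextLeft p) v (nextLeft<n p p<c))

  M3-not-pulled : ∀ p v → k ≤ p → p < c → v < j → ((p ≡ᵇ k) ∨ isLeft p) ≡ false → M3 p v ≡ 0ℤ
  M3-not-pulled p v k≤p p<c v<j ¬pulled
    rewrite ≤⇒≤ᵇ≡true k≤p | ≤⇒≤ᵇ≡true (ℕₚ.<⇒≤ p<c) | <⇒<ᵇ≡true v<j | <⇒<ᵇ≡true p<c | ¬pulled = refl

  inENC-right : ∀ u v → j ≤ v → inENC u v ≡ false
  inENC-right u v j≤v rewrite ≤⇒<ᵇ≡false {v} {j} j≤v | ∧-zeroʳ (u ≤ᵇ c) = ∧-zeroʳ (k ≤ᵇ u)

  inENC-inside : ∀ u v → k ≤ u → u ≤ c → v < j → inENC u v ≡ true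
  inENC-inside u v k≤u u≤c v<j rewrite ≤⇒≤ᵇ≡true k≤u | ≤⇒≤ᵇ≡true u≤c | <⇒<ᵇ≡true v<j = refl

  inCell-above-k : ∀ u v → u < k → inCell u v ≡ false
  inCell-above-k u v u<k rewrite <⇒≤ᵇ≡false {k} {u} u<k | ≤⇒<ᵇ≡false {k} {u} (ℕₚ.<⇒≤ u<k) = refl

  inCell-right-upto-k : ∀ u v → u ≤ k → j ≤ v → inCell u v ≡ false
  inCell-right-upto-k u v u≤k j≤v rewrite inENC-right u v j≤v | ≤⇒<ᵇ≡false {k} {u} u≤k = refl

  inCell-left : ∀ u v → k ≤ u → u ≤ c → v < j → inCell u v ≡ true
  inCell-left u v k≤u u≤c v<j rewrite inENC-inside u v k≤u u≤c v<j = refl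

  inCell-charged : ∀ u v → k < u → u < c → j < v → v < n → inCell u v ≡ true
  inCell-charged u v k<u u<c j<v v<n
    rewrite inENC-right u v (ℕₚ.<⇒≤ j<v) | <⇒<ᵇ≡true k<u | <⇒<ᵇ≡true u<c | <⇒<ᵇ≡true j<v | <⇒<ᵇ≡true v<n = refl

  inCell-below-c : ∀ u v → c < u → inCell u v ≡ false
  inCell-below-c u v c<u rewrite <⇒≤ᵇ≡false c<u | ∧-zeroʳ (k ≤ᵇ u) | ≤⇒<ᵇ≡false {u} {c} (ℕₚ.<⇒≤ c<u) | ∧-zeroʳ (k <ᵇ u) = refl

  Mδ : ℕMat
  Mδ = step4 M3

  pushes : ℕ → ℕ → Bool
  pushes p v = inCell p v ∧ (M3 p v == 1ℤ)

  Mδ-suc : ∀ p v → Mδ (suc p) v ≡ (if pushes p v then 1ℤ else vacate M3 (suc p) v)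
  Mδ-suc p v = refl

  Mδ-not-pushed : ∀ u v → (∀ p → u ≡ suc p → inCell p v ≡ false) → Mδ u v ≡ vacate M3 u v
  Mδ-not-pushed zero    v _          = refl
  Mδ-not-pushed (suc p) v not-pushed rewrite not-pushed p refl = refl

  Mδ-above-k : ∀ u v → u < k → Mδ u v ≡ M1 u v
  Mδ-above-k u v u<k = begin
    Mδ u v          ≡⟨ Mδ-not-pushed u v (λ p u≡1+p → inCell-above-k p v (ℕₚ.<-trans (subst (p <_) (sym u≡1+p) ℕₚ.≤-refl) u<k)) ⟩
    vacate M3 u v   ≡⟨ vacated-outside (inCell u v) (M3 u v) (inCell-above-k u v u<k) ⟩
    M3 u v          ≡⟨ M3-outside-ENC u v inENC-above-k ⟩
    M2 u v          ≡⟨ M2-upper u v (ℕₚ.<⇒≤ (ℕₚ.<-trans u<k k<c)) ⟩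
    M1 u v          ∎
    where
    open ≡-Reasoning
    inENC-above-k : inENC u v ≡ false
    inENC-above-k rewrite <⇒≤ᵇ≡false {k} {u} u<k = refl

  Mδ-k : ∀ v → Mδ k v ≡ χ (v ≡ᵇ j)
  Mδ-k v = trans (Mδ-not-pushed k v (λ p k≡1+p → inCell-above-k p v (subst (p <_) (sym k≡1+p) ℕₚ.≤-refl))) vacated
    where
    vacated : vacate M3 k v ≡ χ (v ≡ᵇ j)
    vacated with ℕₚ.<-≤-connex v j
    ... | inj₁ v<j = trans (vacated-inside (inCell k v) (M3 k v) (M3-01 k v) (inCell-left k v ℕₚ.≤-refl (ℕₚ.<⇒≤ k<c) v<j))
                           (sym (χ-≢ᵇ (ℕₚ.<⇒≢ v<j)))
    ... | inj₂ j≤v = begin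
      vacate M3 k v       ≡⟨ vacated-outside (inCell k v) (M3 k v) (inCell-right-upto-k k v ℕₚ.≤-refl j≤v) ⟩
      M3 k v              ≡⟨ M3-outside-ENC k v (inENC-right k v j≤v) ⟩
      M2 k v              ≡⟨ M2-upper k v (ℕₚ.<⇒≤ k<c) ⟩
      M1 k v              ≡⟨ M1-matrix k v k<n ⟩
      χ (v ≡ᵇ ρ k)        ≡⟨ cong (λ z → χ (v ≡ᵇ z)) ρk≡j ⟩
      χ (v ≡ᵇ j)          ∎
      where open ≡-Reasoning

  -- Step 4 empties the enclosed rows and the closing row before refilling them from the row above.
  vacated-enclosed : ∀ u v → k < u → u ≤ c → v < n → vacate M3 u v ≡ 0ℤ
  vacated-enclosed u v k<u u≤c v<n with ℕₚ.<-≤-connex v j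
  ... | inj₁ v<j = vacated-inside (inCell u v) (M3 u v) (M3-01 u v) (inCell-left u v (ℕₚ.<⇒≤ k<u) u≤c v<j)
  ... | inj₂ j≤v with v ℕ.≟ ρ u
  ...   | no v≢ρu = vacated-zero (inCell u v) (M3 u v)
                      (trans (M3-outside-ENC u v (inENC-right u v j≤v))
                             (trans (M2-upper u v u≤c) (trans (M1-matrix u v (ℕₚ.≤-<-trans u≤c c<n)) (χ-≢ᵇ v≢ρu))))
  ...   | yes v≡ρu = vacated-inside (inCell u v) (M3 u v) (M3-01 u v) (inCell-charged u v k<u u<c j<v v<n)
    where
    u<c : u < c
    u<c = ℕₚ.≤∧≢⇒< u≤c (λ { refl → ℕₚ.<⇒≱ ρc<j (subst (j ≤_) v≡ρu j≤v) })
    j<v : j < v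
    j<v = ℕₚ.≤∧≢⇒< j≤v (λ j≡v → ρ≢j-enclosed u k<u u<c (trans (sym v≡ρu) (sym j≡v)))

  passed : ℕ → ℕ
  passed p = if (p ≡ᵇ k) ∨ isLeft p then ρ (nextLeft p) else ρ p

  pushes-pulled-left : ∀ p v → k ≤ p → p < c → v < j → ((p ≡ᵇ k) ∨ isLeft p) ≡ true → pushes p v ≡ (v ≡ᵇ ρ (nextLeft p))
  pushes-pulled-left p v k≤p p<c v<j pulled
    rewrite inCell-left p v k≤p (ℕₚ.<⇒≤ p<c) v<j | M3-pulled p v k≤p p<c v<j pulled = χ-==-1 (v ≡ᵇ ρ (nextLeft p))

  ρ-nextLeft≢right : ∀ p v → p < c → j ≤ v → (v ≡ᵇ ρ (nextLeft p)) ≡ false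
  ρ-nextLeft≢right p v p<c j≤v = ≢⇒≡ᵇ≡false (λ v≡ρ → ℕₚ.<⇒≱ (ρ-nextLeft<j p p<c) (subst (j ≤_) v≡ρ j≤v))

  pushes-k : ∀ v → v < n → pushes k v ≡ (v ≡ᵇ passed k)
  pushes-k v v<n = trans pushes≡ (cong (v ≡ᵇ_) (sym passed-k))
    where
    passed-k : passed k ≡ ρ (nextLeft k)
    passed-k rewrite ≡ᵇ-refl k = refl
    pushes≡ : pushes k v ≡ (v ≡ᵇ ρ (nextLeft k))
    pushes≡ with ℕₚ.<-≤-connex v j
    ... | inj₁ v<j = pushes-pulled-left k v ℕₚ.≤-refl k<c v<j (cong (_∨ isLeft k) (≡ᵇ-refl k))
    ... | inj₂ j≤v rewrite inCell-right-upto-k k v ℕₚ.≤-refl j≤v = sym (ρ-nextLeft≢right k v k<c j≤v)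

  passed-pulled : ∀ p → ((p ≡ᵇ k) ∨ isLeft p) ≡ true → passed p ≡ ρ (nextLeft p)
  passed-pulled p pulled rewrite pulled = refl

  not-pulled : ∀ p → k < p → isLeft p ≡ false → ((p ≡ᵇ k) ∨ isLeft p) ≡ false
  not-pulled p k<p right rewrite ≢⇒≡ᵇ≡false (ℕₚ.>⇒≢ k<p) = right

  passed-right : ∀ p → k < p → isLeft p ≡ false → passed p ≡ ρ p
  passed-right p k<p right rewrite not-pulled p k<p right = refl

  pushes-left : ∀ p v → k < p → p < c → v < n → isLeft p ≡ true → pushes p v ≡ (v ≡ᵇ ρ (nextLeft p))
  pushes-left p v k<p p<c v<n left with ℕₚ.<-≤-connex v j
  ... | inj₁ v<j = pushes-pulled-left p v (ℕₚ.<⇒≤ k<p) p<c v<j (trans (cong ((p ≡ᵇ k) ∨_) left) (∨-zeroʳ _))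
  ... | inj₂ j≤v rewrite M3-outside-ENC p v (inENC-right p v j≤v) | M2-upper p v (ℕₚ.<⇒≤ p<c) | M1-matrix p v (ℕₚ.<-trans p<c c<n)
                       | ≢⇒≡ᵇ≡false {v} {ρ p} (λ v≡ρp → ℕₚ.<⇒≱ (isLeft⇒ρ<j p (ℕₚ.<⇒≤ p<c) left) (subst (j ≤_) v≡ρp j≤v))
                       | ∧-zeroʳ (inCell p v) = sym (ρ-nextLeft≢right p v p<c j≤v)

  pushes-right : ∀ p v → k < p → p < c → v < n → isLeft p ≡ false → pushes p v ≡ (v ≡ᵇ ρ p)
  pushes-right p v k<p p<c v<n right with ℕₚ.<-≤-connex v j
  ... | inj₁ v<j rewrite M3-not-pulled p v (ℕₚ.<⇒≤ k<p) p<c v<j (not-pulled p k<p right) | ∧-zeroʳ (inCell p v) =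
    sym (≢⇒≡ᵇ≡false (λ v≡ρp → ℕₚ.<-asym v<j (subst (j <_) (sym v≡ρp) (¬isLeft⇒j<ρ p k<p p<c right))))
  ... | inj₂ j≤v rewrite M3-outside-ENC p v (inENC-right p v j≤v) | M2-upper p v (ℕₚ.<⇒≤ p<c) | M1-matrix p v (ℕₚ.<-trans p<c c<n)
    with ℕₚ.m≤n⇒m<n∨m≡n j≤v
  ...   | inj₁ j<v rewrite inCell-charged p v k<p p<c j<v v<n = χ-==-1 (v ≡ᵇ ρ p)
  ...   | inj₂ refl rewrite inENC-right p j ℕₚ.≤-refl | ≤⇒<ᵇ≡false {j} {j} ℕₚ.≤-refl | ∧-zeroʳ (p <ᵇ c) | ∧-zeroʳ (k <ᵇ p) =
    sym (≢⇒≡ᵇ≡false (ρ≢j-enclosed p k<p p<c ∘ sym))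

  pushes-enclosed : ∀ p v → k ≤ p → p < c → v < n → pushes p v ≡ (v ≡ᵇ passed p)
  pushes-enclosed p v k≤p p<c v<n with ℕₚ.m≤n⇒m<n∨m≡n k≤p | true⊎false (isLeft p)
  ... | inj₂ refl | _            = pushes-k v v<n
  ... | inj₁ k<p  | inj₁ left    = trans (pushes-left p v k<p p<c v<n left)
                                        (cong (v ≡ᵇ_) (sym (passed-pulled p (trans (cong ((p ≡ᵇ k) ∨_) left) (∨-zeroʳ _)))))
  ... | inj₁ k<p  | inj₂ right   = trans (pushes-right p v k<p p<c v<n right) (cong (v ≡ᵇ_) (sym (passed-right p k<p right)))

  Mδ-enclosed : ∀ p v → k ≤ p → p < c → v < n → Mδ (suc p) v ≡ χ (v ≡ᵇ passed p)
  Mδ-enclosed p v k≤p p<c v<n rewrite Mδ-suc p v | pushes-enclosed p v k≤p p<c v<n with v ≡ᵇ passed p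
  ... | true  = refl
  ... | false = vacated-enclosed (suc p) v (s≤s k≤p) p<c v<n

  pushes-below-c : ∀ p v → c ≤ p → pushes p v ≡ false
  pushes-below-c p v c≤p with ℕₚ.m≤n⇒m<n∨m≡n c≤p
  ... | inj₁ c<p rewrite inCell-below-c p v c<p = refl
  ... | inj₂ refl with ℕₚ.<-≤-connex v j
  ...   | inj₁ v<j rewrite inENC-inside c v (ℕₚ.<⇒≤ k<c) ℕₚ.≤-refl v<j | ≤⇒<ᵇ≡false {c} {c} ℕₚ.≤-refl = refl
  ...   | inj₂ j≤v rewrite inENC-right c v j≤v | ≤⇒<ᵇ≡false {c} {c} ℕₚ.≤-refl | ∧-zeroʳ (k <ᵇ c) = refl

  Mδ-below-c : ∀ u v → c < u → u < n → Mδ u v ≡ χ (v ≡ᵇ τ (ρ u))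
  Mδ-below-c (suc p) v (s≤s c≤p) u<n rewrite Mδ-suc p v | pushes-below-c p v c≤p = begin
    vacate M3 (suc p) v   ≡⟨ vacated-outside _ _ (inCell-below-c (suc p) v (s≤s c≤p)) ⟩
    M3 (suc p) v          ≡⟨ M3-outside-ENC (suc p) v inENC-below ⟩
    M2 (suc p) v          ≡⟨ RowBelowClosing.M2-below-c (suc p) (s≤s c≤p) u<n v ⟩
    χ (v ≡ᵇ τ (ρ (suc p))) ∎
    where
    open ≡-Reasoning
    inENC-below : inENC (suc p) v ≡ false
    inENC-below rewrite <⇒≤ᵇ≡false {suc p} {c} (s≤s c≤p) = ∧-zeroʳ (k ≤ᵇ suc p)

  -- δ(A) is the permutation matrix of ρδ.
  ρδ : ℕ → ℕ
  ρδ u = if u ≤ᵇ k then ρ u else (if u ≤ᵇ c then passed (u ∸ 1) else τ (ρ u))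

  ρδ-upto-k : ∀ u → u ≤ k → ρδ u ≡ ρ u
  ρδ-upto-k u u≤k rewrite ≤⇒≤ᵇ≡true u≤k = refl

  ρδ-enclosed : ∀ p → k ≤ p → p < c → ρδ (suc p) ≡ passed p
  ρδ-enclosed p k≤p p<c rewrite <⇒≤ᵇ≡false {suc p} {k} (s≤s k≤p) | ≤⇒≤ᵇ≡true p<c = refl

  ρδ-below-c : ∀ u → c < u → ρδ u ≡ τ (ρ u)
  ρδ-below-c u c<u rewrite <⇒≤ᵇ≡false {u} {k} (ℕₚ.<-trans k<c c<u) | <⇒≤ᵇ≡false c<u = refl

  Mδ-matrix : ∀ u v → u < n → v < n → Mδ u v ≡ χ (v ≡ᵇ ρδ u)
  Mδ-matrix u v u<n v<n with ℕₚ.<-cmp u k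
  ... | tri< u<k _ _  = trans (Mδ-above-k u v u<k) (trans (M1-matrix u v u<n) (cong (λ z → χ (v ≡ᵇ z)) (sym (ρδ-upto-k u (ℕₚ.<⇒≤ u<k)))))
  ... | tri≈ _ refl _ = trans (Mδ-k v) (cong (λ z → χ (v ≡ᵇ z)) (sym (trans (ρδ-upto-k u ℕₚ.≤-refl) ρk≡j)))
  ... | tri> _ _ k<u with ℕₚ.<-≤-connex c u
  ...   | inj₁ c<u = trans (Mδ-below-c u v c<u u<n) (cong (λ z → χ (v ≡ᵇ z)) (sym (ρδ-below-c u c<u)))
  ...   | inj₂ u≤c with u | k<u
  ...     | suc p | s≤s k≤p = trans (Mδ-enclosed p v k≤p u≤c v<n) (cong (λ z → χ (v ≡ᵇ z)) (sym (ρδ-enclosed p k≤p u≤c)))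

  τ-≥ : ∀ x → x ≤ τ x
  τ-≥ x with ℕₚ.<-≤-connex x j | ℕₚ.<-≤-connex x q
  ... | inj₁ x<j | _        = ℕₚ.≤-reflexive (sym (τ-left x x<j))
  ... | inj₂ j≤x | inj₁ x<q = subst (x ≤_) (sym (τ-inside x j≤x x<q)) (ℕₚ.<⇒≤ (proj₁ (nextTarget-spec x x<q)))
  ... | inj₂ _   | inj₂ q≤x = ℕₚ.≤-reflexive (sym (τ-right x q≤x))

  τ<n : ∀ x → x < n → τ x < n
  τ<n x x<n with ℕₚ.<-≤-connex x j | ℕₚ.<-≤-connex x q
  ... | inj₁ x<j | _        = subst (_< n) (sym (τ-left x x<j)) x<n
  ... | inj₂ j≤x | inj₁ x<q = subst (_< n) (sym (τ-inside x j≤x x<q)) (ℕₚ.≤-<-trans (proj₁ (proj₂ (nextTarget-spec x x<q))) q<n)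
  ... | inj₂ _   | inj₂ q≤x = subst (_< n) (sym (τ-right x q≤x)) x<n

  Displaceable : ℕ → Set
  Displaceable x = x ≢ q × (j ≤ x → x < q → occupied x ≡ true)

  displaceable-below-c : ∀ w → c < w → w < n → Displaceable (ρ w)
  displaceable-below-c w c<w w<n = ρ≢q w w<n (ℕₚ.>⇒≢ c<w) , λ _ _ → occupied-ρ w c<w w<n

  τ-monotone : ∀ x y → Displaceable x → Displaceable y → x < y → τ x < τ y
  τ-monotone x y (x≢q , _) (y≢q , y-occ) x<y with ℕₚ.<-≤-connex x j | ℕₚ.<-≤-connex x q
  ... | inj₁ x<j | _ rewrite τ-left x x<j = ℕₚ.<-≤-trans x<y (τ-≥ y)
  ... | inj₂ j≤x | inj₂ q≤x rewrite τ-right x q≤x | τ-right y (ℕₚ.<⇒≤ (ℕₚ.≤-<-trans q≤x x<y)) = x<y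
  ... | inj₂ j≤x | inj₁ x<q rewrite τ-inside x j≤x x<q with ℕₚ.<-≤-connex y q
  ...   | inj₂ q≤y = ℕₚ.≤-<-trans (proj₁ (proj₂ (nextTarget-spec x x<q)))
                                  (subst (q <_) (sym (τ-right y q≤y)) (ℕₚ.≤∧≢⇒< q≤y (y≢q ∘ sym)))
  ...   | inj₁ y<q = ℕₚ.≤-<-trans (nextTarget-≤ x y x<y (ℕₚ.<⇒≤ y<q) (isTarget-occupied y (y-occ j≤y y<q)))
                                  (subst (y <_) (sym (τ-inside y j≤y y<q)) (proj₁ (nextTarget-spec y y<q)))
    where
    j≤y : j ≤ y
    j≤y = ℕₚ.<⇒≤ (ℕₚ.≤-<-trans j≤x x<y)

  χ-τ-<ᵇ : ∀ x y → Displaceable x → Displaceable y → x ≢ y → χ (τ y <ᵇ τ x) ≡ χ (y <ᵇ x)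
  χ-τ-<ᵇ x y dx dy x≢y with ℕₚ.<-cmp x y
  ... | tri< x<y _ _ rewrite ≤⇒<ᵇ≡false {τ y} {τ x} (ℕₚ.<⇒≤ (τ-monotone x y dx dy x<y)) | ≤⇒<ᵇ≡false {y} {x} (ℕₚ.<⇒≤ x<y) = refl
  ... | tri≈ _ x≡y _ = ⊥-elim (x≢y x≡y)
  ... | tri> _ _ y<x rewrite <⇒<ᵇ≡true (τ-monotone y x dy dx y<x) | <⇒<ᵇ≡true y<x = refl

  passed<n : ∀ p → k ≤ p → p < c → passed p < n
  passed<n p k≤p p<c with (p ≡ᵇ k) ∨ isLeft p
  ... | true  = ρ<n (nextLeft p) (nextLeft<n p p<c)
  ... | false = ρ<n p (ℕₚ.<-trans p<c c<n)

  ρδ<n : ∀ u → u < n → ρδ u < n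
  ρδ<n u u<n with ℕₚ.<-≤-connex k u | ℕₚ.<-≤-connex c u
  ... | inj₂ u≤k | _        = subst (_< n) (sym (ρδ-upto-k u u≤k)) (ρ<n u u<n)
  ... | inj₁ _   | inj₁ c<u = subst (_< n) (sym (ρδ-below-c u c<u)) (τ<n (ρ u) (ρ<n u u<n))
  ... | inj₁ k<u | inj₂ u≤c with u | k<u
  ...   | suc p | s≤s k≤p = subst (_< n) (sym (ρδ-enclosed p k≤p u≤c)) (passed<n p k≤p u≤c)

inversions : (ℕ → ℕ) → ℕ → ℕ → ℤ
inversions f lo hi = sumR lo hi (λ u → sumR (suc u) hi (λ w → χ (f w <ᵇ f u)))

crossInversions : (ℕ → ℕ) → ℕ → ℕ → ℕ → ℤ
crossInversions f lo mid hi = sumR lo mid (λ u → sumR mid hi (λ w → χ (f w <ᵇ f u)))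

inversions-split : ∀ f lo mid hi → lo ≤ mid → mid ≤ hi →
  inversions f lo hi ≡ inversions f lo mid + inversions f mid hi + crossInversions f lo mid hi
inversions-split f lo mid hi lo≤mid mid≤hi = begin
  inversions f lo hi
    ≡⟨ sumR-split lo mid hi _ lo≤mid mid≤hi ⟩
  sumR lo mid (λ u → sumR (suc u) hi (λ w → χ (f w <ᵇ f u))) + inversions f mid hi
    ≡⟨ cong (_+ inversions f mid hi) (trans (sumR-cong lo mid (λ u _ u<mid → sumR-split (suc u) mid hi _ u<mid mid≤hi))
                                            (sumR-+ lo mid _ _)) ⟩
  inversions f lo mid + crossInversions f lo mid hi + inversions f mid hi
    ≡⟨ swap (inversions f lo mid) (crossInversions f lo mid hi) (inversions f mid hi) ⟩
  inversions f lo mid + inversions f mid hi + crossInversions f lo mid hi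
    ∎
  where
  open ≡-Reasoning
  swap : ∀ a b c → a + b + c ≡ a + c + b
  swap = solve-∀

inversions-empty : ∀ f lo hi → hi ≤ lo → inversions f lo hi ≡ 0ℤ
inversions-empty f lo hi = sumR-empty lo hi _

inversions-single : ∀ f x → inversions f x (suc x) ≡ 0ℤ
inversions-single f x = trans (sumR-single x _) (sumR-empty (suc x) (suc x) _ ℕₚ.≤-refl)

sumR-drop-zero-head : ∀ lo hi (f : ℕ → ℤ) → lo ≤ hi → f lo ≡ 0ℤ → sumR lo hi f ≡ sumR (suc lo) hi f
sumR-drop-zero-head lo hi f lo≤hi f-lo≡0 with ℕₚ.m≤n⇒m<n∨m≡n lo≤hi
... | inj₁ lo<hi = trans (sumR-cons lo hi f lo<hi) (trans (cong (_+ sumR (suc lo) hi f) f-lo≡0) (ℤₚ.+-identityˡ _))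
... | inj₂ refl  = trans (sumR-empty lo lo f ℕₚ.≤-refl) (sym (sumR-empty (suc lo) lo f (ℕₚ.n≤1+n lo)))

-- Between the opening and the closing row, ρδ cyclically rotates ρ on each segment (s, nextLeft s]
-- that starts at k or at a row with its 1 in the left side.
module Segments {n : ℕ} {M : ℕMat} {k c j q : ℕ} (S : OneNegative n M k c j q) where
  open OneNegative S
  open Structure S
  open Discharged S

  SegmentStart : ℕ → Set
  SegmentStart s = s ≡ k ⊎ (k < s × s ≤ c × isLeft s ≡ true)

  start-k≤ : ∀ {s} → SegmentStart s → k ≤ s
  start-k≤ (inj₁ refl)         = ℕₚ.≤-refl
  start-k≤ (inj₂ (k<s , _ , _)) = ℕₚ.<⇒≤ k<s

  start-pulled : ∀ {s} → SegmentStart s → ((s ≡ᵇ k) ∨ isLeft s) ≡ true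
  start-pulled {s} (inj₁ refl)          rewrite ≡ᵇ-refl s = refl
  start-pulled {s} (inj₂ (_ , _ , left)) rewrite left   = ∨-zeroʳ (s ≡ᵇ k)

  ρδ-segment-head : ∀ {s} → SegmentStart s → s < c → ρδ (suc s) ≡ ρ (nextLeft s)
  ρδ-segment-head {s} start s<c = trans (ρδ-enclosed s (start-k≤ start) s<c) (passed-pulled s (start-pulled start))

  module Segment {s : ℕ} (start : SegmentStart s) (s<c : s < c) where
    end : ℕ
    end = nextLeft s

    s<end : s < end
    s<end = <nextLeft s

    end≤c : end ≤ c
    end≤c = nextLeft≤c s s<c

    ρ-end<j : ρ end < j
    ρ-end<j = ρ-nextLeft<j s s<c

    next-start : SegmentStart end
    next-start = inj₂ (ℕₚ.≤-<-trans (start-k≤ start) s<end , end≤c , isLeft-nextLeft s s<c)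

    private
      k<p : ∀ {p} → s < p → k < p
      k<p s<p = ℕₚ.≤-<-trans (start-k≤ start) s<p

      p<c : ∀ {p} → p < end → p < c
      p<c p<end = ℕₚ.<-≤-trans p<end end≤c

    ρδ-segment-rest : ∀ p → s < p → p < end → ρδ (suc p) ≡ ρ p
    ρδ-segment-rest p s<p p<end =
      trans (ρδ-enclosed p (ℕₚ.<⇒≤ (k<p s<p)) (p<c p<end)) (passed-right p (k<p s<p) (nextLeft-minimal s p s<p p<end))

    j<ρ-inside : ∀ p → s < p → p < end → j < ρ p
    j<ρ-inside p s<p p<end = ¬isLeft⇒j<ρ p (k<p s<p) (p<c p<end) (nextLeft-minimal s p s<p p<end)

    segment-sum : ∀ (F : ℕ → ℤ) → sumR (suc s) (suc end) (F ∘ ρδ) ≡ sumR (suc s) (suc end) (F ∘ ρ)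
    segment-sum F = begin
      sumR (suc s) (suc end) (F ∘ ρδ)                   ≡⟨ sumR-cons (suc s) (suc end) _ (s≤s s<end) ⟩
      F (ρδ (suc s)) + sumR (suc (suc s)) (suc end) (F ∘ ρδ)
                                                         ≡⟨ cong₂ _+_ (cong F (ρδ-segment-head start s<c))
                                                                      (trans (sumR-shift (suc s) end _)
                                                                             (sumR-cong (suc s) end (λ p s<p p<end → cong F (ρδ-segment-rest p s<p p<end)))) ⟩
      F (ρ end) + sumR (suc s) end (F ∘ ρ)              ≡⟨ ℤₚ.+-comm (F (ρ end)) _ ⟩
      sumR (suc s) end (F ∘ ρ) + F (ρ end)              ≡⟨ sym (sumR-snoc (suc s) end _ s<end) ⟩
      sumR (suc s) (suc end) (F ∘ ρ)                    ∎
      where open ≡-Reasoning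

    -- Moving ρ end (< j) in front of the rows of the segment, whose 1s lie right of j, removes one inversion per row.
    segment-inversions : inversions ρδ (suc s) (suc end) ≡ inversions ρ (suc s) (suc end) - sumR (suc s) end (λ u → χ (j <ᵇ ρ u))
    segment-inversions = trans lhs (sym rhs)
      where
      right : ℤ
      right = sumR (suc s) end (λ u → χ (j <ᵇ ρ u))
      head-row : sumR (suc (suc s)) (suc end) (λ w → χ (ρδ w <ᵇ ρδ (suc s))) ≡ 0ℤ
      head-row = trans (sumR-shift (suc s) end _) (sumR-zero (suc s) end _ no-inversion)
        where
        no-inversion : ∀ p → suc s ≤ p → p < end → χ (ρδ (suc p) <ᵇ ρδ (suc s)) ≡ 0ℤ
        no-inversion p s<p p<end rewrite ρδ-segment-rest p s<p p<end | ρδ-segment-head start s<c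
          | ≤⇒<ᵇ≡false {ρ p} {ρ end} (ℕₚ.<⇒≤ (ℕₚ.<-trans ρ-end<j (j<ρ-inside p s<p p<end))) = refl
      rest-rows : sumR (suc (suc s)) (suc end) (λ u → sumR (suc u) (suc end) (λ w → χ (ρδ w <ᵇ ρδ u))) ≡ inversions ρ (suc s) end
      rest-rows = trans (sumR-shift (suc s) end _) (sumR-cong (suc s) end (λ u s<u u<end →
                    trans (sumR-shift (suc u) end _) (sumR-cong (suc u) end (λ w u<w w<end →
                      cong₂ (λ a b → χ (a <ᵇ b)) (ρδ-segment-rest w (ℕₚ.<-trans s<u u<w) w<end) (ρδ-segment-rest u s<u u<end)))))
      lhs : inversions ρδ (suc s) (suc end) ≡ inversions ρ (suc s) end
      lhs = trans (sumR-cons (suc s) (suc end) _ (s≤s s<end)) (trans (cong₂ _+_ head-row rest-rows) (ℤₚ.+-identityˡ _))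
      cross : crossInversions ρ (suc s) end (suc end) ≡ right
      cross = sumR-cong (suc s) end (λ u s<u u<end → trans (sumR-single end _) (both-right u s<u u<end))
        where
        both-right : ∀ u → suc s ≤ u → u < end → χ (ρ end <ᵇ ρ u) ≡ χ (j <ᵇ ρ u)
        both-right u s<u u<end rewrite <⇒<ᵇ≡true (ℕₚ.<-trans ρ-end<j (j<ρ-inside u s<u u<end)) | <⇒<ᵇ≡true (j<ρ-inside u s<u u<end) = refl
      rhs : inversions ρ (suc s) (suc end) - right ≡ inversions ρ (suc s) end
      rhs = trans (cong (_- right) (trans (inversions-split ρ (suc s) end (suc end) s<end (ℕₚ.n≤1+n end))
                                          (cong₂ (λ a b → inversions ρ (suc s) end + a + b) (inversions-single ρ end) cross)))
                  (cancel (inversions ρ (suc s) end) right)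
        where
        cancel : ∀ a b → a + 0ℤ + b - b ≡ a
        cancel = solve-∀

  private
    shorter : ∀ {s} (start : SegmentStart s) (s<c : s < c) → c ∸ Segment.end start s<c < c ∸ s
    shorter start s<c = ℕₚ.∸-monoʳ-< s<end end≤c
      where open Segment start s<c

  sum-from : ∀ s → Acc _<_ (c ∸ s) → SegmentStart s → s ≤ c → ∀ (F : ℕ → ℤ) →
    sumR (suc s) (suc c) (F ∘ ρδ) ≡ sumR (suc s) (suc c) (F ∘ ρ)
  sum-from s (acc rec) start s≤c F with ℕₚ.m≤n⇒m<n∨m≡n s≤c
  ... | inj₂ refl = trans (sumR-empty (suc s) (suc s) _ ℕₚ.≤-refl) (sym (sumR-empty (suc s) (suc s) _ ℕₚ.≤-refl))
  ... | inj₁ s<c = begin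
    sumR (suc s) (suc c) (F ∘ ρδ)                                       ≡⟨ split ⟩
    sumR (suc s) (suc end) (F ∘ ρδ) + sumR (suc end) (suc c) (F ∘ ρδ)   ≡⟨ cong₂ _+_ (segment-sum F)
                                                                           (sum-from end (rec (shorter start s<c)) next-start end≤c F) ⟩
    sumR (suc s) (suc end) (F ∘ ρ) + sumR (suc end) (suc c) (F ∘ ρ)     ≡⟨ sym split ⟩
    sumR (suc s) (suc c) (F ∘ ρ)                                        ∎
    where
    open ≡-Reasoning
    open Segment start s<c
    split : ∀ {f} → sumR (suc s) (suc c) f ≡ sumR (suc s) (suc end) f + sumR (suc end) (suc c) f
    split {f} = sumR-split (suc s) (suc end) (suc c) f (s≤s (ℕₚ.<⇒≤ s<end)) (s≤s end≤c)

  inversions-from : ∀ s → Acc _<_ (c ∸ s) → SegmentStart s → s ≤ c →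
    inversions ρδ (suc s) (suc c) ≡ inversions ρ (suc s) (suc c) - sumR (suc s) c (λ u → χ (j <ᵇ ρ u))
  inversions-from s (acc rec) start s≤c with ℕₚ.m≤n⇒m<n∨m≡n s≤c
  ... | inj₂ refl = trans (inversions-empty ρδ (suc s) (suc s) ℕₚ.≤-refl)
                          (sym (cong₂ _-_ (inversions-empty ρ (suc s) (suc s) ℕₚ.≤-refl) (sumR-empty (suc s) s _ (ℕₚ.n≤1+n s))))
  ... | inj₁ s<c = begin
    inversions ρδ (suc s) (suc c)
      ≡⟨ inversions-split ρδ (suc s) (suc end) (suc c) (s≤s (ℕₚ.<⇒≤ s<end)) (s≤s end≤c) ⟩
    inversions ρδ (suc s) (suc end) + inversions ρδ (suc end) (suc c) + crossInversions ρδ (suc s) (suc end) (suc c)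
      ≡⟨ cong₂ (λ a b → a + b + crossInversions ρδ (suc s) (suc end) (suc c))
               segment-inversions (inversions-from end (rec (shorter start s<c)) next-start end≤c) ⟩
    inversions ρ (suc s) (suc end) - right₁ + (inversions ρ (suc end) (suc c) - right₂) + crossInversions ρδ (suc s) (suc end) (suc c)
      ≡⟨ cong (inversions ρ (suc s) (suc end) - right₁ + (inversions ρ (suc end) (suc c) - right₂) +_) cross≡ ⟩
    inversions ρ (suc s) (suc end) - right₁ + (inversions ρ (suc end) (suc c) - right₂) + crossInversions ρ (suc s) (suc end) (suc c)
      ≡⟨ regroup (inversions ρ (suc s) (suc end)) (inversions ρ (suc end) (suc c)) (crossInversions ρ (suc s) (suc end) (suc c)) right₁ right₂ ⟩
    inversions ρ (suc s) (suc end) + inversions ρ (suc end) (suc c) + crossInversions ρ (suc s) (suc end) (suc c) - (right₁ + right₂)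
      ≡⟨ sym (cong₂ _-_ (inversions-split ρ (suc s) (suc end) (suc c) (s≤s (ℕₚ.<⇒≤ s<end)) (s≤s end≤c)) right≡) ⟩
    inversions ρ (suc s) (suc c) - sumR (suc s) c (λ u → χ (j <ᵇ ρ u))
      ∎
    where
    open ≡-Reasoning
    open Segment start s<c
    right₁ right₂ : ℤ
    right₁ = sumR (suc s) end (λ u → χ (j <ᵇ ρ u))
    right₂ = sumR (suc end) c (λ u → χ (j <ᵇ ρ u))
    cross≡ : crossInversions ρδ (suc s) (suc end) (suc c) ≡ crossInversions ρ (suc s) (suc end) (suc c)
    cross≡ = trans (sumR-cong (suc s) (suc end) (λ u _ _ → sum-from end (rec (shorter start s<c)) next-start end≤c (λ t → χ (t <ᵇ ρδ u))))
                   (segment-sum (λ y → sumR (suc end) (suc c) (λ w → χ (ρ w <ᵇ y))))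
    right≡ : sumR (suc s) c (λ u → χ (j <ᵇ ρ u)) ≡ right₁ + right₂
    right≡ = trans (sumR-split (suc s) end c _ s<end end≤c)
                   (cong (right₁ +_) (sumR-drop-zero-head end c _ end≤c (cong χ (≤⇒<ᵇ≡false (ℕₚ.<⇒≤ ρ-end<j)))))
    regroup : ∀ a b x s₁ s₂ → a - s₁ + (b - s₂) + x ≡ a + b + x - (s₁ + s₂)
    regroup = solve-∀

  enclosed-sum : ∀ (F : ℕ → ℤ) → sumR (suc k) (suc c) (F ∘ ρδ) ≡ sumR (suc k) (suc c) (F ∘ ρ)
  enclosed-sum = sum-from k (<-wellFounded _) (inj₁ refl) (ℕₚ.<⇒≤ k<c)

  enclosed-inversions : inversions ρδ (suc k) (suc c) ≡ inversions ρ (suc k) (suc c) - sumR (suc k) c (λ u → χ (j <ᵇ ρ u))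
  enclosed-inversions = inversions-from k (<-wellFounded _) (inj₁ refl) (ℕₚ.<⇒≤ k<c)

  sum-upto-c : ∀ r → r ≤ suc k → ∀ (F : ℕ → ℤ) → sumR r (suc c) (F ∘ ρδ) ≡ sumR r (suc c) (F ∘ ρ)
  sum-upto-c r r≤1+k F = begin
    sumR r (suc c) (F ∘ ρδ)                                  ≡⟨ split {F ∘ ρδ} ⟩
    sumR r (suc k) (F ∘ ρδ) + sumR (suc k) (suc c) (F ∘ ρδ)  ≡⟨ cong₂ _+_ (sumR-cong r (suc k) (λ u _ u≤k → cong F (ρδ-upto-k u (ℕₚ.≤-pred u≤k))))
                                                                         (enclosed-sum F) ⟩
    sumR r (suc k) (F ∘ ρ) + sumR (suc k) (suc c) (F ∘ ρ)    ≡⟨ sym (split {F ∘ ρ}) ⟩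
    sumR r (suc c) (F ∘ ρ)                                   ∎
    where
    open ≡-Reasoning
    split : ∀ {f} → sumR r (suc c) f ≡ sumR r (suc k) f + sumR (suc k) (suc c) f
    split {f} = sumR-split r (suc k) (suc c) f r≤1+k (s≤s (ℕₚ.<⇒≤ k<c))

hits : (ℕ → ℕ) → ℕ → ℕ → ℕ → ℕ → ℤ
hits f r₀ r₁ lo hi = sumR r₀ r₁ (λ u → χ (inRange lo hi (f u)))

module Statistics {n : ℕ} {M : ℕMat} {k c j q : ℕ} (S : OneNegative n M k c j q) where
  open OneNegative S
  open Structure S
  open Discharged S
  open Segments S

  -- The closing row differs from the row of ρ c by +1 in column q and -1 in column j.
  correction : ℕ → ℕ → ℤ
  correction lo hi = χ (inRange lo hi q) - χ (inRange lo hi j)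

  M-row-sum : ∀ u lo hi → u < n → hi ≤ n → sumR lo hi (M u) ≡ χ (inRange lo hi (ρ u)) + χ (u ≡ᵇ c) * correction lo hi
  M-row-sum u lo hi u<n hi≤n with u ℕ.≟ c
  ... | no u≢c = begin
    sumR lo hi (M u)                                  ≡⟨ sumR-cong lo hi (λ v _ _ → row u u<n u≢c v) ⟩
    sumR lo hi (λ v → χ (v ≡ᵇ ρ u))                   ≡⟨ sumR-χ≡ᵇ lo hi (ρ u) ⟩
    χ (inRange lo hi (ρ u))                           ≡⟨ sym (ℤₚ.+-identityʳ _) ⟩
    χ (inRange lo hi (ρ u)) + 0ℤ                      ≡⟨ cong (λ z → χ (inRange lo hi (ρ u)) + z * correction lo hi) (sym (χ-≢ᵇ u≢c)) ⟩
    χ (inRange lo hi (ρ u)) + χ (u ≡ᵇ c) * correction lo hi ∎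
    where open ≡-Reasoning
  ... | yes refl = begin
    sumR lo hi (M u)
      ≡⟨ sumR-cong lo hi (λ v _ _ → closing-row v) ⟩
    sumR lo hi (λ v → χ (v ≡ᵇ ρ u) + χ (v ≡ᵇ q) - χ (v ≡ᵇ j))
      ≡⟨ trans (sumR-- lo hi _ _) (cong (_- _) (sumR-+ lo hi _ _)) ⟩
    sumR lo hi (λ v → χ (v ≡ᵇ ρ u)) + sumR lo hi (λ v → χ (v ≡ᵇ q)) - sumR lo hi (λ v → χ (v ≡ᵇ j))
      ≡⟨ cong₂ _-_ (cong₂ _+_ (sumR-χ≡ᵇ lo hi (ρ u)) (sumR-χ≡ᵇ lo hi q)) (sumR-χ≡ᵇ lo hi j) ⟩
    χ (inRange lo hi (ρ u)) + χ (inRange lo hi q) - χ (inRange lo hi j)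
      ≡⟨ regroup (χ (inRange lo hi (ρ u))) (χ (inRange lo hi q)) (χ (inRange lo hi j)) ⟩
    χ (inRange lo hi (ρ u)) + 1ℤ * correction lo hi
      ≡⟨ cong (λ z → χ (inRange lo hi (ρ u)) + z * correction lo hi) (sym (χ-≡ᵇ {u} refl)) ⟩
    χ (inRange lo hi (ρ u)) + χ (u ≡ᵇ u) * correction lo hi
      ∎
    where
    open ≡-Reasoning
    regroup : ∀ a b d → a + b - d ≡ a + 1ℤ * (b - d)
    regroup = solve-∀

  M-rectangle : ∀ r₀ r₁ lo hi → r₀ ≤ c → c < r₁ → r₁ ≤ n → hi ≤ n →
    rectSum M r₀ r₁ lo hi ≡ hits ρ r₀ r₁ lo hi + correction lo hi
  M-rectangle r₀ r₁ lo hi r₀≤c c<r₁ r₁≤n hi≤n =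
    trans (sumR-cong r₀ r₁ (λ u _ u<r₁ → M-row-sum u lo hi (ℕₚ.<-≤-trans u<r₁ r₁≤n) hi≤n))
          (trans (sumR-+ r₀ r₁ _ _) (cong (hits ρ r₀ r₁ lo hi +_) (sumR-χ≡ᵇ* r₀ r₁ c (λ _ → correction lo hi) r₀≤c c<r₁)))

  M-rectangle-avoiding-c : ∀ r₀ r₁ lo hi → (∀ u → r₀ ≤ u → u < r₁ → u ≢ c) → r₁ ≤ n → hi ≤ n →
    rectSum M r₀ r₁ lo hi ≡ hits ρ r₀ r₁ lo hi
  M-rectangle-avoiding-c r₀ r₁ lo hi ≢c r₁≤n hi≤n = sumR-cong r₀ r₁ (λ u r₀≤u u<r₁ →
    trans (M-row-sum u lo hi (ℕₚ.<-≤-trans u<r₁ r₁≤n) hi≤n)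
          (trans (cong (λ z → χ (inRange lo hi (ρ u)) + z * correction lo hi) (χ-≢ᵇ (≢c u r₀≤u u<r₁))) (ℤₚ.+-identityʳ _)))

  M-rectangle-below-c : ∀ r₀ r₁ lo hi → c < r₀ → r₁ ≤ n → hi ≤ n → rectSum M r₀ r₁ lo hi ≡ hits ρ r₀ r₁ lo hi
  M-rectangle-below-c r₀ r₁ lo hi c<r₀ = M-rectangle-avoiding-c r₀ r₁ lo hi (λ u r₀≤u _ → ℕₚ.>⇒≢ (ℕₚ.<-≤-trans c<r₀ r₀≤u))

  M-rectangle-above-c : ∀ r₀ r₁ lo hi → r₁ ≤ c → hi ≤ n → rectSum M r₀ r₁ lo hi ≡ hits ρ r₀ r₁ lo hi
  M-rectangle-above-c r₀ r₁ lo hi r₁≤c hi≤n =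
    M-rectangle-avoiding-c r₀ r₁ lo hi (λ u _ u<r₁ → ℕₚ.<⇒≢ (ℕₚ.<-≤-trans u<r₁ r₁≤c)) (ℕₚ.≤-trans r₁≤c (ℕₚ.<⇒≤ c<n)) hi≤n

  private
    colBelow-M1 : ∀ x → sumR (suc c) n (λ w → M1 w x) ≡ colBelow x
    colBelow-M1 x = sumR-cong (suc c) n (λ w c<w _ → M1-below-c w x c<w)

    colBelow-q : colBelow q ≡ 0ℤ
    colBelow-q = sumR-zero (suc c) n _ (λ w c<w _ → col-q-only-c w (ℕₚ.>⇒≢ c<w))

    colBelow-prevOcc : ∀ v → j < v → v ≤ q → colBelow (prevOcc v) ≡ 1ℤ
    colBelow-prevOcc v j<v v≤q with prevOcc v ℕ.≟ j | prevOcc-spec v j<v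
    ... | yes p≡j | _                  = trans (cong colBelow p≡j) colBelow-j
    ... | no  p≢j | _ , p<v , occ , _ = colBelow-occupied (prevOcc v) p≢j (ℕₚ.<-trans p<v (ℕₚ.≤-<-trans v≤q q<n)) occ

    untouched : ∀ v → v ≢ j → v ≢ q → colBelow v - χ (v ≡ᵇ j) + χ (v ≡ᵇ q) ≡ colBelow v
    untouched v v≢j v≢q rewrite χ-≢ᵇ v≢j | χ-≢ᵇ v≢q = trans (ℤₚ.+-identityʳ _) (ℤₚ.+-identityʳ _)

    target⇒occupied : ∀ v → isTarget v ≡ true → v ≢ q → occupied v ≡ true
    target⇒occupied v target v≢q rewrite ≢⇒≡ᵇ≡false v≢q = target

    nontarget⇒unoccupied : ∀ v → isTarget v ≡ false → occupied v ≡ false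
    nontarget⇒unoccupied v ¬target with v ≡ᵇ q
    ... | true  = ⊥-elim (true≢false ¬target)
    ... | false = ¬target

  M2-column-below-c : ∀ v → v < n → sumR (suc c) n (λ w → M2 w v) ≡ colBelow v - χ (v ≡ᵇ j) + χ (v ≡ᵇ q)
  M2-column-below-c v v<n with ℕₚ.<-≤-connex v j | ℕₚ.<-≤-connex q v
  ... | inj₁ v<j | _ = trans (sumR-cong (suc c) n (λ w c<w w<n → RowBelowClosing.M2-left w c<w w<n v v<j))
                             (trans (colBelow-M1 v) (sym (untouched v (ℕₚ.<⇒≢ v<j) (ℕₚ.<⇒≢ (ℕₚ.<-trans v<j j<q)))))
  ... | inj₂ _ | inj₁ q<v = trans (sumR-cong (suc c) n (λ w c<w w<n → RowBelowClosing.M2-right w c<w w<n v q<v))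
                                  (trans (colBelow-M1 v) (sym (untouched v (ℕₚ.>⇒≢ (ℕₚ.<-trans j<q q<v)) (ℕₚ.>⇒≢ q<v))))
  ... | inj₂ j≤v | inj₂ v≤q with ℕₚ.m≤n⇒m<n∨m≡n j≤v
  ...   | inj₂ refl = trans (sumR-zero (suc c) n _ (λ w c<w w<n → RowBelowClosing.M2-j w c<w w<n))
                            (sym (trans (cong₂ (λ x y → x - y + χ (v ≡ᵇ q)) colBelow-j (χ-≡ᵇ {v} refl))
                                        (cong (1ℤ - 1ℤ +_) (χ-≢ᵇ (ℕₚ.<⇒≢ j<q)))))
  ...   | inj₁ j<v with true⊎false (isTarget v)
  ...     | inj₂ ¬target = trans (sumR-zero (suc c) n _ (λ w c<w w<n → RowBelowClosing.M2-nontarget w c<w w<n v j<v v≤q ¬target))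
                                 (sym (trans (untouched v (ℕₚ.>⇒≢ j<v) v≢q) (colBelow-unoccupied v (nontarget⇒unoccupied v ¬target))))
    where
    v≢q : v ≢ q
    v≢q refl = true≢false (trans (sym isTarget-q) ¬target)
  ...     | inj₁ target = trans (sumR-cong (suc c) n (λ w c<w w<n → RowBelowClosing.M2-target w c<w w<n v j<v v≤q target))
                                (trans (colBelow-M1 (prevOcc v)) (trans (colBelow-prevOcc v j<v v≤q) (sym new-column)))
    where
    new-column : colBelow v - χ (v ≡ᵇ j) + χ (v ≡ᵇ q) ≡ 1ℤ
    new-column with v ℕ.≟ q
    ... | yes refl = trans (cong₂ (λ x y → x - y + χ (v ≡ᵇ v)) colBelow-q (χ-≢ᵇ (ℕₚ.>⇒≢ j<v))) (cong (λ b → 0ℤ - 0ℤ + χ b) (≡ᵇ-refl v))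
    ... | no  v≢q  = trans (untouched v (ℕₚ.>⇒≢ j<v) v≢q) (colBelow-occupied v (ℕₚ.>⇒≢ j<v) v<n (target⇒occupied v target v≢q))

  hits-below-c : ∀ lo hi → hi ≤ n → hits ρδ (suc c) n lo hi ≡ hits ρ (suc c) n lo hi + correction lo hi
  hits-below-c lo hi hi≤n = begin
    hits ρδ (suc c) n lo hi
      ≡⟨ sumR-cong (suc c) n (λ w _ _ → sym (sumR-χ≡ᵇ lo hi (ρδ w))) ⟩
    sumR (suc c) n (λ w → sumR lo hi (λ v → χ (v ≡ᵇ ρδ w)))
      ≡⟨ sumR-swap (suc c) n lo hi _ ⟩
    sumR lo hi (λ v → sumR (suc c) n (λ w → χ (v ≡ᵇ ρδ w)))
      ≡⟨ sumR-cong lo hi (λ v _ v<hi → trans (sumR-cong (suc c) n (λ w c<w w<n → ρδ-row w v c<w w<n))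
                                             (M2-column-below-c v (ℕₚ.<-≤-trans v<hi hi≤n))) ⟩
    sumR lo hi (λ v → colBelow v - χ (v ≡ᵇ j) + χ (v ≡ᵇ q))
      ≡⟨ trans (sumR-+ lo hi _ _) (cong₂ _+_ (sumR-- lo hi _ _) (sumR-χ≡ᵇ lo hi q)) ⟩
    sumR lo hi colBelow - sumR lo hi (λ v → χ (v ≡ᵇ j)) + χ (inRange lo hi q)
      ≡⟨ cong₂ (λ a b → a - b + χ (inRange lo hi q)) columns (sumR-χ≡ᵇ lo hi j) ⟩
    hits ρ (suc c) n lo hi - χ (inRange lo hi j) + χ (inRange lo hi q)
      ≡⟨ regroup (hits ρ (suc c) n lo hi) (χ (inRange lo hi q)) (χ (inRange lo hi j)) ⟩
    hits ρ (suc c) n lo hi + correction lo hi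
      ∎
    where
    open ≡-Reasoning
    ρδ-row : ∀ w v → c < w → w < n → χ (v ≡ᵇ ρδ w) ≡ M2 w v
    ρδ-row w v c<w w<n = trans (cong (λ z → χ (v ≡ᵇ z)) (ρδ-below-c w c<w)) (sym (RowBelowClosing.M2-below-c w c<w w<n v))
    columns : sumR lo hi colBelow ≡ hits ρ (suc c) n lo hi
    columns = trans (sumR-swap lo hi (suc c) n _) (M-rectangle-below-c (suc c) n lo hi ℕₚ.≤-refl ℕₚ.≤-refl hi≤n)
    regroup : ∀ a b d → a - d + b ≡ a + (b - d)
    regroup = solve-∀

  hits-from : ∀ r lo hi → r ≤ suc k → hi ≤ n → hits ρδ r n lo hi ≡ hits ρ r n lo hi + correction lo hi
  hits-from r lo hi r≤1+k hi≤n = begin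
    hits ρδ r n lo hi                                                 ≡⟨ split ⟩
    hits ρδ r (suc c) lo hi + hits ρδ (suc c) n lo hi                 ≡⟨ cong₂ _+_ (sum-upto-c r r≤1+k (χ ∘ inRange lo hi)) (hits-below-c lo hi hi≤n) ⟩
    hits ρ r (suc c) lo hi + (hits ρ (suc c) n lo hi + correction lo hi) ≡⟨ sym (ℤₚ.+-assoc (hits ρ r (suc c) lo hi) _ _) ⟩
    hits ρ r (suc c) lo hi + hits ρ (suc c) n lo hi + correction lo hi ≡⟨ cong (_+ correction lo hi) (sym split) ⟩
    hits ρ r n lo hi + correction lo hi                               ∎
    where
    open ≡-Reasoning
    split : ∀ {f} → hits f r n lo hi ≡ hits f r (suc c) lo hi + hits f (suc c) n lo hi
    split {f} = sumR-split r (suc c) n (λ u → χ (inRange lo hi (f u))) (ℕₚ.≤-trans r≤1+k (s≤s (ℕₚ.<⇒≤ k<c))) c<n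

  -- τ is increasing on the columns of the ones below the closing row.
  inversions-below-c : inversions ρδ (suc c) n ≡ inversions ρ (suc c) n
  inversions-below-c = sumR-cong (suc c) n (λ u c<u u<n → sumR-cong (suc u) n (λ w u<w w<n →
    let c<w = ℕₚ.<-trans c<u u<w in
    trans (cong₂ (λ a b → χ (a <ᵇ b)) (ρδ-below-c w c<w) (ρδ-below-c u c<u))
          (χ-τ-<ᵇ (ρ u) (ρ w) (displaceable-below-c u c<u u<n) (displaceable-below-c w c<w w<n)
                  (λ ρu≡ρw → ℕₚ.<-irrefl (ρ-injective-below-c u w c<u u<n c<w w<n ρu≡ρw) u<w))))

  enclosedRight : ℤ
  enclosedRight = sumR (suc k) c (λ u → χ (j <ᵇ ρ u))

  private
    inversions-split₃ : ∀ f → inversions f 0 n ≡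
      inversions f 0 (suc k) + inversions f (suc k) (suc c) + crossInversions f 0 (suc k) (suc c)
        + inversions f (suc c) n + crossInversions f 0 (suc c) n
    inversions-split₃ f =
      trans (inversions-split f 0 (suc c) n z≤n c<n)
            (cong (λ z → z + inversions f (suc c) n + crossInversions f 0 (suc c) n)
                  (inversions-split f 0 (suc k) (suc c) z≤n (s≤s (ℕₚ.<⇒≤ k<c))))

  inversions-δ : inversions ρδ 0 n ≡ inversions ρ 0 n - enclosedRight + sumR 0 (suc c) (correction 0 ∘ ρ)
  inversions-δ = begin
    inversions ρδ 0 n
      ≡⟨ inversions-split₃ ρδ ⟩
    inversions ρδ 0 (suc k) + inversions ρδ (suc k) (suc c) + crossInversions ρδ 0 (suc k) (suc c)
      + inversions ρδ (suc c) n + crossInversions ρδ 0 (suc c) n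
      ≡⟨ cong₅ upper enclosed-inversions upper-enclosed inversions-below-c crossing-c ⟩
    inversions ρ 0 (suc k) + (inversions ρ (suc k) (suc c) - enclosedRight) + crossInversions ρ 0 (suc k) (suc c)
      + inversions ρ (suc c) n + (crossInversions ρ 0 (suc c) n + corrections)
      ≡⟨ regroup (inversions ρ 0 (suc k)) (inversions ρ (suc k) (suc c)) (crossInversions ρ 0 (suc k) (suc c))
                 (inversions ρ (suc c) n) (crossInversions ρ 0 (suc c) n) enclosedRight corrections ⟩
    inversions ρ 0 (suc k) + inversions ρ (suc k) (suc c) + crossInversions ρ 0 (suc k) (suc c)
      + inversions ρ (suc c) n + crossInversions ρ 0 (suc c) n - enclosedRight + corrections
      ≡⟨ cong (λ z → z - enclosedRight + corrections) (sym (inversions-split₃ ρ)) ⟩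
    inversions ρ 0 n - enclosedRight + corrections
      ∎
    where
    open ≡-Reasoning
    corrections : ℤ
    corrections = sumR 0 (suc c) (correction 0 ∘ ρ)
    cong₅ : ∀ {a₁ b₁ a₂ b₂ a₃ b₃ a₄ b₄ a₅ b₅ : ℤ} → a₁ ≡ b₁ → a₂ ≡ b₂ → a₃ ≡ b₃ → a₄ ≡ b₄ → a₅ ≡ b₅ →
      a₁ + a₂ + a₃ + a₄ + a₅ ≡ b₁ + b₂ + b₃ + b₄ + b₅
    cong₅ refl refl refl refl refl = refl
    upper : inversions ρδ 0 (suc k) ≡ inversions ρ 0 (suc k)
    upper = sumR-cong 0 (suc k) (λ u _ u≤k → sumR-cong (suc u) (suc k) (λ w _ w≤k →
              cong₂ (λ a b → χ (a <ᵇ b)) (ρδ-upto-k w (ℕₚ.≤-pred w≤k)) (ρδ-upto-k u (ℕₚ.≤-pred u≤k))))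
    upper-enclosed : crossInversions ρδ 0 (suc k) (suc c) ≡ crossInversions ρ 0 (suc k) (suc c)
    upper-enclosed = sumR-cong 0 (suc k) (λ u _ u≤k →
      trans (cong (λ z → sumR (suc k) (suc c) (λ w → χ (ρδ w <ᵇ z))) (ρδ-upto-k u (ℕₚ.≤-pred u≤k)))
            (enclosed-sum (λ t → χ (t <ᵇ ρ u))))
    below : ℕ → ℤ
    below y = hits ρ (suc c) n 0 y
    crossing-c : crossInversions ρδ 0 (suc c) n ≡ crossInversions ρ 0 (suc c) n + corrections
    crossing-c = begin
      sumR 0 (suc c) (λ u → hits ρδ (suc c) n 0 (ρδ u))
        ≡⟨ sumR-cong 0 (suc c) (λ u _ u≤c → hits-below-c 0 (ρδ u) (ℕₚ.<⇒≤ (ρδ<n u (ℕₚ.<-≤-trans u≤c c<n)))) ⟩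
      sumR 0 (suc c) (λ u → below (ρδ u) + correction 0 (ρδ u))
        ≡⟨ sum-upto-c 0 z≤n (λ y → below y + correction 0 y) ⟩
      sumR 0 (suc c) (λ u → below (ρ u) + correction 0 (ρ u))
        ≡⟨ sumR-+ 0 (suc c) (below ∘ ρ) (correction 0 ∘ ρ) ⟩
      crossInversions ρ 0 (suc c) n + corrections
        ∎
    regroup : ∀ a₁ a₂ a₃ a₄ a₅ e s → a₁ + (a₂ - e) + a₃ + a₄ + (a₅ + s) ≡ a₁ + a₂ + a₃ + a₄ + a₅ - e + s
    regroup = solve-∀

  rowsBelow : ℕ → ℕ → ℤ
  rowsBelow u v = hits ρ (suc u) n 0 v + χ (u <ᵇ c) * correction 0 v

  M-rows-below : ∀ u v → v ≤ n → rectSum M (suc u) n 0 v ≡ rowsBelow u v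
  M-rows-below u v v≤n with ℕₚ.<-≤-connex u c
  ... | inj₁ u<c = trans (M-rectangle (suc u) n 0 v u<c c<n ℕₚ.≤-refl v≤n)
                         (cong (hits ρ (suc u) n 0 v +_) (sym (trans (cong (λ b → χ b * correction 0 v) (<⇒<ᵇ≡true u<c))
                                                                     (ℤₚ.*-identityˡ _))))
  ... | inj₂ c≤u = trans (M-rectangle-below-c (suc u) n 0 v (s≤s c≤u) ℕₚ.≤-refl v≤n)
                         (sym (trans (cong (λ b → hits ρ (suc u) n 0 v + χ b * correction 0 v) (≤⇒<ᵇ≡false c≤u))
                                     (trans (cong (hits ρ (suc u) n 0 v +_) (ℤₚ.*-zeroˡ (correction 0 v))) (ℤₚ.+-identityʳ _))))

  closingRowTerm : ℤ
  closingRowTerm = rowsBelow c q - rowsBelow c j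

  M-row-contribution : ∀ u → u < n →
    sumR 0 n (λ v → M u v * rowsBelow u v) ≡ rowsBelow u (ρ u) + χ (u ≡ᵇ c) * closingRowTerm
  M-row-contribution u u<n with u ℕ.≟ c
  ... | no u≢c = begin
    sumR 0 n (λ v → M u v * rowsBelow u v)                  ≡⟨ sumR-cong 0 n (λ v _ _ → cong (_* rowsBelow u v) (row u u<n u≢c v)) ⟩
    sumR 0 n (λ v → χ (v ≡ᵇ ρ u) * rowsBelow u v)           ≡⟨ sumR-χ≡ᵇ* 0 n (ρ u) (rowsBelow u) z≤n (ρ<n u u<n) ⟩
    rowsBelow u (ρ u)                                       ≡⟨ sym (ℤₚ.+-identityʳ _) ⟩
    rowsBelow u (ρ u) + 0ℤ                                  ≡⟨ cong (λ z → rowsBelow u (ρ u) + z * closingRowTerm) (sym (χ-≢ᵇ u≢c)) ⟩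
    rowsBelow u (ρ u) + χ (u ≡ᵇ c) * closingRowTerm         ∎
    where open ≡-Reasoning
  ... | yes refl = begin
    sumR 0 n (λ v → M u v * rowsBelow u v)
      ≡⟨ sumR-cong 0 n (λ v _ _ → trans (cong (_* rowsBelow u v) (closing-row v))
                                        (distrib (χ (v ≡ᵇ ρ u)) (χ (v ≡ᵇ q)) (χ (v ≡ᵇ j)) (rowsBelow u v))) ⟩
    sumR 0 n (λ v → χ (v ≡ᵇ ρ u) * rowsBelow u v + χ (v ≡ᵇ q) * rowsBelow u v - χ (v ≡ᵇ j) * rowsBelow u v)
      ≡⟨ trans (sumR-- 0 n _ _) (cong (_- sumR 0 n (λ v → χ (v ≡ᵇ j) * rowsBelow u v)) (sumR-+ 0 n _ _)) ⟩
    sumR 0 n (λ v → χ (v ≡ᵇ ρ u) * rowsBelow u v) + sumR 0 n (λ v → χ (v ≡ᵇ q) * rowsBelow u v)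
      - sumR 0 n (λ v → χ (v ≡ᵇ j) * rowsBelow u v)
      ≡⟨ cong₂ _-_ (cong₂ _+_ (sumR-χ≡ᵇ* 0 n (ρ u) (rowsBelow u) z≤n ρc<n) (sumR-χ≡ᵇ* 0 n q (rowsBelow u) z≤n q<n))
                   (sumR-χ≡ᵇ* 0 n j (rowsBelow u) z≤n j<n) ⟩
    rowsBelow u (ρ u) + rowsBelow u q - rowsBelow u j
      ≡⟨ regroup (rowsBelow u (ρ u)) (rowsBelow u q) (rowsBelow u j) ⟩
    rowsBelow u (ρ u) + 1ℤ * closingRowTerm
      ≡⟨ cong (λ z → rowsBelow u (ρ u) + z * closingRowTerm) (sym (χ-≡ᵇ {u} refl)) ⟩
    rowsBelow u (ρ u) + χ (u ≡ᵇ u) * closingRowTerm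
      ∎
    where
    open ≡-Reasoning
    distrib : ∀ a b d r → (a + b - d) * r ≡ a * r + b * r - d * r
    distrib = solve-∀
    regroup : ∀ x y z → x + y - z ≡ x + 1ℤ * (y - z)
    regroup = solve-∀

  inv-M : inv n M ≡ inversions ρ 0 n + sumR 0 c (correction 0 ∘ ρ) + closingRowTerm
  inv-M = begin
    inv n M
      ≡⟨ sumR-cong 0 n (λ u _ u<n → trans (sumR-cong 0 n (λ v _ v<n → cong (M u v *_) (M-rows-below u v (ℕₚ.<⇒≤ v<n))))
                                          (M-row-contribution u u<n)) ⟩
    sumR 0 n (λ u → rowsBelow u (ρ u) + χ (u ≡ᵇ c) * closingRowTerm)
      ≡⟨ trans (sumR-+ 0 n _ _) (cong₂ _+_ (sumR-+ 0 n _ _) (sumR-χ≡ᵇ* 0 n c (λ _ → closingRowTerm) z≤n c<n)) ⟩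
    inversions ρ 0 n + sumR 0 n (λ u → χ (u <ᵇ c) * correction 0 (ρ u)) + closingRowTerm
      ≡⟨ cong (λ z → inversions ρ 0 n + z + closingRowTerm) rows-above-c ⟩
    inversions ρ 0 n + sumR 0 c (correction 0 ∘ ρ) + closingRowTerm
      ∎
    where
    open ≡-Reasoning
    rows-above-c : sumR 0 n (λ u → χ (u <ᵇ c) * correction 0 (ρ u)) ≡ sumR 0 c (correction 0 ∘ ρ)
    rows-above-c = begin
      sumR 0 n (λ u → χ (u <ᵇ c) * correction 0 (ρ u))
        ≡⟨ sumR-split 0 c n _ z≤n (ℕₚ.<⇒≤ c<n) ⟩
      sumR 0 c (λ u → χ (u <ᵇ c) * correction 0 (ρ u)) + sumR c n (λ u → χ (u <ᵇ c) * correction 0 (ρ u))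
        ≡⟨ cong₂ _+_ (sumR-cong 0 c (λ u _ u<c → trans (cong (λ b → χ b * correction 0 (ρ u)) (<⇒<ᵇ≡true u<c)) (ℤₚ.*-identityˡ _)))
                     (sumR-zero c n _ (λ u c≤u _ → trans (cong (λ b → χ b * correction 0 (ρ u)) (≤⇒<ᵇ≡false c≤u))
                                                        (ℤₚ.*-zeroˡ (correction 0 (ρ u))))) ⟩
      sumR 0 c (correction 0 ∘ ρ) + 0ℤ
        ≡⟨ ℤₚ.+-identityʳ _ ⟩
      sumR 0 c (correction 0 ∘ ρ)
        ∎

  private
    inRange-right : ∀ t → t < n → inRange (suc j) n t ≡ (j <ᵇ t)
    inRange-right t t<n rewrite <⇒<ᵇ≡true t<n = ∧-identityʳ (j <ᵇ t)

  -- In the neutral case c = k + 1 both sides are empty sums.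
  chargeStat≡enclosedRight : chargeStat n M k c j ≡ enclosedRight
  chargeStat≡enclosedRight with suc k ≡ᵇ c | ≡ᵇ-reflects-≡ (suc k) c
  ... | true  | ofʸ 1+k≡c = sym (sumR-empty (suc k) c _ (ℕₚ.≤-reflexive (sym 1+k≡c)))
  ... | false | _         = trans (M-rectangle-above-c (suc k) c (suc j) n ℕₚ.≤-refl ℕₚ.≤-refl)
                                  (sumR-cong (suc k) c (λ u _ u<c → cong χ (inRange-right (ρ u) (ρ<n u (ℕₚ.<-trans u<c c<n)))))

  closingRowTerm≡ : closingRowTerm ≡ closingStat n M c j q + 1ℤ
  closingRowTerm≡ = begin
    rowsBelow c q - rowsBelow c j
      ≡⟨ cong₂ _-_ (no-correction q) (no-correction j) ⟩
    hits ρ (suc c) n 0 q - hits ρ (suc c) n 0 j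
      ≡⟨ sym (sumR-- (suc c) n _ _) ⟩
    sumR (suc c) n (λ w → χ (ρ w <ᵇ q) - χ (ρ w <ᵇ j))
      ≡⟨ sumR-cong (suc c) n (λ w _ _ → split-at-j (ρ w)) ⟩
    sumR (suc c) n (λ w → χ (inRange (suc j) q (ρ w)) + χ (j ≡ᵇ ρ w))
      ≡⟨ sumR-+ (suc c) n _ _ ⟩
    hits ρ (suc c) n (suc j) q + sumR (suc c) n (λ w → χ (j ≡ᵇ ρ w))
      ≡⟨ cong₂ _+_ (sym (M-rectangle-below-c (suc c) n (suc j) q ℕₚ.≤-refl ℕₚ.≤-refl (ℕₚ.<⇒≤ q<n)))
                   (trans (sumR-cong (suc c) n (λ w c<w w<n → sym (row w w<n (ℕₚ.>⇒≢ c<w) j))) colBelow-j) ⟩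
    closingStat n M c j q + 1ℤ
      ∎
    where
    open ≡-Reasoning
    no-correction : ∀ v → rowsBelow c v ≡ hits ρ (suc c) n 0 v
    no-correction v = trans (cong (λ b → hits ρ (suc c) n 0 v + χ b * correction 0 v) (≤⇒<ᵇ≡false {c} {c} ℕₚ.≤-refl))
                            (trans (cong (hits ρ (suc c) n 0 v +_) (ℤₚ.*-zeroˡ (correction 0 v))) (ℤₚ.+-identityʳ _))
    split-at-j : ∀ t → χ (t <ᵇ q) - χ (t <ᵇ j) ≡ χ (inRange (suc j) q t) + χ (j ≡ᵇ t)
    split-at-j t with ℕₚ.<-cmp t j
    ... | tri< t<j _ _ rewrite <⇒<ᵇ≡true t<j | <⇒<ᵇ≡true (ℕₚ.<-trans t<j j<q)
                             | <⇒≤ᵇ≡false {suc j} {t} (ℕₚ.<-trans t<j (ℕₚ.n<1+n j)) | ≢⇒≡ᵇ≡false (ℕₚ.>⇒≢ t<j) = refl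
    ... | tri≈ _ refl _ rewrite ≤⇒<ᵇ≡false {t} {t} ℕₚ.≤-refl | <⇒<ᵇ≡true j<q | ≡ᵇ-refl t = refl
    ... | tri> _ _ j<t rewrite ≤⇒<ᵇ≡false {t} {j} (ℕₚ.<⇒≤ j<t) | ≤⇒≤ᵇ≡true j<t | ≢⇒≡ᵇ≡false (ℕₚ.<⇒≢ j<t) = refl

  correction-ρc : correction 0 (ρ c) ≡ 0ℤ
  correction-ρc rewrite ≤⇒<ᵇ≡false {q} {ρ c} (ℕₚ.<⇒≤ (ℕₚ.<-trans ρc<j j<q)) | ≤⇒<ᵇ≡false {j} {ρ c} (ℕₚ.<⇒≤ ρc<j) = refl

  xStat≡ : xStat n M k j ≡ hits ρ (suc k) n (suc j) n + 1ℤ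
  xStat≡ = trans (M-rectangle (suc k) n (suc j) n k<c c<n ℕₚ.≤-refl ℕₚ.≤-refl) (cong (hits ρ (suc k) n (suc j) n +_) q-not-j)
    where
    q-not-j : correction (suc j) n ≡ 1ℤ
    q-not-j rewrite ≤⇒≤ᵇ≡true j<q | <⇒<ᵇ≡true q<n | <⇒≤ᵇ≡false {suc j} {j} (ℕₚ.n<1+n j) = refl

  closing+charge<x : closingStat n M c j q + chargeStat n M k c j <ℤ xStat n M k j
  closing+charge<x = subst (closingStat n M c j q + chargeStat n M k c j <ℤ_) (sym xStat≡)
    (ℤₚ.≤-<-trans (begin
      closingStat n M c j q + chargeStat n M k c j
        ≡⟨ cong₂ _+_ (M-rectangle-below-c (suc c) n (suc j) q ℕₚ.≤-refl ℕₚ.≤-refl (ℕₚ.<⇒≤ q<n))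
                     (trans chargeStat≡enclosedRight
                            (sumR-cong (suc k) c (λ u _ u<c → cong χ (sym (inRange-right (ρ u) (ρ<n u (ℕₚ.<-trans u<c c<n))))))) ⟩
      hits ρ (suc c) n (suc j) q + hits ρ (suc k) c (suc j) n
        ≤⟨ ℤₚ.+-monoˡ-≤ (hits ρ (suc k) c (suc j) n) (sumR-mono (suc c) n _ _ (λ w _ _ → χ-mono (ρ w))) ⟩
      hits ρ (suc c) n (suc j) n + hits ρ (suc k) c (suc j) n
        ≡⟨ ℤₚ.+-comm (hits ρ (suc c) n (suc j) n) (hits ρ (suc k) c (suc j) n) ⟩
      hits ρ (suc k) c (suc j) n + hits ρ (suc c) n (suc j) n
        ≡⟨ sym split ⟩
      hits ρ (suc k) n (suc j) n
        ∎) (ℤₚ.suc[i]≤j⇒i<j (ℤₚ.≤-reflexive (ℤₚ.+-comm 1ℤ (hits ρ (suc k) n (suc j) n)))))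
    where
    open ℤₚ.≤-Reasoning
    χ-mono : ∀ t → χ (inRange (suc j) q t) ≤ℤ χ (inRange (suc j) n t)
    χ-mono t with suc j ≤ᵇ t | t <ᵇ q | ℕₚ.<ᵇ-reflects-< t q
    ... | false | _     | _        = ℤₚ.≤-refl
    ... | true  | false | _        = χ-nonneg (t <ᵇ n)
    ... | true  | true  | ofʸ t<q rewrite <⇒<ᵇ≡true (ℕₚ.<-trans t<q q<n) = ℤₚ.≤-refl
    ρc-left : χ (inRange (suc j) n (ρ c)) ≡ 0ℤ
    ρc-left rewrite <⇒≤ᵇ≡false {suc j} {ρ c} (ℕₚ.<-trans ρc<j (ℕₚ.n<1+n j)) = refl
    split : hits ρ (suc k) n (suc j) n ≡ hits ρ (suc k) c (suc j) n + hits ρ (suc c) n (suc j) n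
    split = trans (sumR-split (suc k) c n _ k<c (ℕₚ.<⇒≤ c<n))
                  (cong (hits ρ (suc k) c (suc j) n +_) (sumR-drop-zero-head c n _ (ℕₚ.<⇒≤ c<n) ρc-left))

  leading-column : ∀ L → IsLeadingColumn M k j L → L ≡ ρ (nextLeft k)
  leading-column L (L<j , w , k<w , MwL≡1 , none-before) with ℕₚ.<-cmp w (nextLeft k)
  ... | tri< w<next _ _ = ⊥-elim (ℕₚ.<-asym L<j (subst (j <_) (sym L≡ρw) (Segment.j<ρ-inside (inj₁ refl) k<c w k<w w<next)))
    where
    L≡ρw : L ≡ ρ w
    L≡ρw = left-one-is-ρ w L (ℕₚ.<-trans (ℕₚ.<-≤-trans w<next (nextLeft≤c k k<c)) c<n) L<j MwL≡1
  ... | tri≈ _ refl _ = left-one-is-ρ w L (nextLeft<n k k<c) L<j MwL≡1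
  ... | tri> _ _ next<w = ⊥-elim (none-before (nextLeft k) (ρ (nextLeft k)) (<nextLeft k) next<w (ρ-nextLeft<j k k<c)
                                              (M-ρ≡1 (nextLeft k) (nextLeft<n k k<c)))

  module MatrixOfρδ (P : ℕMat)
    (P-matrix      : ∀ u v → u < n → v < n → P u v ≡ χ (v ≡ᵇ ρδ u))
    (P-row-outside : ∀ u v → n ≤ u → P u v ≡ 0ℤ)
    (P-col-outside : ∀ u v → n ≤ v → P u v ≡ 0ℤ) where

    P-rectangle : ∀ r₀ r₁ lo hi → r₁ ≤ n → hi ≤ n → rectSum P r₀ r₁ lo hi ≡ hits ρδ r₀ r₁ lo hi
    P-rectangle r₀ r₁ lo hi r₁≤n hi≤n = sumR-cong r₀ r₁ (λ u _ u<r₁ →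
      trans (sumR-cong lo hi (λ v _ v<hi → P-matrix u v (ℕₚ.<-≤-trans u<r₁ r₁≤n) (ℕₚ.<-≤-trans v<hi hi≤n))) (sumR-χ≡ᵇ lo hi (ρδ u)))

    rectangles-agree : ∀ r lo hi → r ≤ suc k → hi ≤ n → rectSum P r n lo hi ≡ rectSum M r n lo hi
    rectangles-agree r lo hi r≤1+k hi≤n = begin
      rectSum P r n lo hi                     ≡⟨ P-rectangle r n lo hi ℕₚ.≤-refl hi≤n ⟩
      hits ρδ r n lo hi                       ≡⟨ hits-from r lo hi r≤1+k hi≤n ⟩
      hits ρ r n lo hi + correction lo hi     ≡⟨ sym (M-rectangle r n lo hi (ℕₚ.≤-trans r≤1+k k<c) c<n ℕₚ.≤-refl hi≤n) ⟩
      rectSum M r n lo hi                     ∎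
      where open ≡-Reasoning

    P-column-sum : ∀ v → v < n → sumR 0 n (λ u → P u v) ≡ 1ℤ
    P-column-sum v v<n = begin
      sumR 0 n (λ u → P u v)               ≡⟨ sumR-cong 0 n (λ u _ _ → sym (sumR-single v (P u))) ⟩
      rectSum P 0 n v (suc v)              ≡⟨ rectangles-agree 0 v (suc v) z≤n v<n ⟩
      rectSum M 0 n v (suc v)              ≡⟨ sumR-cong 0 n (λ u _ _ → sumR-single v (M u)) ⟩
      sumR 0 n (λ u → M u v)               ≡⟨ proj₁ (cols v v<n) ⟩
      1ℤ                                   ∎
      where open ≡-Reasoning

    inv-P : inv n P ≡ inversions ρδ 0 n
    inv-P = sumR-cong 0 n (λ u _ u<n →
      trans (sumR-cong 0 n (λ v _ v<n → cong₂ _*_ (P-matrix u v u<n v<n) (P-rectangle (suc u) n 0 v ℕₚ.≤-refl (ℕₚ.<⇒≤ v<n))))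
            (sumR-χ≡ᵇ* 0 n (ρδ u) (hits ρδ (suc u) n 0) z≤n (ρδ<n u u<n)))

    inv-M≡inv-P+closing+1+charge : inv n M ≡ inv n P + closingStat n M c j q + 1ℤ + chargeStat n M k c j
    inv-M≡inv-P+closing+1+charge = begin
      inv n M
        ≡⟨ trans inv-M (cong (inversions ρ 0 n + corrections +_) closingRowTerm≡) ⟩
      inversions ρ 0 n + corrections + (closingStat n M c j q + 1ℤ)
        ≡⟨ regroup (inversions ρ 0 n) enclosedRight corrections (closingStat n M c j q) ⟩
      inversions ρ 0 n - enclosedRight + (corrections + 0ℤ) + closingStat n M c j q + 1ℤ + enclosedRight
        ≡⟨ cong₂ (λ a b → inversions ρ 0 n - enclosedRight + (corrections + a) + closingStat n M c j q + 1ℤ + b)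
                 (sym correction-ρc) (sym chargeStat≡enclosedRight) ⟩
      inversions ρ 0 n - enclosedRight + (corrections + correction 0 (ρ c)) + closingStat n M c j q + 1ℤ + chargeStat n M k c j
        ≡⟨ cong (λ z → inversions ρ 0 n - enclosedRight + z + closingStat n M c j q + 1ℤ + chargeStat n M k c j)
                (sym (sumR-snoc 0 c (correction 0 ∘ ρ) z≤n)) ⟩
      inversions ρ 0 n - enclosedRight + sumR 0 (suc c) (correction 0 ∘ ρ) + closingStat n M c j q + 1ℤ + chargeStat n M k c j
        ≡⟨ cong (λ z → z + closingStat n M c j q + 1ℤ + chargeStat n M k c j) (sym (trans inv-P inversions-δ)) ⟩
      inv n P + closingStat n M c j q + 1ℤ + chargeStat n M k c j
        ∎
      where
      open ≡-Reasoning
      corrections : ℤ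
      corrections = sumR 0 c (correction 0 ∘ ρ)
      regroup : ∀ i e s x → i + s + (x + 1ℤ) ≡ i - e + (s + 0ℤ) + x + 1ℤ + e
      regroup = solve-∀

    xStat-preserved : xStat n M k j ≡ xStat n P k j
    xStat-preserved = sym (rectangles-agree (suc k) (suc j) n ℕₚ.≤-refl ℕₚ.≤-refl)

    rows-upto-k-preserved : ∀ u v → u ≤ k → M u v ≡ P u v
    rows-upto-k-preserved u v u≤k with ℕₚ.<-≤-connex v n
    ... | inj₂ n≤v = trans (col-outside u v n≤v) (sym (P-col-outside u v n≤v))
    ... | inj₁ v<n = begin
      M u v           ≡⟨ row u u<n (ℕₚ.<⇒≢ (ℕₚ.≤-<-trans u≤k k<c)) v ⟩
      χ (v ≡ᵇ ρ u)    ≡⟨ cong (λ z → χ (v ≡ᵇ z)) (sym (ρδ-upto-k u u≤k)) ⟩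
      χ (v ≡ᵇ ρδ u)   ≡⟨ sym (P-matrix u v u<n v<n) ⟩
      P u v           ∎
      where
      open ≡-Reasoning
      u<n : u < n
      u<n = ℕₚ.≤-<-trans u≤k k<n

    P-one : ∀ u v → P u v ≡ 1ℤ → v ≡ ρδ u
    P-one u v Puv≡1 with ℕₚ.<-≤-connex u n | ℕₚ.<-≤-connex v n
    ... | inj₂ n≤u | _        = ⊥-elim (1≢0 (trans (sym Puv≡1) (P-row-outside u v n≤u)))
    ... | inj₁ _   | inj₂ n≤v = ⊥-elim (1≢0 (trans (sym Puv≡1) (P-col-outside u v n≤v)))
    ... | inj₁ u<n | inj₁ v<n = χ-≡ᵇ⁻¹ (trans (sym (P-matrix u v u<n v<n)) Puv≡1)

    P-row-k : ∀ j′ → P k j′ ≡ 1ℤ → j′ ≡ j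
    P-row-k j′ Pkj′≡1 = trans (P-one k j′ Pkj′≡1) (trans (ρδ-upto-k k ℕₚ.≤-refl) ρk≡j)

    P-row-1+k : ∀ m → P (suc k) m ≡ 1ℤ → m ≡ ρ (nextLeft k)
    P-row-1+k m P1+k,m≡1 = trans (P-one (suc k) m P1+k,m≡1) (ρδ-segment-head (inj₁ refl) k<c)

    row-1+k-left-of-row-k : ∀ j′ m → P k j′ ≡ 1ℤ → P (suc k) m ≡ 1ℤ → m < j′
    row-1+k-left-of-row-k j′ m Pkj′≡1 P1+k,m≡1 rewrite P-row-k j′ Pkj′≡1 | P-row-1+k m P1+k,m≡1 = ρ-nextLeft<j k k<c

    ellStat-preserved : ∀ L j′ m → IsLeadingColumn M k j L → P k j′ ≡ 1ℤ → P (suc k) m ≡ 1ℤ →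
      ellStat n M k L j ≡ ellStat n P k m j′
    ellStat-preserved L j′ m leading Pkj′≡1 P1+k,m≡1
      rewrite P-row-k j′ Pkj′≡1 | P-row-1+k m P1+k,m≡1 | sym (leading-column L leading) =
      sym (rectangles-agree (suc k) (suc L) j ℕₚ.≤-refl (ℕₚ.<⇒≤ j<n))

    ρδ-onto : ∀ v → v < n → ∃ λ u → u < n × ρδ u ≡ v
    ρδ-onto v v<n = u , u<n , sym (χ-≡ᵇ⁻¹ (χ≢0⇒≡1 (v ≡ᵇ ρδ u) (Puv≢0 ∘ trans (P-matrix u v u<n v<n))))
      where
      witness : ∃ λ u → 0 ≤ u × u < n × P u v ≢ 0ℤ
      witness = sumR-nonzero 0 n (λ u → P u v) (1≢0 ∘ trans (sym (P-column-sum v v<n)))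
      u : ℕ
      u = proj₁ witness
      u<n : u < n
      u<n = proj₁ (proj₂ (proj₂ witness))
      Puv≢0 : P u v ≢ 0ℤ
      Puv≢0 = proj₂ (proj₂ (proj₂ witness))
      χ≢0⇒≡1 : ∀ b → χ b ≢ 0ℤ → χ b ≡ 1ℤ
      χ≢0⇒≡1 true  _   = refl
      χ≢0⇒≡1 false χ≢0 = ⊥-elim (χ≢0 refl)

    ρδ-injective : ∀ u u′ → u < n → u′ < n → ρδ u ≡ ρδ u′ → u ≡ u′
    ρδ-injective u u′ u<n u′<n ρδu≡ρδu′ =
      sumR-ones-coincide 0 n (λ w → P w x) P-nonneg (P-column-sum x x<n) u u′ z≤n u<n z≤n u′<n
        (trans (P-matrix u x u<n x<n) (χ-≡ᵇ {x} refl)) (trans (P-matrix u′ x u′<n x<n) (χ-≡ᵇ ρδu≡ρδu′))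
      where
      x : ℕ
      x = ρδ u
      x<n : x < n
      x<n = ρδ<n u u<n
      P-nonneg : ∀ w → 0 ≤ w → w < n → 0ℤ ≤ℤ P w x
      P-nonneg w _ w<n = subst (0ℤ ≤ℤ_) (sym (P-matrix w x w<n x<n)) (χ-nonneg _)

permutation-matrix : ∀ {n} (P : Matrix n) (π : Fin n → Fin n) →
  (∀ u v → P u v ≡ (if does (π u Fin.≟ v) then 1ℤ else 0ℤ)) →
  (∀ v → ∃ λ u → π u ≡ v) → (∀ u u′ → π u ≡ π u′ → u ≡ u′) → IsPermutationMatrix P
permutation-matrix P π P≡ onto injective =
  permutation π (proj₁ ∘ onto) (proj₂ ∘ onto) (λ u → injective _ u (proj₂ (onto (π u)))) , P≡

module DischargeOf {n : ℕ} (A : Matrix n) {k c j q : ℕ} (S : OneNegative n (lift A) k c j q) where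
  open Structure S
  open Discharged S
  open Statistics S

  P : ℕMat
  P = lift (δ A k c j q)

  P-matrix : ∀ u v → u < n → v < n → P u v ≡ χ (v ≡ᵇ ρδ u)
  P-matrix u v u<n v<n = trans (lift-δ A k c j q u v u<n v<n) (Mδ-matrix u v u<n v<n)

  open MatrixOfρδ P P-matrix (lift-row-outside (δ A k c j q)) (lift-col-outside (δ A k c j q)) public

  π : Fin n → Fin n
  π u = fromℕ< (ρδ<n (toℕ u) (Finₚ.toℕ<n u))

  toℕ-π : ∀ u → toℕ (π u) ≡ ρδ (toℕ u)
  toℕ-π u = Finₚ.toℕ-fromℕ< _

  δ-is-permutation : IsPermutationMatrix (δ A k c j q)
  δ-is-permutation = permutation-matrix (δ A k c j q) π entries onto injective
    where
    entries : ∀ u v → δ A k c j q u v ≡ (if does (π u Fin.≟ v) then 1ℤ else 0ℤ)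
    entries u v with π u Fin.≟ v
    ... | yes refl = trans (Mδ-matrix (toℕ u) (toℕ (π u)) (Finₚ.toℕ<n u) (Finₚ.toℕ<n (π u))) (χ-≡ᵇ (toℕ-π u))
    ... | no  πu≢v = trans (Mδ-matrix (toℕ u) (toℕ v) (Finₚ.toℕ<n u) (Finₚ.toℕ<n v))
                           (χ-≢ᵇ (λ v≡ρδu → πu≢v (Finₚ.toℕ-injective (trans (toℕ-π u) (sym v≡ρδu)))))
    onto : ∀ v → ∃ λ u → π u ≡ v
    onto v = fromℕ< u<n , Finₚ.toℕ-injective (trans (toℕ-π (fromℕ< u<n)) (trans (cong ρδ (Finₚ.toℕ-fromℕ< u<n)) ρδu≡v))
      where
      preimage : ∃ λ u → u < n × ρδ u ≡ toℕ v
      preimage = ρδ-onto (toℕ v) (Finₚ.toℕ<n v)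
      u : ℕ
      u = proj₁ preimage
      u<n : u < n
      u<n = proj₁ (proj₂ preimage)
      ρδu≡v : ρδ u ≡ toℕ v
      ρδu≡v = proj₂ (proj₂ preimage)
    injective : ∀ u u′ → π u ≡ π u′ → u ≡ u′
    injective u u′ πu≡πu′ = Finₚ.toℕ-injective (ρδ-injective (toℕ u) (toℕ u′) (Finₚ.toℕ<n u) (Finₚ.toℕ<n u′)
      (trans (sym (toℕ-π u)) (trans (cong toℕ πu≡πu′) (toℕ-π u′))))

mainTheorem1 :
    (n : ℕ) → 1 ≤ n → (A : Matrix n) → InASM n 1 A →
    (k c j q : ℕ) →
    lift A c j ≡ -1ℤ →
    IsOpeningRow (lift A) k j →
    j < q → lift A c q ≡ 1ℤ →
    (IsPositive (lift A) k c j ⊎ IsNeutral (lift A) k c j) →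
      IsPermutationMatrix (δ A k c j q)
      × ((∀ u v → u ≤ k → lift A u v ≡ lift (δ A k c j q) u v)
         × r n (lift A) ≡ r n (lift (δ A k c j q)))
      × (∀ j′ m → lift (δ A k c j q) k j′ ≡ 1ℤ → lift (δ A k c j q) (suc k) m ≡ 1ℤ → m < j′)
      × (∀ L j′ m → IsLeadingColumn (lift A) k j L →
           lift (δ A k c j q) k j′ ≡ 1ℤ → lift (δ A k c j q) (suc k) m ≡ 1ℤ →
           ellStat n (lift A) k L j ≡ ellStat n (lift (δ A k c j q)) k m j′)
      × ((closingStat n (lift A) c j q + chargeStat n (lift A) k c j <ℤ xStat n (lift A) k j)
         × xStat n (lift A) k j ≡ xStat n (lift (δ A k c j q)) k j)
      × inv n (lift A) ≡ inv n (lift (δ A k c j q)) + closingStat n (lift A) c j q + 1ℤ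
                          + chargeStat n (lift A) k c j
-- Neither 1 ≤ n nor the case distinction positive/neutral is needed for the statement as formalised.
mainTheorem1 n _ A asm k c j q Acj≡-1 opening j<q Acq≡1 _ =
  δ-is-permutation , (rows-upto-k-preserved , r-preserved) , row-1+k-left-of-row-k , ellStat-preserved ,
  (closing+charge<x , xStat-preserved) , inv-M≡inv-P+closing+1+charge
  where
  S : OneNegative n (lift A) k c j q
  S = oneNegative n A asm k c j q Acj≡-1 opening j<q Acq≡1
  open Statistics S
  open DischargeOf A S
  r-preserved : r n (lift A) ≡ r n P
  r-preserved = cong (λ row → length (List.takeWhile (λ x → ¬? (x ℤ.≟ 1ℤ)) row))
                     (Listₚ.map-cong (λ v → rows-upto-k-preserved 0 v z≤n) (List.upTo n))
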